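{- Let $n,k,r\ge0$ be integers and $\alpha,\beta$ indeterminates. Then $$S(n,k;\alpha,\beta,r)=\sum_{\lambda\in\mathcal{L}^*_{n,k}}\alpha^{\mathrm{nrec}(\lambda)}\beta^{\mathrm{rec}^*(\lambda)}r^{\mathrm{circ}(\lambda)}.$$
   Context: For $\theta$ and $k\ge1$ let $(x)^{(k,\theta)}=x(x-\theta)\cdots(x-k\theta+\theta)$, and $(x)^{(0,\theta)}=1$. The generalized Stirling numbers $S(n,k;\alpha,\beta,r)$ (Hsu–Shiue) are the coefficients defined by $(x)^{(n,-\alpha)}=\sum_{k=0}^n S(n,k;\alpha,\beta,r)(x-r)^{(k,\beta)}$. A Lah distribution of $[n]$ is a partition of $[n]$ into nonempty blocks, each block linearly ordered; blocks are listed left to right in increasing order of their smallest elements. An element $i$ is special if $i=1$, or if $i\ge2$, $i$ is not the smallest element of its block, and every element of $\{1,\dots,i-1\}$ occurs to the left of $i$ in the left-to-right reading of the blocks (blocks in the listed order, each read in its order). $\mathcal{L}^*_n$ is the set of all objects obtained from Lah distributions of $[n]$ by circling some (possibly empty) subset of the special elements, where $1$ may be circled only if it is the first element of its block. A block is true unless it contains a circled $1$. $\mathcal{L}^*_{n,k}$ is the set of members of $\mathcal{L}^*_n$ with exactly $k$ true blocks. For a true block, consider the sublist of its uncircled elements (in order); an element of this sublist is a record low if no smaller element precedes it in the sublist. $\mathrm{rec}^*(\lambda)$ is the number of uncircled elements of true blocks that are record lows but not the smallest element of their block; $\mathrm{nrec}(\lambda)$ is the number of uncircled elements of true blocks that are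 not record lows, plus the number of uncircled elements in the block containing a circled $1$ (if any); that block contributes nothing to $\mathrm{rec}^*$. $\mathrm{circ}(\lambda)$ is the number of circled elements of $\lambda$. -}

module Defs where

open import Function using (_∘_)
open import Data.Nat as ℕ using (ℕ; zero; suc; _⊓_; _<ᵇ_; _≡ᵇ_; _≤ᵇ_)
open import Data.Bool using (Bool; true; false; _∧_; _∨_; not; if_then_else_)
open import Data.List using (List; []; _∷_; [_]; map; concat; concatMap; upTo; length; filterᵇ; foldr; _++_; null; takeWhileᵇ)
open import Data.Bool.ListAction using (all; any)
open import Data.Product using (_×_; _,_; proj₁; proj₂)
open import Data.Integer as ℤ using (ℤ; +_; _*_; _-_; _+_; -_; _^_)
open import Relation.Binary.PropositionalEquality using (_≡_)

fall : ℤ → ℤ → ℕ → ℤ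
fall x θ zero    = + 1
fall x θ (suc k) = fall x θ k * (x - (+ k) * θ)

sumTo : ℕ → (ℕ → ℤ) → ℤ
sumTo n f = foldr ℤ._+_ (+ 0) (map f (upTo (suc n)))

-- Defining property of the Hsu–Shiue numbers S(n,k;α,β,r):
--   (x)^{(n,-α)} = Σ_{k=0}^n S(n,k) (x-r)^{(k,β)}   for all n and all x.
-- (Since (x-r)^{(k,β)} is monic of degree k in x, this determines S uniquely.)
HsuShiueExpansion : ℤ → ℤ → ℕ → (ℕ → ℕ → ℤ) → Set
HsuShiueExpansion α β r S =
  (n : ℕ) (x : ℤ) → fall x (- α) n ≡ sumTo n (λ k → S n k * fall (x - + r) β k)

-- Objects of L*_n: a list of blocks (in the listed order); each block is a
-- list of entries (value , circled?) in its linear order.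

Entry : Set
Entry = ℕ × Bool

Block : Set
Block = List Entry

LahStar : Set
LahStar = List Block

range : ℕ → List ℕ
range n = map suc (upTo n)

elemᵇ : ℕ → List ℕ → Bool
elemᵇ v = any (λ w → v ≡ᵇ w)

count : {A : Set} → (A → Bool) → List A → ℕ
count p xs = length (filterᵇ p xs)

vals : Block → List ℕ
vals = map proj₁

reading : LahStar → List Entry
reading = concat

readVals : LahStar → List ℕ
readVals = vals ∘ reading

blockMin : List ℕ → ℕ
blockMin []       = 0
blockMin (x ∷ xs) = foldr _⊓_ x xs

strictlyIncr : List ℕ → Bool
strictlyIncr (x ∷ y ∷ t) = (x <ᵇ y) ∧ strictlyIncr (y ∷ t)
strictlyIncr _           = true

isLahDist : ℕ → LahStar → Bool
isLahDist n λs =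
  all (not ∘ null) λs
  ∧ (length (readVals λs) ≡ᵇ n)
  ∧ all (λ v → (1 ≤ᵇ v) ∧ (v ≤ᵇ n)) (readVals λs)
  ∧ all (λ i → elemᵇ i (readVals λs)) (range n)
  ∧ strictlyIncr (map (blockMin ∘ vals) λs)

blockOf : ℕ → LahStar → Block
blockOf i []       = []
blockOf i (b ∷ bs) = if elemᵇ i (vals b) then b else blockOf i bs

isSpecial : LahStar → ℕ → Bool
isSpecial λs i =
  (i ≡ᵇ 1)
  ∨ ((2 ≤ᵇ i)
     ∧ not (i ≡ᵇ blockMin (vals (blockOf i λs)))
     ∧ all (λ j → elemᵇ j (takeWhileᵇ (λ v → not (v ≡ᵇ i)) (readVals λs)))
           (map suc (upTo (i ℕ.∸ 1))))

circled1 : Entry → Bool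
circled1 (v , c) = c ∧ (v ≡ᵇ 1)

tailL : {A : Set} → List A → List A
tailL []       = []
tailL (_ ∷ xs) = xs

circlesOK : LahStar → Bool
circlesOK λs =
  all (λ e → not (proj₂ e) ∨ isSpecial λs (proj₁ e)) (reading λs)
  ∧ all (λ b → all (not ∘ circled1) (tailL b)) λs

isLahStar : ℕ → LahStar → Bool
isLahStar n λs = isLahDist n λs ∧ circlesOK λs

isTrue : Block → Bool
isTrue b = not (any circled1 b)

numTrue : LahStar → ℕ
numTrue = count isTrue

uncirc : Block → List ℕ
uncirc b = vals (filterᵇ (not ∘ proj₂) b)

markRecGo : List ℕ → List ℕ → List (ℕ × Bool)
markRecGo pre []       = []
markRecGo pre (x ∷ xs) = (x , all (λ y → not (y <ᵇ x)) pre) ∷ markRecGo (pre ++ [ x ]) xs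

markRec : List ℕ → List (ℕ × Bool)
markRec = markRecGo []

recStarBlock : Block → ℕ
recStarBlock b =
  if isTrue b
  then count (λ e → proj₂ e ∧ not (proj₁ e ≡ᵇ blockMin (vals b))) (markRec (uncirc b))
  else 0

nrecBlock : Block → ℕ
nrecBlock b =
  if isTrue b
  then count (not ∘ proj₂) (markRec (uncirc b))
  else length (uncirc b)

sumℕ : List ℕ → ℕ
sumℕ = foldr ℕ._+_ 0

recStar : LahStar → ℕ
recStar λs = sumℕ (map recStarBlock λs)

nrec : LahStar → ℕ
nrec λs = sumℕ (map nrecBlock λs)

circ : LahStar → ℕ
circ λs = count proj₂ (reading λs)

-- Candidates are words of length n over letters (value ∈ [n], circled?, startsBlock?);
-- a word whose first letter starts a block encodes a list of nonempty blocks
-- (bijectively), which is then filtered by isLahStar and the number of true blocks.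

Letter : Set
Letter = ℕ × Bool × Bool

alphabet : ℕ → List Letter
alphabet n = concatMap (λ v → concatMap (λ c → map (λ s → v , c , s) (true ∷ false ∷ [])) (true ∷ false ∷ [])) (range n)

wordsOf : List Letter → ℕ → List (List Letter)
wordsOf A zero    = [] ∷ []
wordsOf A (suc m) = concatMap (λ a → map (a ∷_) (wordsOf A m)) A

-- (entries before the first block start , blocks)
split : List Letter → List Entry × LahStar
split [] = [] , []
split ((v , c , s) ∷ w) with split w
... | p , bs = if s then ([] , ((v , c) ∷ p) ∷ bs) else (((v , c) ∷ p) , bs)

candidates : ℕ → List LahStar
candidates n = map (proj₂ ∘ split) (filterᵇ (null ∘ proj₁ ∘ split) (wordsOf (alphabet n) n))

LstarNK : ℕ → ℕ → List LahStar
LstarNK n k = filterᵇ (λ λs → isLahStar n λs ∧ (numTrue λs ≡ᵇ k)) (candidates n)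

weight : ℤ → ℤ → ℕ → LahStar → ℤ
weight α β r λs = (α ^ nrec λs) * (β ^ recStar λs) * ((+ r) ^ circ λs)

lahStarSum : ℤ → ℤ → ℕ → ℕ → ℕ → ℤ
lahStarSum α β r n k = foldr ℤ._+_ (+ 0) (map (weight α β r) (LstarNK n k))

-- Every λ ∈ L*_{n+1} arises from exactly one μ ∈ L*_n by placing v = n+1, in one of three ways:
-- as a new singleton block (one more true block, same weight); circled at the end of the last block
-- (v is then special, weight × r); or uncircled inside a block b of μ, in one of the |b| places after
-- its head (v then counts for nrec, weight × α), or in front of the head of a true block (v becomes
-- a record low that is not the block minimum, weight × β).  Hence the weighted counts satisfy
--   T(n+1,k) = T(n,k-1) + (kβ + nα + r) T(n,k),
-- which is also the recurrence of S(n,k;α,β,r), because (x)^(n+1,-α) = (x)^(n,-α) (x + nα) and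
-- (x + nα)(x-r)^(k,β) = (x-r)^(k+1,β) + (kβ + nα + r)(x-r)^(k,β).
-- The recursive enumeration has no repetitions (deleting n+1 undoes each placement) and contains
-- exactly the words accepted by isLahStar, so summing over it is summing over L*_{n,k}.

module Submission where
open import Defs
open import Function using (_∘_; id)
open import Data.Empty using (⊥; ⊥-elim)
open import Data.Unit using (⊤; tt)
open import Data.Bool using (Bool; true; false; _∧_; _∨_; not; if_then_else_; T; T?)
open import Data.Bool.Properties using (if-∧; ∧-assoc; ∨-assoc; ∨-identityʳ; ∨-zeroʳ; ∧-identityʳ)
open import Data.Bool.ListAction using (all; any)
open import Data.Nat as ℕ using (ℕ; zero; suc; _⊓_; _<ᵇ_; _≡ᵇ_; _≤ᵇ_; _<_; _≤_; z≤n; s≤s)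
import Data.Nat.Properties as ℕP
open import Data.Integer as ℤ using (ℤ; +_; _*_; _-_; _+_; -_; _^_)
import Data.Integer.Properties as ℤP
open import Algebra.Properties.CommutativeSemigroup ℤP.+-commutativeSemigroup
  using () renaming (interchange to +-interchange; x∙yz≈y∙xz to +-left-swap)
open import Data.Integer.Tactic.RingSolver using (solve-∀)
open import Data.Product using (_×_; _,_; proj₁; proj₂; ∃-syntax)
open import Data.Sum using (_⊎_; inj₁; inj₂)
open import Data.Maybe using (just)
open import Data.Maybe.Properties using (just-injective)
open import Data.List using (List; []; _∷_; [_]; head; applyUpTo; map; concat; concatMap; upTo; length; filterᵇ; foldr; _++_; null; takeWhileᵇ)
open import Data.List.Properties
  using (map-cong; ∷-injectiveʳ; filter-++; filter-accept; filter-reject; ++-assoc; ++-identityʳ; map-++; length-++; length-map; concat-++; length-filter; length-upTo)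
open import Data.List.Membership.Propositional using (_∈_)
open import Data.List.Membership.Propositional.Properties
  using (∈-map⁺; ∈-map⁻; ∈-++⁺ˡ; ∈-++⁺ʳ; ∈-++⁻; ∈-∃++; ∈-upTo⁺; ∈-upTo⁻; ∈-filter⁺; ∈-filter⁻; ∈-concat⁺′)
open import Data.List.Membership.DecPropositional ℕ._≟_ using (_∈?_)
open import Data.List.Relation.Unary.Any using (here; there)
open import Data.List.Relation.Unary.All as All using (All; []; _∷_; lookup)
import Data.List.Relation.Unary.All.Properties as AllP
open import Data.List.Relation.Unary.AllPairs using ([]; _∷_)
open import Data.List.Relation.Unary.Unique.Propositional using (Unique)
import Data.List.Relation.Unary.Unique.Propositional.Properties as UP
open import Relation.Nullary using (¬_; yes; no)
open import Relation.Binary.PropositionalEquality hiding ([_])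

-- Sums, and the recurrence that determines the Hsu–Shiue numbers

sumBelow : ℕ → (ℕ → ℤ) → ℤ
sumBelow zero f = + 0
sumBelow (suc n) f = f 0 + sumBelow n (f ∘ suc)

sumTo≡sumBelow : (n : ℕ) (f : ℕ → ℤ) → sumTo n f ≡ sumBelow (suc n) f
sumTo≡sumBelow n f = foldr-applyUpTo f id (suc n)
  where
  foldr-applyUpTo : (f : ℕ → ℤ) (g : ℕ → ℕ) (m : ℕ) → foldr _+_ (+ 0) (map f (applyUpTo g m)) ≡ sumBelow m (f ∘ g)
  foldr-applyUpTo f g zero = refl
  foldr-applyUpTo f g (suc m) = cong (_+_ (f (g 0))) (foldr-applyUpTo f (g ∘ suc) m)

sumBelow-suc : (n : ℕ) (f : ℕ → ℤ) → sumBelow (suc n) f ≡ sumBelow n f + f n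
sumBelow-suc zero f = trans (ℤP.+-identityʳ (f 0)) (sym (ℤP.+-identityˡ (f 0)))
sumBelow-suc (suc n) f = trans (cong (λ t → f 0 + t) (sumBelow-suc n (f ∘ suc))) (sym (ℤP.+-assoc (f 0) _ _))

sumBelow-+ : (n : ℕ) (f g : ℕ → ℤ) → sumBelow n (λ k → f k + g k) ≡ sumBelow n f + sumBelow n g
sumBelow-+ zero f g = refl
sumBelow-+ (suc n) f g = trans (cong (λ t → (f 0 + g 0) + t) (sumBelow-+ n (f ∘ suc) (g ∘ suc)))
  (+-interchange (f 0) (g 0) (sumBelow n (f ∘ suc)) (sumBelow n (g ∘ suc)))

sumBelow-cong : (n : ℕ) (f g : ℕ → ℤ) → (∀ k → f k ≡ g k) → sumBelow n f ≡ sumBelow n g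
sumBelow-cong zero f g e = refl
sumBelow-cong (suc n) f g e = cong₂ _+_ (e 0) (sumBelow-cong n (f ∘ suc) (g ∘ suc) (e ∘ suc))

sumBelow-*ʳ : (n : ℕ) (f : ℕ → ℤ) (c : ℤ) → sumBelow n (λ k → f k * c) ≡ sumBelow n f * c
sumBelow-*ʳ zero f c = sym (ℤP.*-zeroˡ c)
sumBelow-*ʳ (suc n) f c = trans (cong (λ t → f 0 * c + t) (sumBelow-*ʳ n (f ∘ suc) c)) (sym (ℤP.*-distribʳ-+ c (f 0) _))

module HsuShiueRecurrence (α β : ℤ) (r : ℕ) (T : ℕ → ℕ → ℤ)
  (T-0-0 : T 0 0 ≡ + 1)
  (T-above-diagonal : ∀ n k → n < k → T n k ≡ + 0)
  (T-suc-0 : ∀ n → T (suc n) 0 ≡ (+ 0 * β + + n * α + + r) * T n 0)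
  (T-suc-suc : ∀ n k → T (suc n) (suc k) ≡ T n k + (+ suc k * β + + n * α + + r) * T n (suc k))
  where

  coeff : ℕ → ℕ → ℤ
  coeff n k = + k * β + + n * α + + r

  module _ (x : ℤ) where

    F : ℕ → ℤ
    F = fall (x - + r) β

    falling-step : ∀ n k → T n k * F (suc k) + coeff n k * T n k * F k ≡ T n k * F k * (x - + n * - α)
    falling-step n k = identity (T n k) (F k) x (+ k) β (+ n) α (+ r)
      where
      identity : (t f y k b m a rr : ℤ) → t * (f * ((y - rr) - k * b)) + (k * b + m * a + rr) * t * f ≡ t * f * (y - m * - a)
      identity = solve-∀

    row-suc : ∀ n → sumBelow (suc (suc n)) (λ k → T (suc n) k * F k)
                  ≡ sumBelow (suc n) (λ k → T n k * F (suc k)) + sumBelow (suc n) (λ k → coeff n k * T n k * F k)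
    row-suc n = begin
        T (suc n) 0 * F 0 + sumBelow (suc n) (λ k → T (suc n) (suc k) * F (suc k))
      ≡⟨ cong₂ _+_ (cong (_* F 0) (T-suc-0 n)) (sumBelow-cong (suc n) _ _ (λ k →
           trans (cong (_* F (suc k)) (T-suc-suc n k)) (ℤP.*-distribʳ-+ (F (suc k)) (T n k) _))) ⟩
        H 0 + sumBelow (suc n) (λ k → T n k * F (suc k) + H (suc k))
      ≡⟨ cong (_+_ (H 0)) (sumBelow-+ (suc n) (λ k → T n k * F (suc k)) (H ∘ suc)) ⟩
        H 0 + (A + sumBelow (suc n) (H ∘ suc))
      ≡⟨ +-left-swap (H 0) A _ ⟩
        A + sumBelow (suc (suc n)) H
      ≡⟨ cong (_+_ A) (trans (sumBelow-suc (suc n) H) (trans (cong (_+_ (sumBelow (suc n) H)) H-top) (ℤP.+-identityʳ _))) ⟩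
        A + sumBelow (suc n) H ∎
      where
      open ≡-Reasoning
      A = sumBelow (suc n) (λ k → T n k * F (suc k))
      H : ℕ → ℤ
      H k = coeff n k * T n k * F k
      H-top : H (suc n) ≡ + 0
      H-top = trans (cong (λ t → coeff n (suc n) * t * F (suc n)) (T-above-diagonal n (suc n) (ℕP.n<1+n n)))
                    (trans (cong (_* F (suc n)) (ℤP.*-zeroʳ (coeff n (suc n)))) (ℤP.*-zeroˡ (F (suc n))))

    row-expansion : ∀ n → fall x (- α) n ≡ sumBelow (suc n) (λ k → T n k * F k)
    row-expansion zero = trans (sym (ℤP.+-identityʳ (+ 1))) (cong (λ t → t * + 1 + + 0) (sym T-0-0))
    row-expansion (suc n) = begin
        fall x (- α) n * (x - + n * - α)
      ≡⟨ cong (_* (x - + n * - α)) (row-expansion n) ⟩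
        sumBelow (suc n) (λ k → T n k * F k) * (x - + n * - α)
      ≡⟨ sumBelow-*ʳ (suc n) (λ k → T n k * F k) (x - + n * - α) ⟨
        sumBelow (suc n) (λ k → T n k * F k * (x - + n * - α))
      ≡⟨ sumBelow-cong (suc n) _ _ (falling-step n) ⟨
        sumBelow (suc n) (λ k → T n k * F (suc k) + coeff n k * T n k * F k)
      ≡⟨ sumBelow-+ (suc n) (λ k → T n k * F (suc k)) (λ k → coeff n k * T n k * F k) ⟩
        sumBelow (suc n) (λ k → T n k * F (suc k)) + sumBelow (suc n) (λ k → coeff n k * T n k * F k)
      ≡⟨ row-suc n ⟨
        sumBelow (suc (suc n)) (λ k → T (suc n) k * F k) ∎
      where open ≡-Reasoning

  expansion : HsuShiueExpansion α β r T
  expansion n x = trans (row-expansion x n) (sym (sumTo≡sumBelow n (λ k → T n k * F x k)))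

sumMap : {A : Set} → (A → ℤ) → List A → ℤ
sumMap f xs = foldr ℤ._+_ (+ 0) (map f xs)

sumMap-++ : {A : Set} (f : A → ℤ) (xs ys : List A) → sumMap f (xs ++ ys) ≡ sumMap f xs + sumMap f ys
sumMap-++ f [] ys = sym (ℤP.+-identityˡ _)
sumMap-++ f (x ∷ xs) ys = trans (cong (λ t → f x + t) (sumMap-++ f xs ys)) (sym (ℤP.+-assoc (f x) _ _))

sumMap-concatMap : {A B : Set} (f : B → ℤ) (g : A → List B) (xs : List A) →
  sumMap f (concatMap g xs) ≡ sumMap (λ a → sumMap f (g a)) xs
sumMap-concatMap f g [] = refl
sumMap-concatMap f g (x ∷ xs) = trans (sumMap-++ f (g x) (concatMap g xs)) (cong (λ t → sumMap f (g x) + t) (sumMap-concatMap f g xs))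

sumMap-map : {A B : Set} (f : B → ℤ) (g : A → B) (xs : List A) → sumMap f (map g xs) ≡ sumMap (f ∘ g) xs
sumMap-map f g [] = refl
sumMap-map f g (x ∷ xs) = cong (λ t → f (g x) + t) (sumMap-map f g xs)

sumMap-cong : {A : Set} (f g : A → ℤ) (xs : List A) → (∀ x → x ∈ xs → f x ≡ g x) → sumMap f xs ≡ sumMap g xs
sumMap-cong f g [] e = refl
sumMap-cong f g (x ∷ xs) e = cong₂ _+_ (e x (here refl)) (sumMap-cong f g xs (λ y m → e y (there m)))

sumMap-+ : {A : Set} (f g : A → ℤ) (xs : List A) → sumMap (λ x → f x + g x) xs ≡ sumMap f xs + sumMap g xs
sumMap-+ f g [] = refl
sumMap-+ f g (x ∷ xs) = trans (cong (λ t → (f x + g x) + t) (sumMap-+ f g xs)) (+-interchange (f x) (g x) _ _)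

sumMap-*ˡ : {A : Set} (c : ℤ) (f : A → ℤ) (xs : List A) → sumMap (λ x → c * f x) xs ≡ c * sumMap f xs
sumMap-*ˡ c f [] = sym (ℤP.*-zeroʳ c)
sumMap-*ˡ c f (x ∷ xs) = trans (cong (λ t → c * f x + t) (sumMap-*ˡ c f xs)) (sym (ℤP.*-distribˡ-+ c (f x) _))

sumMap-*ʳ : {A : Set} (f : A → ℤ) (c : ℤ) (xs : List A) → sumMap (λ x → f x * c) xs ≡ sumMap f xs * c
sumMap-*ʳ f c xs = trans (sumMap-cong _ _ xs (λ x _ → ℤP.*-comm (f x) c)) (trans (sumMap-*ˡ c f xs) (ℤP.*-comm c _))

sumMap-const : {A : Set} (f : A → ℤ) (c : ℤ) (xs : List A) → (∀ x → x ∈ xs → f x ≡ c) → sumMap f xs ≡ + length xs * c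
sumMap-const f c [] e = sym (ℤP.*-zeroˡ c)
sumMap-const f c (x ∷ xs) e = trans (cong₂ _+_ (e x (here refl)) (sumMap-const f c xs (λ y m → e y (there m))))
  (trans (cong (λ t → t + + length xs * c) (sym (ℤP.*-identityˡ c))) (trans (sym (ℤP.*-distribʳ-+ c (+ 1) (+ length xs))) refl))

sumMap-filterᵇ : {A : Set} (f : A → ℤ) (p : A → Bool) (xs : List A) →
  sumMap f (filterᵇ p xs) ≡ sumMap (λ x → if p x then f x else + 0) xs
sumMap-filterᵇ f p [] = refl
sumMap-filterᵇ f p (x ∷ xs) with p x
... | true = cong (λ t → f x + t) (sumMap-filterᵇ f p xs)
... | false = trans (sumMap-filterᵇ f p xs) (sym (ℤP.+-identityˡ _))

sumMap-zero : {A : Set} (L : List A) → sumMap (λ _ → + 0) L ≡ + 0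
sumMap-zero [] = refl
sumMap-zero (x ∷ L) = trans (ℤP.+-identityˡ _) (sumMap-zero L)

sumMap-if : {A : Set} (b : Bool) (f : A → ℤ) (L : List A) → sumMap (λ z → if b then f z else + 0) L ≡ (if b then sumMap f L else + 0)
sumMap-if true f L = refl
sumMap-if false f L = sumMap-zero L

false≢true : false ≢ true
false≢true ()

∷≢[] : {A : Set} {x : A} {xs : List A} → x ∷ xs ≢ []
∷≢[] ()

T⇒≡true : ∀ {b} → T b → b ≡ true
T⇒≡true {true} _ = refl

≡true⇒T : ∀ {b} → b ≡ true → T b
≡true⇒T refl = tt

¬T⇒≡false : ∀ {b} → (T b → ⊥) → b ≡ false
¬T⇒≡false {true} f = ⊥-elim (f tt)
¬T⇒≡false {false} _ = refl

<⇒<ᵇ≡true : ∀ {m n} → m < n → (m <ᵇ n) ≡ true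
<⇒<ᵇ≡true p = T⇒≡true (ℕP.<⇒<ᵇ p)

≤⇒>ᵇ≡false : ∀ {m n} → n ≤ m → (m <ᵇ n) ≡ false
≤⇒>ᵇ≡false {m} {n} p = ¬T⇒≡false (λ t → ℕP.<⇒≱ (ℕP.<ᵇ⇒< m n t) p)

≡ᵇ-refl : ∀ m → (m ≡ᵇ m) ≡ true
≡ᵇ-refl m = T⇒≡true (ℕP.≡⇒≡ᵇ m m refl)

≢⇒≡ᵇ≡false : ∀ {m n} → m ≢ n → (m ≡ᵇ n) ≡ false
≢⇒≡ᵇ≡false {m} {n} p = ¬T⇒≡false (λ t → p (ℕP.≡ᵇ⇒≡ m n t))

≡ᵇ≡true⇒≡ : ∀ {m n} → (m ≡ᵇ n) ≡ true → m ≡ n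
≡ᵇ≡true⇒≡ {m} {n} e = ℕP.≡ᵇ⇒≡ m n (≡true⇒T e)

∧≡true⁻ : ∀ {a b : Bool} → (a ∧ b) ≡ true → (a ≡ true) × (b ≡ true)
∧≡true⁻ {true} {true} _ = refl , refl

∧≡true⁺ : ∀ {a b : Bool} → a ≡ true → b ≡ true → (a ∧ b) ≡ true
∧≡true⁺ refl refl = refl

∨≡true⁻ : ∀ {a b : Bool} → (a ∨ b) ≡ true → (a ≡ true) ⊎ (b ≡ true)
∨≡true⁻ {true} _ = inj₁ refl
∨≡true⁻ {false} e = inj₂ e

if-true : {A : Set} (t : Bool) (x y : A) → t ≡ true → (if t then x else y) ≡ x
if-true true x y _ = refl

if-false : {A : Set} (t : Bool) (x y : A) → t ≡ false → (if t then x else y) ≡ y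
if-false false x y _ = refl

isNot : ℕ → ℕ → Bool
isNot i u = not (u ≡ᵇ i)

≢⇒isNot : ∀ {y v} → y ≢ v → not (y ≡ᵇ v) ≡ true
≢⇒isNot ne = cong not (≢⇒≡ᵇ≡false ne)

isNot⇒≢ : ∀ {y v} → not (y ≡ᵇ v) ≡ true → y ≢ v
isNot⇒≢ {y} {v} h eq = false≢true (trans (sym (cong not (trans (cong (_≡ᵇ v) eq) (≡ᵇ-refl v)))) h)

≤ᵇ≡true⇒≤ : ∀ m n → (m ≤ᵇ n) ≡ true → m ≤ n
≤ᵇ≡true⇒≤ m n e = ℕP.≤ᵇ⇒≤ m n (≡true⇒T e)

≤⇒≤ᵇ≡true : ∀ {m n} → m ≤ n → (m ≤ᵇ n) ≡ true
≤⇒≤ᵇ≡true p = T⇒≡true (ℕP.≤⇒≤ᵇ p)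

count-++ : {A : Set} (p : A → Bool) (xs ys : List A) → count p (xs ++ ys) ≡ count p xs ℕ.+ count p ys
count-++ p [] ys = refl
count-++ p (x ∷ xs) ys with p x
... | true = cong suc (count-++ p xs ys)
... | false = count-++ p xs ys

count-middle-false : {A : Set} (P : A → Bool) (A1 B1 : List A) (y : A) → P y ≡ false → count P (A1 ++ y ∷ B1) ≡ count P (A1 ++ B1)
count-middle-false P A1 B1 y e rewrite count-++ P A1 (y ∷ B1) | count-++ P A1 B1 | e = refl

count-middle-true : {A : Set} (P : A → Bool) (A1 B1 : List A) (y : A) → P y ≡ true → count P (A1 ++ y ∷ B1) ≡ suc (count P (A1 ++ B1))
count-middle-true P A1 B1 y e rewrite count-++ P A1 (y ∷ B1) | count-++ P A1 B1 | e = ℕP.+-suc (count P A1) _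

boolToℕ : Bool → ℕ
boolToℕ true = 1
boolToℕ false = 0

count-cons : {A : Set} (P : A → Bool) (y : A) (L : List A) → count P (y ∷ L) ≡ boolToℕ (P y) ℕ.+ count P L
count-cons P y L with P y
... | true = refl
... | false = refl

all-++ : {A : Set} (p : A → Bool) (xs ys : List A) → all p (xs ++ ys) ≡ (all p xs ∧ all p ys)
all-++ p [] ys = refl
all-++ p (x ∷ xs) ys rewrite all-++ p xs ys = sym (∧-assoc (p x) _ _)

any-++ : {A : Set} (p : A → Bool) (xs ys : List A) → any p (xs ++ ys) ≡ (any p xs ∨ any p ys)
any-++ p [] ys = refl
any-++ p (x ∷ xs) ys rewrite any-++ p xs ys = sym (∨-assoc (p x) _ _)

filterᵇ-++ : {A : Set} (p : A → Bool) (xs ys : List A) → filterᵇ p (xs ++ ys) ≡ filterᵇ p xs ++ filterᵇ p ys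
filterᵇ-++ p = filter-++ (T? ∘ p)

filterᵇ-reject : {A : Set} (p : A → Bool) (x : A) (xs : List A) → p x ≡ false → filterᵇ p (x ∷ xs) ≡ filterᵇ p xs
filterᵇ-reject p x xs e = filter-reject (T? ∘ p) (subst T e)

filterᵇ-accept : {A : Set} (p : A → Bool) (x : A) (xs : List A) → p x ≡ true → filterᵇ p (x ∷ xs) ≡ x ∷ filterᵇ p xs
filterᵇ-accept p x xs e = filter-accept (T? ∘ p) (≡true⇒T e)

all≡true⁻ : {A : Set} (p : A → Bool) (xs : List A) → all p xs ≡ true → ∀ x → x ∈ xs → p x ≡ true
all≡true⁻ p (y ∷ xs) h x (here refl) = proj₁ (∧≡true⁻ h)
all≡true⁻ p (y ∷ xs) h x (there m) = all≡true⁻ p xs (proj₂ (∧≡true⁻ {p y} h)) x m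

all≡true⁺ : {A : Set} (p : A → Bool) (xs : List A) → (∀ x → x ∈ xs → p x ≡ true) → all p xs ≡ true
all≡true⁺ p [] h = refl
all≡true⁺ p (y ∷ xs) h = ∧≡true⁺ (h y (here refl)) (all≡true⁺ p xs (λ x m → h x (there m)))

all-cong : {A : Set} (p q : A → Bool) (xs : List A) → (∀ x → x ∈ xs → p x ≡ q x) → all p xs ≡ all q xs
all-cong p q [] h = refl
all-cong p q (y ∷ xs) h = cong₂ _∧_ (h y (here refl)) (all-cong p q xs (λ x m → h x (there m)))

elemᵇ≡true⇒∈ : ∀ v xs → elemᵇ v xs ≡ true → v ∈ xs
elemᵇ≡true⇒∈ v (y ∷ xs) h with ∨≡true⁻ {v ≡ᵇ y} h
... | inj₁ e = here (≡ᵇ≡true⇒≡ e)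
... | inj₂ e = there (elemᵇ≡true⇒∈ v xs e)

∈⇒elemᵇ≡true : ∀ v xs → v ∈ xs → elemᵇ v xs ≡ true
∈⇒elemᵇ≡true v (y ∷ xs) (here refl) = cong (_∨ elemᵇ v xs) (≡ᵇ-refl v)
∈⇒elemᵇ≡true v (y ∷ xs) (there m) = trans (cong ((v ≡ᵇ y) ∨_) (∈⇒elemᵇ≡true v xs m)) (∨-zeroʳ (v ≡ᵇ y))

∉⇒elemᵇ≡false : ∀ v xs → ¬ (v ∈ xs) → elemᵇ v xs ≡ false
∉⇒elemᵇ≡false v xs nm = ¬T⇒≡false (λ t → nm (elemᵇ≡true⇒∈ v xs (T⇒≡true t)))

∈-filterᵇ⁻ : {A : Set} (p : A → Bool) (L : List A) (x : A) → x ∈ filterᵇ p L → x ∈ L × p x ≡ true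
∈-filterᵇ⁻ p L x m with ∈-filter⁻ (T? ∘ p) {xs = L} m
... | m1 , t = m1 , T⇒≡true t

∈-filterᵇ⁺ : {A : Set} (p : A → Bool) (L : List A) (x : A) → x ∈ L → p x ≡ true → x ∈ filterᵇ p L
∈-filterᵇ⁺ p L x m t = ∈-filter⁺ (T? ∘ p) m (≡true⇒T t)

∈-concatMap⁻′ : {A B : Set} (f : A → List B) (xs : List A) (z : B) → z ∈ concatMap f xs → ∃[ x ] (x ∈ xs × z ∈ f x)
∈-concatMap⁻′ f (x ∷ xs) z m with ∈-++⁻ (f x) m
... | inj₁ m1 = x , here refl , m1
... | inj₂ m2 with ∈-concatMap⁻′ f xs z m2
... | y , ym , zm = y , there ym , zm

∈-concatMap⁺′ : {A B : Set} (f : A → List B) (xs : List A) (x : A) (z : B) → x ∈ xs → z ∈ f x → z ∈ concatMap f xs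
∈-concatMap⁺′ f (y ∷ xs) x z (here refl) m = ∈-++⁺ˡ m
∈-concatMap⁺′ f (y ∷ xs) x z (there mx) m = ∈-++⁺ʳ (f y) (∈-concatMap⁺′ f xs x z mx m)

takeWhileᵇ-accept : {A : Set} (p : A → Bool) (x : A) (xs : List A) → p x ≡ true → takeWhileᵇ p (x ∷ xs) ≡ x ∷ takeWhileᵇ p xs
takeWhileᵇ-accept p x xs e with p x
... | true = refl
takeWhileᵇ-accept p x xs () | false

takeWhileᵇ-reject : {A : Set} (p : A → Bool) (x : A) (xs : List A) → p x ≡ false → takeWhileᵇ p (x ∷ xs) ≡ []
takeWhileᵇ-reject p x xs e with p x
... | false = refl
takeWhileᵇ-reject p x xs () | true

takeWhileᵇ-isNot-prefix : ∀ v X Y → ¬ (v ∈ X) → takeWhileᵇ (isNot v) (X ++ v ∷ Y) ≡ X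
takeWhileᵇ-isNot-prefix v [] Y nx = takeWhileᵇ-reject (isNot v) v Y (cong not (≡ᵇ-refl v))
takeWhileᵇ-isNot-prefix v (x ∷ X) Y nx = trans (takeWhileᵇ-accept (isNot v) x (X ++ v ∷ Y) (≢⇒isNot (λ eq → nx (here (sym eq))))) (cong (x ∷_) (takeWhileᵇ-isNot-prefix v X Y (λ m → nx (there m))))

length≡0⇒[] : {A : Set} (L : List A) → length L ≡ 0 → L ≡ []
length≡0⇒[] [] _ = refl

n≢1+n : ∀ n → n ≢ suc n
n≢1+n n eq = ℕP.1+n≢n (sym eq)

concat-filter-nonempty : {A : Set} (L : List (List A)) → concat (filterᵇ (not ∘ null) L) ≡ concat L
concat-filter-nonempty [] = refl
concat-filter-nonempty ([] ∷ L) = concat-filter-nonempty L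
concat-filter-nonempty ((x ∷ xs) ∷ L) = cong ((x ∷ xs) ++_) (concat-filter-nonempty L)

concat-map-filterᵇ : {A : Set} (p : A → Bool) (L : List (List A)) → concat (map (filterᵇ p) L) ≡ filterᵇ p (concat L)
concat-map-filterᵇ p [] = refl
concat-map-filterᵇ p (b ∷ L) = trans (cong (filterᵇ p b ++_) (concat-map-filterᵇ p L)) (sym (filterᵇ-++ p b (concat L)))

map-filterᵇ : {A B : Set} (f : A → B) (q : B → Bool) (L : List A) → map f (filterᵇ (q ∘ f) L) ≡ filterᵇ q (map f L)
map-filterᵇ f q [] = refl
map-filterᵇ f q (x ∷ L) with q (f x)
... | true = cong (f x ∷_) (map-filterᵇ f q L)
... | false = map-filterᵇ f q L

∈-tailL⁻ : {A : Set} (L : List A) (e : A) → e ∈ tailL L → e ∈ L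
∈-tailL⁻ (x ∷ L) e m = there m

∈-range-pred⁻ : ∀ i j → j ∈ map suc (upTo (i ℕ.∸ 1)) → j < i
∈-range-pred⁻ (suc i) j m with ∈-map⁻ suc m
... | u , um , refl = s≤s (∈-upTo⁻ um)

∈-range⁻ : ∀ n i → i ∈ range n → 1 ≤ i × i ≤ n
∈-range⁻ n i m with ∈-map⁻ suc m
... | u , um , refl = s≤s z≤n , ∈-upTo⁻ um

∈-range⁺ : ∀ n i → 1 ≤ i → i ≤ n → i ∈ range n
∈-range⁺ n (suc u) _ le = ∈-map⁺ suc (∈-upTo⁺ le)

length-range : ∀ n → length (range n) ≡ n
length-range n = trans (length-map suc (upTo n)) (length-upTo n)

All-remove-middle : {A : Set} {P : A → Set} (ys1 ys2 : List A) (x : A) → All P (ys1 ++ x ∷ ys2) → All P (ys1 ++ ys2)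
All-remove-middle [] ys2 x (_ ∷ a) = a
All-remove-middle (y ∷ ys1) ys2 x (py ∷ a) = py ∷ All-remove-middle ys1 ys2 x a

Unique-remove-middle : {A : Set} (ys1 ys2 : List A) (x : A) → Unique (ys1 ++ x ∷ ys2) → Unique (ys1 ++ ys2) × (¬ (x ∈ ys1 ++ ys2))
Unique-remove-middle [] ys2 x (ax ∷ u) = u , (λ m → lookup ax m refl)
Unique-remove-middle (y ∷ ys1) ys2 x (ay ∷ u) with Unique-remove-middle ys1 ys2 x u
... | u' , nx = All-remove-middle ys1 ys2 x ay ∷ u' , f
  where f : ¬ (x ∈ y ∷ ys1 ++ ys2)
        f (here eq) = lookup ay (∈-++⁺ʳ ys1 (here refl)) (sym eq)
        f (there m) = nx m

∈-remove-middle : {A : Set} (ys1 ys2 : List A) (x z : A) → z ∈ ys1 ++ x ∷ ys2 → z ≢ x → z ∈ ys1 ++ ys2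
∈-remove-middle [] ys2 x z (here eq) ne = ⊥-elim (ne eq)
∈-remove-middle [] ys2 x z (there m) ne = m
∈-remove-middle (y ∷ ys1) ys2 x z (here eq) ne = here eq
∈-remove-middle (y ∷ ys1) ys2 x z (there m) ne = there (∈-remove-middle ys1 ys2 x z m ne)

∈-insert-middle : {A : Set} (ys1 ys2 : List A) (x z : A) → z ∈ ys1 ++ ys2 → z ∈ ys1 ++ x ∷ ys2
∈-insert-middle [] ys2 x z m = there m
∈-insert-middle (y ∷ ys1) ys2 x z (here eq) = here eq
∈-insert-middle (y ∷ ys1) ys2 x z (there m) = there (∈-insert-middle ys1 ys2 x z m)

sumMap-middle : {A : Set} (f : A → ℤ) (ys1 ys2 : List A) (x : A) → sumMap f (ys1 ++ x ∷ ys2) ≡ f x + sumMap f (ys1 ++ ys2)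
sumMap-middle f ys1 ys2 x = trans (sumMap-++ f ys1 (x ∷ ys2)) (trans (+-left-swap (sumMap f ys1) (f x) (sumMap f ys2)) (cong (λ w → f x + w) (sym (sumMap-++ f ys1 ys2))))

sumMap-sameElements : {A : Set} (f : A → ℤ) (xs ys : List A) → Unique xs → Unique ys →
           (∀ z → z ∈ xs → z ∈ ys) → (∀ z → z ∈ ys → z ∈ xs) → sumMap f xs ≡ sumMap f ys
sumMap-sameElements f [] [] ux uy h1 h2 = refl
sumMap-sameElements f [] (y ∷ ys) ux uy h1 h2 with h2 y (here refl)
... | ()
sumMap-sameElements f (x ∷ xs) ys (ax ∷ ux) uy h1 h2 with ∈-∃++ (h1 x (here refl))
... | ys1 , ys2 , refl with Unique-remove-middle ys1 ys2 x uy
... | uy' , nx = trans (cong (λ w → f x + w) (sumMap-sameElements f xs (ys1 ++ ys2) ux uy' g1 g2)) (sym (sumMap-middle f ys1 ys2 x))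
  where
  g1 : ∀ z → z ∈ xs → z ∈ ys1 ++ ys2
  g1 z m = ∈-remove-middle ys1 ys2 x z (h1 z (there m)) (λ eq → lookup ax m (sym eq))
  g2 : ∀ z → z ∈ ys1 ++ ys2 → z ∈ xs
  g2 z m with h2 z (∈-insert-middle ys1 ys2 x z m)
  ... | here eq = ⊥-elim (nx (subst (_∈ ys1 ++ ys2) eq m))
  ... | there m' = m'

Unique-++⁻ʳ : ∀ (X Y : List ℕ) → Unique (X ++ Y) → Unique Y
Unique-++⁻ʳ [] Y u = u
Unique-++⁻ʳ (x ∷ X) Y (_ ∷ u) = Unique-++⁻ʳ X Y u

Unique-++⁻ˡ : ∀ (X Y : List ℕ) → Unique (X ++ Y) → Unique X
Unique-++⁻ˡ [] Y u = []
Unique-++⁻ˡ (x ∷ X) Y (a ∷ u) = AllP.++⁻ˡ X a ∷ Unique-++⁻ˡ X Y u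

Unique-++⇒disjoint : ∀ (X Y : List ℕ) m → Unique (X ++ Y) → m ∈ X → m ∈ Y → ⊥
Unique-++⇒disjoint (x ∷ X) Y m (a ∷ u) (here refl) my = lookup (AllP.++⁻ʳ X a) my refl
Unique-++⇒disjoint (x ∷ X) Y m (a ∷ u) (there mx) my = Unique-++⇒disjoint X Y m u mx my

range-unique : ∀ n → Unique (range n)
range-unique n = UP.map⁺ ℕP.suc-injective (UP.upTo⁺ n)

length-filter-isNot-< : ∀ x L → x ∈ L → length (filterᵇ (isNot x) L) < length L
length-filter-isNot-< x (y ∷ L) m with y ℕ.≟ x
... | yes refl = subst (λ l → length l < suc (length L)) (sym (filterᵇ-reject (isNot y) y L (cong not (≡ᵇ-refl y)))) (s≤s (length-filter (T? ∘ isNot y) L))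
... | no ne with m
...   | here eq = ⊥-elim (ne (sym eq))
...   | there m' = subst (λ l → length l < suc (length L)) (sym (filterᵇ-accept (isNot x) y L (≢⇒isNot ne))) (s≤s (length-filter-isNot-< x L m'))

Unique-⊆⇒length≤ : ∀ U L → Unique U → (∀ u → u ∈ U → u ∈ L) → length U ≤ length L
Unique-⊆⇒length≤ [] L uU h = z≤n
Unique-⊆⇒length≤ (u ∷ U) L (au ∷ uU) h = ℕP.≤-trans (s≤s (Unique-⊆⇒length≤ U (filterᵇ (isNot u) L) uU h')) (length-filter-isNot-< u L (h u (here refl)))
  where h' : ∀ u' → u' ∈ U → u' ∈ filterᵇ (isNot u) L
        h' u' m = ∈-filterᵇ⁺ (isNot u) L u' (h u' (there m)) (≢⇒isNot (λ eq → lookup au m (sym eq)))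

filter-isNot-∉ : ∀ x L → ¬ (x ∈ L) → filterᵇ (isNot x) L ≡ L
filter-isNot-∉ x [] nm = refl
filter-isNot-∉ x (y ∷ L) nm = trans (filterᵇ-accept (isNot x) y L (≢⇒isNot (λ eq → nm (here (sym eq))))) (cong (y ∷_) (filter-isNot-∉ x L (λ m → nm (there m))))

All≢⇒∉ : ∀ {x : ℕ} {L} → All (x ≢_) L → ¬ (x ∈ L)
All≢⇒∉ a m = lookup a m refl

Unique-length-filter-isNot : ∀ x U → Unique U → length U ≤ suc (length (filterᵇ (isNot x) U))
Unique-length-filter-isNot x [] uU = z≤n
Unique-length-filter-isNot x (u ∷ U) (au ∷ uU) with u ℕ.≟ x
... | yes refl = subst (λ l → suc (length U) ≤ suc (length l)) (sym (trans (filterᵇ-reject (isNot u) u U (cong not (≡ᵇ-refl u))) (filter-isNot-∉ u U (All≢⇒∉ au)))) ℕP.≤-refl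
... | no ne = subst (λ l → suc (length U) ≤ suc (length l)) (sym (filterᵇ-accept (isNot x) u U (≢⇒isNot ne))) (s≤s (Unique-length-filter-isNot x U uU))

⊆-length≤⇒Unique : ∀ U L → Unique U → (∀ u → u ∈ U → u ∈ L) → length L ≤ length U → Unique L
⊆-length≤⇒Unique U [] uU h le = []
⊆-length≤⇒Unique U (x ∷ L) uU h le = All.tabulate (λ {y} m eq → x∉ (subst (_∈ L) (sym eq) m)) ∷ ⊆-length≤⇒Unique U' L uU' h' le'
  where
  x∉ : ¬ (x ∈ L)
  x∉ m = ℕP.<-irrefl refl (ℕP.≤-trans le (Unique-⊆⇒length≤ U L uU (λ u um → into-L u (h u um))))
    where into-L : ∀ u → u ∈ x ∷ L → u ∈ L
          into-L u (here refl) = m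
          into-L u (there m') = m'
  U' = filterᵇ (isNot x) U
  uU' : Unique U'
  uU' = UP.filter⁺ (T? ∘ isNot x) uU
  h' : ∀ u → u ∈ U' → u ∈ L
  h' u m with ∈-filterᵇ⁻ (isNot x) U u m
  ... | um , t with h u um
  ...   | here eq = ⊥-elim (isNot⇒≢ t eq)
  ...   | there m' = m'
  le' : length L ≤ length U'
  le' = ℕP.≤-pred (ℕP.≤-trans le (Unique-length-filter-isNot x U uU))

Unique-length-filter-isNot-∈ : ∀ v L → Unique L → v ∈ L → suc (length (filterᵇ (isNot v) L)) ≡ length L
Unique-length-filter-isNot-∈ v (y ∷ L) (ay ∷ uL) m with y ℕ.≟ v
... | yes refl = cong suc (trans (cong length (filterᵇ-reject (isNot y) y L (cong not (≡ᵇ-refl y)))) (cong length (filter-isNot-∉ y L (All≢⇒∉ ay))))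
... | no ne with m
...   | here eq = ⊥-elim (ne (sym eq))
...   | there m' = trans (cong (suc ∘ length) (filterᵇ-accept (isNot v) y L (≢⇒isNot ne))) (cong suc (Unique-length-filter-isNot-∈ v L uL m'))

Unique-concatMap : {A B : Set} (g : A → List B) (xs : List A) → Unique xs → (∀ a → a ∈ xs → Unique (g a)) →
                   (∀ a a' z → a ∈ xs → a' ∈ xs → z ∈ g a → z ∈ g a' → a ≡ a') → Unique (concatMap g xs)
Unique-concatMap g [] ux ug dj = []
Unique-concatMap g (x ∷ xs) (ax ∷ ux) ug dj = UP.++⁺ (ug x (here refl)) (Unique-concatMap g xs ux (λ a m → ug a (there m)) (λ a a' z ma ma' → dj a a' z (there ma) (there ma'))) d
  where d : ∀ {v} → ¬ (v ∈ g x × v ∈ concatMap g xs)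
        d (m1 , m2) with ∈-concatMap⁻′ g xs _ m2
        ... | a' , am , m3 = lookup ax am (dj x a' _ (here refl) (there am) m1 m3)

Unique-map-injectiveOn : {A B : Set} (h : A → B) (xs : List A) → Unique xs → (∀ x y → x ∈ xs → y ∈ xs → h x ≡ h y → x ≡ y) → Unique (map h xs)
Unique-map-injectiveOn h [] u inj = []
Unique-map-injectiveOn h (x ∷ xs) (ax ∷ u) inj = all' xs ax (λ y m → inj x y (here refl) (there m)) ∷ Unique-map-injectiveOn h xs u (λ a b ma mb → inj a b (there ma) (there mb))
  where
  all' : ∀ ys → All (x ≢_) ys → (∀ y → y ∈ ys → h x ≡ h y → x ≡ y) → All (h x ≢_) (map h ys)
  all' [] _ _ = []
  all' (y ∷ ys) (p ∷ ps) i = (λ e → p (i y (here refl) e)) ∷ all' ys ps (λ y' m → i y' (there m))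

∈-middle⁻ : ∀ (p q : List Entry) x e → e ∈ p ++ x ∷ q → (e ≡ x) ⊎ (e ∈ p ++ q)
∈-middle⁻ [] q x e (here eq) = inj₁ eq
∈-middle⁻ [] q x e (there m) = inj₂ m
∈-middle⁻ (y ∷ p) q x e (here eq) = inj₂ (here eq)
∈-middle⁻ (y ∷ p) q x e (there m) with ∈-middle⁻ p q x e m
... | inj₁ a = inj₁ a
... | inj₂ a = inj₂ (there a)

foldr-⊓-≤-seed : ∀ s xs → foldr _⊓_ s xs ≤ s
foldr-⊓-≤-seed s [] = ℕP.≤-refl
foldr-⊓-≤-seed s (x ∷ xs) = ℕP.≤-trans (ℕP.m⊓n≤n x _) (foldr-⊓-≤-seed s xs)

foldr-⊓-≤ : ∀ s xs y → y ∈ xs → foldr _⊓_ s xs ≤ y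
foldr-⊓-≤ s (x ∷ xs) y (here refl) = ℕP.m⊓n≤m x _
foldr-⊓-≤ s (x ∷ xs) y (there m) = ℕP.≤-trans (ℕP.m⊓n≤n x _) (foldr-⊓-≤ s xs y m)

foldr-⊓-∈ : ∀ s xs → foldr _⊓_ s xs ∈ (s ∷ xs)
foldr-⊓-∈ s [] = here refl
foldr-⊓-∈ s (x ∷ xs) with ℕP.⊓-sel x (foldr _⊓_ s xs)
... | inj₁ e rewrite e = there (here refl)
... | inj₂ e rewrite e with foldr-⊓-∈ s xs
... | here p = here p
... | there p = there (there p)

blockMin-≤ : ∀ xs y → y ∈ xs → blockMin xs ≤ y
blockMin-≤ (x ∷ xs) y (here refl) = foldr-⊓-≤-seed x xs
blockMin-≤ (x ∷ xs) y (there m) = foldr-⊓-≤ x xs y m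

blockMin-∈ : ∀ x xs → blockMin (x ∷ xs) ∈ (x ∷ xs)
blockMin-∈ x xs = foldr-⊓-∈ x xs

blockMin-≡-∷ : ∀ x xs y ys → (∀ a → a ∈ (x ∷ xs) → ∃[ b ] (b ∈ (y ∷ ys) × b ≤ a))
                    → (∀ b → b ∈ (y ∷ ys) → ∃[ a ] (a ∈ (x ∷ xs) × a ≤ b))
                    → blockMin (x ∷ xs) ≡ blockMin (y ∷ ys)
blockMin-≡-∷ x xs y ys f g = ℕP.≤-antisym l1 l2
  where
  l1 : blockMin (x ∷ xs) ≤ blockMin (y ∷ ys)
  l1 with g _ (blockMin-∈ y ys)
  ... | a , am , a≤ = ℕP.≤-trans (blockMin-≤ (x ∷ xs) a am) a≤
  l2 : blockMin (y ∷ ys) ≤ blockMin (x ∷ xs)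
  l2 with f _ (blockMin-∈ x xs)
  ... | b , bm , b≤ = ℕP.≤-trans (blockMin-≤ (y ∷ ys) b bm) b≤

blockMin-≡ : ∀ L1 L2 → L1 ≢ [] → L2 ≢ [] → (∀ a → a ∈ L1 → ∃[ b ] (b ∈ L2 × b ≤ a)) → (∀ b → b ∈ L2 → ∃[ a ] (a ∈ L1 × a ≤ b)) → blockMin L1 ≡ blockMin L2
blockMin-≡ [] L2 n1 n2 f g = ⊥-elim (n1 refl)
blockMin-≡ (x ∷ xs) [] n1 n2 f g = ⊥-elim (n2 refl)
blockMin-≡ (x ∷ xs) (y ∷ ys) n1 n2 f g = blockMin-≡-∷ x xs y ys f g

vals-++ : ∀ p q → vals (p ++ q) ≡ vals p ++ vals q
vals-++ p q = map-++ proj₁ p q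

vals-middle : ∀ (p q : Block) (e : Entry) → vals (p ++ e ∷ q) ≡ vals p ++ proj₁ e ∷ vals q
vals-middle p q e = map-++ proj₁ p (e ∷ q)

∈-vals-middle⁻ : ∀ (e : Entry) p q a → a ∈ vals (p ++ e ∷ q) → a ≡ proj₁ e ⊎ a ∈ vals (p ++ q)
∈-vals-middle⁻ e [] q a (here refl) = inj₁ refl
∈-vals-middle⁻ e [] q a (there m) = inj₂ m
∈-vals-middle⁻ e (y ∷ p) q a (here refl) = inj₂ (here refl)
∈-vals-middle⁻ e (y ∷ p) q a (there m) with ∈-vals-middle⁻ e p q a m
... | inj₁ x = inj₁ x
... | inj₂ x = inj₂ (there x)

∈-vals-middle⁺ : ∀ (e : Entry) p q a → a ∈ vals (p ++ q) → a ∈ vals (p ++ e ∷ q)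
∈-vals-middle⁺ e [] q a m = there m
∈-vals-middle⁺ e (y ∷ p) q a (here refl) = here refl
∈-vals-middle⁺ e (y ∷ p) q a (there m) = there (∈-vals-middle⁺ e p q a m)

∈-vals-++⁺ˡ : ∀ (p q : Block) y → y ∈ vals p → y ∈ vals (p ++ q)
∈-vals-++⁺ˡ (z ∷ p) q y (here refl) = here refl
∈-vals-++⁺ˡ (z ∷ p) q y (there m) = there (∈-vals-++⁺ˡ p q y m)

∈-vals-++⁺ʳ : ∀ (p q : Block) y → y ∈ vals q → y ∈ vals (p ++ q)
∈-vals-++⁺ʳ [] q y m = m
∈-vals-++⁺ʳ (z ∷ p) q y m = there (∈-vals-++⁺ʳ p q y m)

blockMin-insert : ∀ x₁ (e : Entry) p q → x₁ ≤ proj₁ e → blockMin (x₁ ∷ vals (p ++ e ∷ q)) ≡ blockMin (x₁ ∷ vals (p ++ q))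
blockMin-insert x₁ e p q le = blockMin-≡-∷ x₁ _ x₁ _ f g
  where
  f : ∀ a → a ∈ (x₁ ∷ vals (p ++ e ∷ q)) → ∃[ b ] (b ∈ (x₁ ∷ vals (p ++ q)) × b ≤ a)
  f a (here refl) = a , here refl , ℕP.≤-refl
  f a (there m) with ∈-vals-middle⁻ e p q a m
  ... | inj₁ refl = x₁ , here refl , le
  ... | inj₂ m' = a , there m' , ℕP.≤-refl
  g : ∀ b → b ∈ (x₁ ∷ vals (p ++ q)) → ∃[ a ] (a ∈ (x₁ ∷ vals (p ++ e ∷ q)) × a ≤ b)
  g b (here refl) = b , here refl , ℕP.≤-refl
  g b (there m) = b , there (∈-vals-middle⁺ e p q b m) , ℕP.≤-refl

blockMin-cons-larger : ∀ v x₁ xs → x₁ ≤ v → blockMin (v ∷ x₁ ∷ vals xs) ≡ blockMin (x₁ ∷ vals xs)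
blockMin-cons-larger v x₁ xs le = blockMin-≡-∷ v (x₁ ∷ vals xs) x₁ (vals xs) f g
    where
    f : ∀ a → a ∈ (v ∷ x₁ ∷ vals xs) → ∃[ b ] (b ∈ (x₁ ∷ vals xs) × b ≤ a)
    f a (here refl) = x₁ , here refl , le
    f a (there m) = a , m , ℕP.≤-refl
    g : ∀ b → b ∈ (x₁ ∷ vals xs) → ∃[ a ] (a ∈ (v ∷ x₁ ∷ vals xs) × a ≤ b)
    g b m = b , there m , ℕP.≤-refl

blockMin-snoc : ∀ v b → b ≢ [] → (∀ y → y ∈ vals b → y ≤ v) → blockMin (vals (b ++ [ (v , true) ])) ≡ blockMin (vals b)
blockMin-snoc v [] nb _ = ⊥-elim (nb refl)
blockMin-snoc v (x ∷ xs) _ le = trans (blockMin-insert (proj₁ x) (v , true) xs [] (le _ (here refl))) (cong (λ L → blockMin (proj₁ x ∷ vals L)) (++-identityʳ xs))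

uncirc-++ : ∀ p q → uncirc (p ++ q) ≡ uncirc p ++ uncirc q
uncirc-++ p q = trans (cong vals (filterᵇ-++ (not ∘ proj₂) p q)) (map-++ proj₁ (filterᵇ (not ∘ proj₂) p) _)

uncirc⊆vals : ∀ b y → y ∈ uncirc b → y ∈ vals b
uncirc⊆vals ((x , false) ∷ b) y (here refl) = here refl
uncirc⊆vals ((x , false) ∷ b) y (there m) = there (uncirc⊆vals b y m)
uncirc⊆vals ((x , true) ∷ b) y m = there (uncirc⊆vals b y m)

any-circled1-insert : ∀ p q (e : Entry) → circled1 e ≡ false → any circled1 (p ++ e ∷ q) ≡ any circled1 (p ++ q)
any-circled1-insert p q e ce = trans (any-++ circled1 p (e ∷ q)) (trans (cong (λ t → any circled1 p ∨ (t ∨ any circled1 q)) ce) (sym (any-++ circled1 p q)))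

count-circled-insert : ∀ p q (e : Entry) → proj₂ e ≡ false → count proj₂ (p ++ e ∷ q) ≡ count proj₂ (p ++ q)
count-circled-insert p q e ce = count-middle-false proj₂ p q e ce

isRecordLow : List ℕ → ℕ → Bool
isRecordLow pre x = all (λ y → not (y <ᵇ x)) pre

markRecGo-++ : ∀ pre a b → markRecGo pre (a ++ b) ≡ markRecGo pre a ++ markRecGo (pre ++ a) b
markRecGo-++ pre [] b = cong (λ p → markRecGo p b) (sym (++-identityʳ pre))
markRecGo-++ pre (x ∷ a) b = cong ((x , isRecordLow pre x) ∷_) (trans (markRecGo-++ (pre ++ [ x ]) a b) (cong (λ p → markRecGo (pre ++ [ x ]) a ++ markRecGo p b) (++-assoc pre [ x ] a)))

markRecGo-cong-prefix : ∀ v pre pre' u → (∀ x → x < v → isRecordLow pre x ≡ isRecordLow pre' x) → (∀ y → y ∈ u → y < v) → markRecGo pre u ≡ markRecGo pre' u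
markRecGo-cong-prefix v pre pre' [] R s = refl
markRecGo-cong-prefix v pre pre' (x ∷ u) R s = cong₂ _∷_ (cong (x ,_) (R x (s x (here refl)))) (markRecGo-cong-prefix v (pre ++ [ x ]) (pre' ++ [ x ]) u R' (λ y m → s y (there m)))
  where R' : ∀ y → y < v → isRecordLow (pre ++ [ x ]) y ≡ isRecordLow (pre' ++ [ x ]) y
        R' y y<v = trans (all-++ _ pre [ x ]) (trans (cong (_∧ _) (R y y<v)) (sym (all-++ _ pre' [ x ])))

isRecordLow-snoc-larger : ∀ v pre x → x < v → isRecordLow (pre ++ [ v ]) x ≡ isRecordLow pre x
isRecordLow-snoc-larger v pre x x<v rewrite all-++ (λ y → not (y <ᵇ x)) pre [ v ] | ≤⇒>ᵇ≡false {v} {x} (ℕP.<⇒≤ x<v) = ∧-identityʳ (isRecordLow pre x)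

markRec-cons-larger : ∀ v u → (∀ y → y ∈ u → y < v) → markRec (v ∷ u) ≡ (v , true) ∷ markRec u
markRec-cons-larger v u smu = cong ((v , true) ∷_) (markRecGo-cong-prefix v [ v ] [] u (λ x x<v → isRecordLow-snoc-larger v [] x x<v) smu)

readVals-cons : ∀ b bs → readVals (b ∷ bs) ≡ vals b ++ readVals bs
readVals-cons b bs = map-++ proj₁ b (concat bs)

readVals-++ : ∀ z1 z2 → readVals (z1 ++ z2) ≡ readVals z1 ++ readVals z2
readVals-++ z1 z2 = trans (cong vals (sym (concat-++ z1 z2))) (map-++ proj₁ (concat z1) (concat z2))

readVals-mid : ∀ z1 B z2 → readVals (z1 ++ B ∷ z2) ≡ readVals z1 ++ vals B ++ readVals z2
readVals-mid z1 B z2 = trans (readVals-++ z1 (B ∷ z2)) (cong (readVals z1 ++_) (readVals-cons B z2))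

readVals-tail : ∀ b bs y → y ∈ readVals bs → y ∈ readVals (b ∷ bs)
readVals-tail b bs y ym = subst (y ∈_) (sym (map-++ proj₁ b (concat bs))) (∈-++⁺ʳ (vals b) ym)

readVals-head : ∀ b bs y → y ∈ vals b → y ∈ readVals (b ∷ bs)
readVals-head b bs y ym = subst (y ∈_) (sym (map-++ proj₁ b (concat bs))) (∈-++⁺ˡ ym)

∈-block⇒∈-readVals : ∀ z b y → b ∈ z → y ∈ vals b → y ∈ readVals z
∈-block⇒∈-readVals z b y bm ym with ∈-map⁻ proj₁ ym
... | e , em , refl = ∈-map⁺ proj₁ (∈-concat⁺′ em bm)

∈-block⇒∈-reading : ∀ z b e → b ∈ z → e ∈ b → e ∈ reading z
∈-block⇒∈-reading z b e bm em = ∈-concat⁺′ em bm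

blockOf-find : ∀ i z1 B z2 → ¬ (i ∈ readVals z1) → i ∈ vals B → blockOf i (z1 ++ B ∷ z2) ≡ B
blockOf-find i [] B z2 ni ib = if-true (elemᵇ i (vals B)) B _ (∈⇒elemᵇ≡true i _ ib)
blockOf-find i (b ∷ z1) B z2 ni ib = trans (if-false (elemᵇ i (vals b)) b _ (∉⇒elemᵇ≡false i _ (λ m → ni (readVals-head b z1 i m))))
  (blockOf-find i z1 B z2 (λ m → ni (readVals-tail b z1 i m)) ib)

blockOf-cases : ∀ i z → (blockOf i z ≡ []) ⊎ (blockOf i z ∈ z × i ∈ vals (blockOf i z))
blockOf-cases i [] = inj₁ refl
blockOf-cases i (b ∷ bs) with elemᵇ i (vals b) in eq
... | true = inj₂ (here refl , elemᵇ≡true⇒∈ i _ eq)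
... | false with blockOf-cases i bs
... | inj₁ x = inj₁ x
... | inj₂ (m , x) = inj₂ (there m , x)

blockMins : LahStar → List ℕ
blockMins z = map (blockMin ∘ vals) z

blockMins-++ : ∀ z1 z2 → blockMins (z1 ++ z2) ≡ blockMins z1 ++ blockMins z2
blockMins-++ z1 z2 = map-++ (blockMin ∘ vals) z1 z2

readVals≡[]⇒≡[] : ∀ z → (∀ b → b ∈ z → b ≢ []) → readVals z ≡ [] → z ≡ []
readVals≡[]⇒≡[] [] ne e = refl
readVals≡[]⇒≡[] ([] ∷ z) ne e = ⊥-elim (ne [] (here refl) refl)
readVals≡[]⇒≡[] ((x ∷ xs) ∷ z) ne ()

readVals-nonempty : ∀ b bs → b ≢ [] → 1 ≤ length (readVals (b ∷ bs))
readVals-nonempty [] bs nb = ⊥-elim (nb refl)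
readVals-nonempty (x ∷ xs) bs _ = s≤s z≤n

blockMin-≤-bound : ∀ z b v → b ∈ z → b ≢ [] → (∀ y → y ∈ readVals z → y ≤ v) → blockMin (vals b) ≤ v
blockMin-≤-bound z [] v bm nb le = ⊥-elim (nb refl)
blockMin-≤-bound z (x ∷ xs) v bm nb le = le _ (∈-block⇒∈-readVals z (x ∷ xs) _ bm (blockMin-∈ (proj₁ x) (vals xs)))

StrictlyIncreasing : List ℕ → Set
StrictlyIncreasing [] = ⊤
StrictlyIncreasing (x ∷ L) = All (x <_) L × StrictlyIncreasing L

strictlyIncr⇒StrictlyIncreasing : ∀ L → strictlyIncr L ≡ true → StrictlyIncreasing L
strictlyIncr⇒StrictlyIncreasing [] _ = tt
strictlyIncr⇒StrictlyIncreasing (x ∷ []) _ = [] , tt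
strictlyIncr⇒StrictlyIncreasing (x ∷ y ∷ t) h = aux (strictlyIncr⇒StrictlyIncreasing (y ∷ t) (proj₂ (∧≡true⁻ {x <ᵇ y} h)))
  where
  x<y = ℕP.<ᵇ⇒< x y (≡true⇒T (proj₁ (∧≡true⁻ {x <ᵇ y} h)))
  aux : StrictlyIncreasing (y ∷ t) → StrictlyIncreasing (x ∷ y ∷ t)
  aux (ay , sy) = (x<y ∷ All.map (ℕP.<-trans x<y) ay) , (ay , sy)

StrictlyIncreasing⇒strictlyIncr : ∀ L → StrictlyIncreasing L → strictlyIncr L ≡ true
StrictlyIncreasing⇒strictlyIncr [] _ = refl
StrictlyIncreasing⇒strictlyIncr (x ∷ []) _ = refl
StrictlyIncreasing⇒strictlyIncr (x ∷ y ∷ t) ((x<y ∷ _) , s) = ∧≡true⁺ (<⇒<ᵇ≡true x<y) (StrictlyIncreasing⇒strictlyIncr (y ∷ t) s)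

StrictlyIncreasing-middle : ∀ L1 x L2 → StrictlyIncreasing (L1 ++ x ∷ L2) → All (x <_) L2
StrictlyIncreasing-middle [] x L2 (a , _) = a
StrictlyIncreasing-middle (y ∷ L1) x L2 (_ , s) = StrictlyIncreasing-middle L1 x L2 s

StrictlyIncreasing-snoc : ∀ L v → StrictlyIncreasing L → All (_< v) L → StrictlyIncreasing (L ++ [ v ])
StrictlyIncreasing-snoc [] v _ _ = [] , tt
StrictlyIncreasing-snoc (x ∷ L) v (a , s) (xv ∷ av) = AllP.++⁺ a (xv ∷ []) , StrictlyIncreasing-snoc L v s av

-- Building Lah* objects by placing the largest element

Below : ℕ → Block → Set
Below v b = ∀ y → y ∈ vals b → y < v

WellFormedBlock : ℕ → Block → Set
WellFormedBlock v [] = ⊥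
WellFormedBlock v (x ∷ xs) = (proj₂ x ≡ true → proj₁ x ≡ 1) × (all (not ∘ circled1) xs ≡ true) × Below v (x ∷ xs)

all-not⇒any≡false : ∀ xs → all (not ∘ circled1) xs ≡ true → any circled1 xs ≡ false
all-not⇒any≡false [] e = refl
all-not⇒any≡false (x ∷ xs) e with circled1 x
... | true = ⊥-elim (false≢true e)
... | false = all-not⇒any≡false xs e

snocLastBlock : Entry → LahStar → LahStar
snocLastBlock e [] = [ [ e ] ]
snocLastBlock e (b ∷ []) = (b ++ [ e ]) ∷ []
snocLastBlock e (b ∷ b' ∷ bs) = b ∷ snocLastBlock e (b' ∷ bs)

insertions : Entry → Block → List Block
insertions e [] = [ e ] ∷ []
insertions e (x ∷ xs) = (e ∷ x ∷ xs) ∷ map (x ∷_) (insertions e xs)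

blockInsertions : Entry → Block → List Block
blockInsertions e [] = [ e ] ∷ []
blockInsertions e (x ∷ xs) = if proj₂ x then map (x ∷_) (insertions e xs) else insertions e (x ∷ xs)

blocksInsertions : Entry → LahStar → List LahStar
blocksInsertions e [] = []
blocksInsertions e (b ∷ bs) = map (_∷ bs) (blockInsertions e b) ++ map (b ∷_) (blocksInsertions e bs)

extensions : ℕ → LahStar → List LahStar
extensions v ls = (ls ++ [ [ (v , false) ] ]) ∷ snocLastBlock (v , true) ls ∷ blocksInsertions (v , false) ls

lahStars : ℕ → List LahStar
lahStars zero = [] ∷ []
lahStars (suc n) = concatMap (extensions (suc n)) (lahStars n)

insertions-shape : ∀ e xs b' → b' ∈ insertions e xs → ∃[ p ] ∃[ q ] (xs ≡ p ++ q × b' ≡ p ++ e ∷ q)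
insertions-shape e [] b' (here refl) = [] , [] , refl , refl
insertions-shape e (x ∷ xs) b' (here refl) = [] , x ∷ xs , refl , refl
insertions-shape e (x ∷ xs) b' (there m) with ∈-map⁻ (x ∷_) m
... | c , cm , refl with insertions-shape e xs c cm
... | p , q , refl , refl = x ∷ p , q , refl , refl

length-insertions : ∀ e xs → length (insertions e xs) ≡ suc (length xs)
length-insertions e [] = refl
length-insertions e (x ∷ xs) = cong suc (trans (length-map (x ∷_) (insertions e xs)) (length-insertions e xs))

insertions-length : ∀ e xs b' → b' ∈ insertions e xs → length b' ≡ suc (length xs)
insertions-length e xs b' m with insertions-shape e xs b' m
... | p , q , refl , refl = trans (length-++ p {e ∷ q}) (trans (ℕP.+-suc (length p) (length q)) (cong suc (sym (length-++ p {q}))))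

blockInsertions-length : ∀ v b → WellFormedBlock v b → ∀ b' → b' ∈ blockInsertions (v , false) b → length b' ≡ suc (length b)
blockInsertions-length v ((x₁ , false) ∷ xs) _ b' m = insertions-length (v , false) ((x₁ , false) ∷ xs) b' m
blockInsertions-length v ((x₁ , true) ∷ xs) _ b' m with ∈-map⁻ ((x₁ , true) ∷_) m
... | c , cm , refl = cong suc (insertions-length (v , false) xs c cm)

blockInsertions-shape : ∀ v b → WellFormedBlock v b → ∀ b' → b' ∈ blockInsertions (v , false) b → ∃[ p ] ∃[ q ] (b ≡ p ++ q × b' ≡ p ++ (v , false) ∷ q)
blockInsertions-shape v ((x₁ , false) ∷ xs) _ b' m = insertions-shape (v , false) ((x₁ , false) ∷ xs) b' m
blockInsertions-shape v ((x₁ , true) ∷ xs) _ b' m with ∈-map⁻ ((x₁ , true) ∷_) m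
... | c , cm , refl with insertions-shape (v , false) xs c cm
... | p , q , refl , refl = (x₁ , true) ∷ p , q , refl , refl

reading-snocLastBlock : ∀ e z → reading (snocLastBlock e z) ≡ reading z ++ [ e ]
reading-snocLastBlock e [] = refl
reading-snocLastBlock e (b ∷ []) = trans (++-identityʳ (b ++ [ e ])) (cong (_++ [ e ]) (sym (++-identityʳ b)))
reading-snocLastBlock e (b ∷ b' ∷ bs) = trans (cong (b ++_) (reading-snocLastBlock e (b' ∷ bs))) (sym (++-assoc b (concat (b' ∷ bs)) [ e ]))

snocLastBlock-shape : ∀ (e : Entry) b bs → ∃[ z1 ] ∃[ b' ] ((b ∷ bs ≡ z1 ++ [ b' ]) × (snocLastBlock e (b ∷ bs) ≡ z1 ++ [ b' ++ [ e ] ]))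
snocLastBlock-shape e b [] = [] , b , refl , refl
snocLastBlock-shape e b (b2 ∷ bs) with snocLastBlock-shape e b2 bs
... | z1 , b' , e1 , e2 = b ∷ z1 , b' , cong (b ∷_) e1 , cong (b ∷_) e2

numTrue-∷ : ∀ b bs → numTrue (b ∷ bs) ≡ boolToℕ (isTrue b) ℕ.+ numTrue bs
numTrue-∷ b bs = count-cons isTrue b bs

WellFormedBlock-weaken : ∀ v b → WellFormedBlock v b → WellFormedBlock (suc v) b
WellFormedBlock-weaken v (x ∷ xs) (h , t , s) = h , t , (λ y m → ℕP.m<n⇒m<1+n (s y m))

isTrue-snoc-circled : ∀ b v → (v ≡ᵇ 1) ≡ false → isTrue (b ++ [ (v , true) ]) ≡ isTrue b
isTrue-snoc-circled b v v1 = cong not (trans (any-++ circled1 b [ (v , true) ]) (trans (cong (λ t → any circled1 b ∨ (t ∨ false)) v1) (∨-identityʳ _)))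

blockInsertions-isTrue : ∀ v b → WellFormedBlock v b → ∀ b' → b' ∈ blockInsertions (v , false) b → isTrue b' ≡ isTrue b
blockInsertions-isTrue v ((x₁ , false) ∷ xs) (h , t , sm) b' (here refl) = refl
blockInsertions-isTrue v ((x₁ , false) ∷ xs) (h , t , sm) b' (there m) with ∈-map⁻ ((x₁ , false) ∷_) m
... | c , cm , refl with insertions-shape (v , false) xs c cm
... | p , q , refl , refl = cong not (any-circled1-insert p q (v , false) refl)
blockInsertions-isTrue v ((x₁ , true) ∷ xs) (h , t , sm) b' m with h refl
... | refl with ∈-map⁻ ((1 , true) ∷_) m
... | c , cm , refl = refl

all-not-circled1-insert : ∀ p q (e : Entry) → circled1 e ≡ false → all (not ∘ circled1) (p ++ q) ≡ true → all (not ∘ circled1) (p ++ e ∷ q) ≡ true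
all-not-circled1-insert p q e ce h = trans (all-++ (not ∘ circled1) p (e ∷ q)) (trans (cong (λ t → all (not ∘ circled1) p ∧ (not t ∧ all (not ∘ circled1) q)) ce)
  (trans (sym (all-++ (not ∘ circled1) p q)) h))

Below-insert : ∀ v x p q (e : Entry) → proj₁ e < suc v → Below v (x ∷ p ++ q) → Below (suc v) (x ∷ p ++ e ∷ q)
Below-insert v x p q e ev sm y (here refl) = ℕP.m<n⇒m<1+n (sm y (here refl))
Below-insert v x p q e ev sm y (there m) with ∈-vals-middle⁻ e p q y m
... | inj₁ refl = ev
... | inj₂ m' = ℕP.m<n⇒m<1+n (sm y (there m'))

blockInsertions-wellFormed : ∀ v b → WellFormedBlock v b → ∀ b' → b' ∈ blockInsertions (v , false) b → WellFormedBlock (suc v) b'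
blockInsertions-wellFormed v ((x₁ , false) ∷ xs) (h , t , sm) b' (here refl) =
  (λ ()) , t , sm'
  where
  sm' : Below (suc v) ((v , false) ∷ (x₁ , false) ∷ xs)
  sm' y (here refl) = ℕP.≤-refl
  sm' y (there m) = ℕP.m<n⇒m<1+n (sm y m)
blockInsertions-wellFormed v ((x₁ , false) ∷ xs) (h , t , sm) b' (there m) with ∈-map⁻ ((x₁ , false) ∷_) m
... | c , cm , refl with insertions-shape (v , false) xs c cm
... | p , q , refl , refl = h , all-not-circled1-insert p q (v , false) refl t , Below-insert v (x₁ , false) p q (v , false) ℕP.≤-refl sm
blockInsertions-wellFormed v ((x₁ , true) ∷ xs) (h , t , sm) b' m with ∈-map⁻ ((x₁ , true) ∷_) m
... | c , cm , refl with insertions-shape (v , false) xs c cm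
... | p , q , refl , refl = h , all-not-circled1-insert p q (v , false) refl t , Below-insert v (x₁ , true) p q (v , false) ℕP.≤-refl sm

blocksInsertions-numTrue : ∀ v z → All (WellFormedBlock v) z → ∀ z' → z' ∈ blocksInsertions (v , false) z → numTrue z' ≡ numTrue z
blocksInsertions-numTrue v (b ∷ bs) (ib ∷ ibs) z' m with ∈-++⁻ (map (_∷ bs) (blockInsertions (v , false) b)) m
... | inj₁ m1 with ∈-map⁻ (_∷ bs) m1
... | b' , bm , refl = trans (numTrue-∷ b' bs) (trans (cong (λ t → boolToℕ t ℕ.+ numTrue bs) (blockInsertions-isTrue v b ib b' bm)) (sym (numTrue-∷ b bs)))
blocksInsertions-numTrue v (b ∷ bs) (ib ∷ ibs) z' m | inj₂ m2 with ∈-map⁻ (b ∷_) m2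
... | z'' , zm , refl = trans (numTrue-∷ b z'') (trans (cong (boolToℕ (isTrue b) ℕ.+_) (blocksInsertions-numTrue v bs ibs z'' zm)) (sym (numTrue-∷ b bs)))

blocksInsertions-size : ∀ v z → All (WellFormedBlock v) z → ∀ z' → z' ∈ blocksInsertions (v , false) z → length (reading z') ≡ suc (length (reading z))
blocksInsertions-size v (b ∷ bs) (ib ∷ ibs) z' m with ∈-++⁻ (map (_∷ bs) (blockInsertions (v , false) b)) m
... | inj₁ m1 with ∈-map⁻ (_∷ bs) m1
... | b' , bm , refl = trans (length-++ b' {concat bs}) (trans (cong (ℕ._+ length (concat bs)) (blockInsertions-length v b ib b' bm)) (cong suc (sym (length-++ b {concat bs}))))
blocksInsertions-size v (b ∷ bs) (ib ∷ ibs) z' m | inj₂ m2 with ∈-map⁻ (b ∷_) m2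
... | z'' , zm , refl = trans (length-++ b {concat z''}) (trans (cong (length b ℕ.+_) (blocksInsertions-size v bs ibs z'' zm))
     (trans (ℕP.+-suc (length b) _) (cong suc (sym (length-++ b {concat bs})))))

blocksInsertions-wellFormed : ∀ v z → All (WellFormedBlock v) z → ∀ z' → z' ∈ blocksInsertions (v , false) z → All (WellFormedBlock (suc v)) z'
blocksInsertions-wellFormed v (b ∷ bs) (ib ∷ ibs) z' m with ∈-++⁻ (map (_∷ bs) (blockInsertions (v , false) b)) m
... | inj₁ m1 with ∈-map⁻ (_∷ bs) m1
... | b' , bm , refl = blockInsertions-wellFormed v b ib b' bm ∷ All.map (WellFormedBlock-weaken v _) ibs
blocksInsertions-wellFormed v (b ∷ bs) (ib ∷ ibs) z' m | inj₂ m2 with ∈-map⁻ (b ∷_) m2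
... | z'' , zm , refl = WellFormedBlock-weaken v b ib ∷ blocksInsertions-wellFormed v bs ibs z'' zm

snocLastBlock-wellFormed : ∀ v b bs → (v ≡ᵇ 1) ≡ false → All (WellFormedBlock v) (b ∷ bs) → All (WellFormedBlock (suc v)) (snocLastBlock (v , true) (b ∷ bs))
snocLastBlock-wellFormed v (x ∷ xs) [] v1 ((h , t , sm) ∷ []) =
  (h , all-not-circled1-insert xs [] (v , true) v1 (trans (cong (all (not ∘ circled1)) (++-identityʳ xs)) t)
     , Below-insert v x xs [] (v , true) ℕP.≤-refl (subst (λ L → Below v (x ∷ L)) (sym (++-identityʳ xs)) sm)) ∷ []
snocLastBlock-wellFormed v b (b' ∷ bs) v1 (ib ∷ ibs) = WellFormedBlock-weaken v b ib ∷ snocLastBlock-wellFormed v b' bs v1 ibs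

WellFormed : ℕ → LahStar → Set
WellFormed n z = All (WellFormedBlock (suc n)) z × length (reading z) ≡ n

wellFormed-size≢0 : ∀ v b bs → All (WellFormedBlock v) (b ∷ bs) → length (reading (b ∷ bs)) ≢ 0
wellFormed-size≢0 v (x ∷ xs) bs _ ()
wellFormed-size≢0 v [] bs (() ∷ _) _

numTrue≤size : ∀ v z → All (WellFormedBlock v) z → numTrue z ≤ length (reading z)
numTrue≤size v [] [] = z≤n
numTrue≤size v ((x ∷ xs) ∷ bs) (ib ∷ ibs) rewrite numTrue-∷ (x ∷ xs) bs | length-++ (x ∷ xs) {concat bs} =
  ℕP.+-mono-≤ (tv≤ (isTrue (x ∷ xs))) (numTrue≤size v bs ibs)
  where tv≤ : ∀ t → boolToℕ t ≤ suc (length xs)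
        tv≤ true = s≤s z≤n
        tv≤ false = z≤n

extensions-wellFormed : ∀ n z → WellFormed n z → ∀ z' → z' ∈ extensions (suc n) z → WellFormed (suc n) z'
extensions-wellFormed n z (iz , len) z' (here refl) =
  AllP.++⁺ (All.map (WellFormedBlock-weaken (suc n) _) iz) ((((λ ()) , refl , sm1)) ∷ []) ,
  trans (cong length (sym (concat-++ z [ [ (suc n , false) ] ]))) (trans (length-++ (concat z) {[ (suc n , false) ]}) (trans (ℕP.+-comm _ 1) (cong suc len)))
  where sm1 : Below (suc (suc n)) [ (suc n , false) ]
        sm1 y (here refl) = ℕP.≤-refl
extensions-wellFormed n [] ([] , refl) z' (there (here refl)) = ((λ _ → refl) , refl , sm1) ∷ [] , refl
  where sm1 : Below 2 [ (1 , true) ]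
        sm1 y (here refl) = s≤s (s≤s z≤n)
extensions-wellFormed n (b ∷ bs) (iz , len) z' (there (here refl)) =
  snocLastBlock-wellFormed (suc n) b bs v1 iz , trans (cong length (reading-snocLastBlock (suc n , true) (b ∷ bs))) (trans (length-++ (reading (b ∷ bs)) {[ (suc n , true) ]}) (trans (ℕP.+-comm _ 1) (cong suc len)))
  where v1 : (suc n ≡ᵇ 1) ≡ false
        v1 = ≢⇒≡ᵇ≡false (λ eq → wellFormed-size≢0 (suc n) b bs iz (trans len (ℕP.suc-injective eq)))
extensions-wellFormed n z (iz , len) z' (there (there m)) = blocksInsertions-wellFormed (suc n) z iz z' m , trans (blocksInsertions-size (suc n) z iz z' m) (cong suc len)

lahStars-wellFormed : ∀ n z → z ∈ lahStars n → WellFormed n z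
lahStars-wellFormed zero z (here refl) = [] , refl
lahStars-wellFormed (suc n) z m with ∈-concatMap⁻′ (extensions (suc n)) (lahStars n) z m
... | y , ym , zm = extensions-wellFormed n y (lahStars-wellFormed n y ym) z zm

WellFormedBlock⇒Below : ∀ v b → WellFormedBlock v b → ∀ y → y ∈ vals b → y < v
WellFormedBlock⇒Below v (x ∷ xs) (_ , _ , s) = s

WellFormedBlock⇒nonempty : ∀ v z → All (WellFormedBlock v) z → ∀ b → b ∈ z → b ≢ []
WellFormedBlock⇒nonempty v z a b m refl with lookup a m
... | ()

WellFormedBlock⇒tail-uncircled1 : ∀ v z → All (WellFormedBlock v) z → ∀ b → b ∈ z → all (not ∘ circled1) (tailL b) ≡ true
WellFormedBlock⇒tail-uncircled1 v z a [] m with lookup a m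
... | ()
WellFormedBlock⇒tail-uncircled1 v z a (x ∷ xs) m = proj₁ (proj₂ (lookup a m))

-- Deleting the largest element; nothing is built twice

deleteFromBlock : ℕ → Block → Block
deleteFromBlock v = filterᵇ (λ e → not (proj₁ e ≡ᵇ v))

delete : ℕ → LahStar → LahStar
delete v z = filterᵇ (not ∘ null) (map (deleteFromBlock v) z)

deleteFromBlock-id : ∀ v (b : Block) → (∀ y → y ∈ vals b → y < v) → deleteFromBlock v b ≡ b
deleteFromBlock-id v [] s = refl
deleteFromBlock-id v ((y , c) ∷ b) s = trans (filterᵇ-accept _ (y , c) b (cong not (≢⇒≡ᵇ≡false (λ eq → ℕP.<-irrefl eq (s y (here refl))))))
  (cong ((y , c) ∷_) (deleteFromBlock-id v b (λ y' m → s y' (there m))))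

deleteFromBlock-head : ∀ v c q → deleteFromBlock v ((v , c) ∷ q) ≡ deleteFromBlock v q
deleteFromBlock-head v c q = filterᵇ-reject _ (v , c) q (cong not (≡ᵇ-refl v))

deleteFromBlock-middle : ∀ v c (p q : Block) → (∀ y → y ∈ vals (p ++ q) → y < v) → deleteFromBlock v (p ++ (v , c) ∷ q) ≡ p ++ q
deleteFromBlock-middle v c p q s = trans (filterᵇ-++ _ p ((v , c) ∷ q)) (trans (cong (deleteFromBlock v p ++_) (deleteFromBlock-head v c q))
  (trans (sym (filterᵇ-++ _ p q)) (deleteFromBlock-id v (p ++ q) s)))

delete-id-wellFormed : ∀ v z → All (WellFormedBlock v) z → delete v z ≡ z
delete-id-wellFormed v [] [] = refl
delete-id-wellFormed v ((x ∷ xs) ∷ bs) (ib ∷ ibs) rewrite deleteFromBlock-id v (x ∷ xs) (WellFormedBlock⇒Below v _ ib) = cong ((x ∷ xs) ∷_) (delete-id-wellFormed v bs ibs)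

delete-++ : ∀ v z1 z2 → delete v (z1 ++ z2) ≡ delete v z1 ++ delete v z2
delete-++ v z1 z2 = trans (cong (filterᵇ (not ∘ null)) (map-++ (deleteFromBlock v) z1 z2)) (filterᵇ-++ _ (map (deleteFromBlock v) z1) (map (deleteFromBlock v) z2))

delete-blocksInsertions : ∀ v z → All (WellFormedBlock v) z → ∀ z' → z' ∈ blocksInsertions (v , false) z → delete v z' ≡ z
delete-blocksInsertions v (b ∷ bs) (ib ∷ ibs) z' m with ∈-++⁻ (map (_∷ bs) (blockInsertions (v , false) b)) m
... | inj₁ m1 with ∈-map⁻ (_∷ bs) m1
... | b' , bm , refl with blockInsertions-shape v b ib b' bm
... | p , q , refl , refl = deleted (nonempty p q ib)
  where
  nonempty : ∀ p q → WellFormedBlock v (p ++ q) → ∃[ x ] ∃[ xs ] (p ++ q ≡ x ∷ xs)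
  nonempty (x ∷ p) q _ = x , p ++ q , refl
  nonempty [] (x ∷ q) _ = x , q , refl
  deleted : (∃[ x ] ∃[ xs ] (p ++ q ≡ x ∷ xs)) → delete v ((p ++ (v , false) ∷ q) ∷ bs) ≡ (p ++ q) ∷ bs
  deleted (x , xs , eq) rewrite deleteFromBlock-middle v false p q (WellFormedBlock⇒Below v _ ib) | eq = cong ((x ∷ xs) ∷_) (delete-id-wellFormed v bs ibs)
delete-blocksInsertions v (b ∷ bs) (ib ∷ ibs) z' m | inj₂ m2 with ∈-map⁻ (b ∷_) m2
delete-blocksInsertions v ((x ∷ xs) ∷ bs) (ib ∷ ibs) z' m | inj₂ m2 | z'' , zm , refl
  rewrite deleteFromBlock-id v (x ∷ xs) (WellFormedBlock⇒Below v _ ib) = cong ((x ∷ xs) ∷_) (delete-blocksInsertions v bs ibs z'' zm)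

delete-snocLastBlock : ∀ v b bs → All (WellFormedBlock v) (b ∷ bs) → delete v (snocLastBlock (v , true) (b ∷ bs)) ≡ b ∷ bs
delete-snocLastBlock v (x ∷ xs) [] (ib ∷ []) rewrite deleteFromBlock-middle v true (x ∷ xs) [] (subst (λ L → ∀ y → y ∈ vals L → y < v) (sym (++-identityʳ (x ∷ xs))) (WellFormedBlock⇒Below v _ ib))
  | ++-identityʳ (x ∷ xs) = refl
delete-snocLastBlock v (x ∷ xs) (b' ∷ bs) (ib ∷ ibs) rewrite deleteFromBlock-id v (x ∷ xs) (WellFormedBlock⇒Below v _ ib) = cong ((x ∷ xs) ∷_) (delete-snocLastBlock v b' bs ibs)

delete-extensions : ∀ n z → WellFormed n z → ∀ z' → z' ∈ extensions (suc n) z → delete (suc n) z' ≡ z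
delete-extensions n z (iz , len) z' (here refl) = trans (delete-++ (suc n) z _) (trans (cong (_++ delete (suc n) [ [ (suc n , false) ] ]) (delete-id-wellFormed (suc n) z iz))
  (trans (cong (λ t → z ++ filterᵇ (not ∘ null) [ t ]) (deleteFromBlock-head (suc n) false [])) (++-identityʳ z)))
delete-extensions n [] ([] , refl) z' (there (here refl)) = refl
delete-extensions n (b ∷ bs) (iz , len) z' (there (here refl)) = delete-snocLastBlock (suc n) b bs iz
delete-extensions n z (iz , len) z' (there (there m)) = delete-blocksInsertions (suc n) z iz z' m

blocksInsertions-reading : ∀ v z → All (WellFormedBlock v) z → ∀ z' → z' ∈ blocksInsertions (v , false) z → ∃[ p ] ∃[ q ] (reading z ≡ p ++ q × reading z' ≡ p ++ (v , false) ∷ q)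
blocksInsertions-reading v (b ∷ bs) (ib ∷ ibs) z' m with ∈-++⁻ (map (_∷ bs) (blockInsertions (v , false) b)) m
... | inj₁ m1 with ∈-map⁻ (_∷ bs) m1
... | b' , bm , refl with blockInsertions-shape v b ib b' bm
... | p , q , refl , refl = p , q ++ concat bs , ++-assoc p q (concat bs) , ++-assoc p ((v , false) ∷ q) (concat bs)
blocksInsertions-reading v (b ∷ bs) (ib ∷ ibs) z' m | inj₂ m2 with ∈-map⁻ (b ∷_) m2
... | z'' , zm , refl with blocksInsertions-reading v bs ibs z'' zm
... | p , q , e1 , e2 = b ++ p , q , trans (cong (b ++_) e1) (sym (++-assoc b p q)) , trans (cong (b ++_) e2) (sym (++-assoc b p _))

blocksInsertions-length : ∀ v z → ∀ z' → z' ∈ blocksInsertions (v , false) z → length z' ≡ length z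
blocksInsertions-length v (b ∷ bs) z' m with ∈-++⁻ (map (_∷ bs) (blockInsertions (v , false) b)) m
... | inj₁ m1 with ∈-map⁻ (_∷ bs) m1
... | b' , bm , refl = refl
blocksInsertions-length v (b ∷ bs) z' m | inj₂ m2 with ∈-map⁻ (b ∷_) m2
... | z'' , zm , refl = cong suc (blocksInsertions-length v bs z'' zm)

Unique-insertions : ∀ (e : Entry) xs → ¬ (e ∈ xs) → Unique (insertions e xs)
Unique-insertions e [] ne = [] ∷ []
Unique-insertions e (x ∷ xs) ne = allne (insertions e xs) ∷ UP.map⁺ (λ {a} {b} eq → ∷-inj eq) (Unique-insertions e xs (λ m → ne (there m)))
  where
  ∷-inj : ∀ {a b : Block} → x ∷ a ≡ x ∷ b → a ≡ b
  ∷-inj refl = refl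
  allne : ∀ L → All ((e ∷ x ∷ xs) ≢_) (map (x ∷_) L)
  allne [] = []
  allne (l ∷ L) = (λ eq → ne (here (hd eq))) ∷ allne L
    where hd : ∀ {a b : Entry} {c d : Block} → a ∷ c ≡ b ∷ d → a ≡ b
          hd refl = refl

Below⇒∉ : ∀ v c (b : Block) → (∀ y → y ∈ vals b → y < v) → ¬ ((v , c) ∈ b)
Below⇒∉ v c b s m = ℕP.<-irrefl refl (s v (∈-map⁺ proj₁ m))

Unique-blockInsertions : ∀ v b → WellFormedBlock v b → Unique (blockInsertions (v , false) b)
Unique-blockInsertions v ((x₁ , false) ∷ xs) ib = Unique-insertions (v , false) ((x₁ , false) ∷ xs) (Below⇒∉ v false _ (WellFormedBlock⇒Below v _ ib))
Unique-blockInsertions v ((x₁ , true) ∷ xs) ib = UP.map⁺ (λ {a} {b} eq → ∷-inj eq) (Unique-insertions (v , false) xs (λ m → Below⇒∉ v false ((x₁ , true) ∷ xs) (WellFormedBlock⇒Below v _ ib) (there m)))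
  where
  ∷-inj : ∀ {a b : Block} → (x₁ , true) ∷ a ≡ (x₁ , true) ∷ b → a ≡ b
  ∷-inj refl = refl

Unique-blocksInsertions : ∀ v z → All (WellFormedBlock v) z → Unique (blocksInsertions (v , false) z)
Unique-blocksInsertions v [] [] = []
Unique-blocksInsertions v (b ∷ bs) (ib ∷ ibs) = UP.++⁺ (UP.map⁺ (λ {a} {c} eq → hd eq) (Unique-blockInsertions v b ib)) (UP.map⁺ (λ {a} {c} eq → tl eq) (Unique-blocksInsertions v bs ibs)) d
  where
  hd : ∀ {a c : Block} {d e : LahStar} → a ∷ d ≡ c ∷ e → a ≡ c
  hd refl = refl
  tl : ∀ {a : Block} {d e : LahStar} → a ∷ d ≡ a ∷ e → d ≡ e
  tl refl = refl
  d : ∀ {w} → ¬ (w ∈ map (_∷ bs) (blockInsertions (v , false) b) × w ∈ map (b ∷_) (blocksInsertions (v , false) bs))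
  d (m1 , m2) with ∈-map⁻ (_∷ bs) m1 | ∈-map⁻ (b ∷_) m2
  ... | b' , bm , refl | z'' , _ , eq = n≢1+n (length b) (trans (cong length (sym (hd eq))) (blockInsertions-length v b ib b' bm))

circ-newBlock : ∀ z (e : Entry) → proj₂ e ≡ false → circ (z ++ [ [ e ] ]) ≡ circ z
circ-newBlock z e ce = trans (cong (count proj₂) (sym (concat-++ z [ [ e ] ]))) (trans (count-++ proj₂ (concat z) [ e ]) (trans (cong (λ t → count proj₂ (concat z) ℕ.+ length t) (filterᵇ-reject proj₂ e [] ce)) (ℕP.+-identityʳ _)))

circ-snocLastBlock : ∀ z v → circ (snocLastBlock (v , true) z) ≡ suc (circ z)
circ-snocLastBlock z v = trans (cong (count proj₂) (reading-snocLastBlock (v , true) z)) (trans (count-++ proj₂ (reading z) [ (v , true) ]) (ℕP.+-comm _ 1))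

circ-blocksInsertions : ∀ v z → All (WellFormedBlock v) z → ∀ z' → z' ∈ blocksInsertions (v , false) z → circ z' ≡ circ z
circ-blocksInsertions v z iz z' m with blocksInsertions-reading v z iz z' m
... | p , q , e1 , e2 = trans (cong (count proj₂) e2) (trans (count-circled-insert p q (v , false) refl) (cong (count proj₂) (sym e1)))

Unique-extensions : ∀ n z → WellFormed n z → Unique (extensions (suc n) z)
Unique-extensions n z (iz , len) = (nb≢sn ∷ allM (λ z' m eq → nb≢mid z' m eq)) ∷ allM (λ z' m eq → sn≢mid z' m eq) ∷ Unique-blocksInsertions (suc n) z iz
  where
  e = (suc n , false)
  nb = z ++ [ [ e ] ]
  sn = snocLastBlock (suc n , true) z
  allM : ∀ {w : LahStar} → (∀ z' → z' ∈ blocksInsertions e z → w ≡ z' → ⊥) → All (w ≢_) (blocksInsertions e z)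
  allM {w} f = All.tabulate (λ {z'} m → f z' m)
  nb≢sn : nb ≢ sn
  nb≢sn eq = n≢1+n (circ z) (trans (sym (circ-newBlock z e refl)) (trans (cong circ eq) (circ-snocLastBlock z (suc n))))
  nb≢mid : ∀ z' → z' ∈ blocksInsertions e z → nb ≢ z'
  nb≢mid z' m eq = n≢1+n (length z) (trans (sym (blocksInsertions-length (suc n) z z' m)) (trans (cong length (sym eq)) (trans (length-++ z {[ [ e ] ]}) (ℕP.+-comm _ 1))))
  sn≢mid : ∀ z' → z' ∈ blocksInsertions e z → sn ≢ z'
  sn≢mid z' m eq = n≢1+n (circ z) (trans (sym (circ-blocksInsertions (suc n) z iz z' m)) (trans (cong circ (sym eq)) (circ-snocLastBlock z (suc n))))

Unique-lahStars : ∀ n → Unique (lahStars n)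
Unique-lahStars zero = [] ∷ []
Unique-lahStars (suc n) = Unique-concatMap (extensions (suc n)) (lahStars n) (Unique-lahStars n) (λ a m → Unique-extensions n a (lahStars-wellFormed n a m))
  (λ a a' z ma ma' m1 m2 → trans (sym (delete-extensions n a (lahStars-wellFormed n a ma) z m1)) (delete-extensions n a' (lahStars-wellFormed n a' ma') z m2))

-- The objects accepted by isLahStar are exactly the ones built

record Valid (n : ℕ) (z : LahStar) : Set where
  field
    blocks-nonempty : ∀ b → b ∈ z → b ≢ []
    size : length (readVals z) ≡ n
    in-range : ∀ y → y ∈ readVals z → 1 ≤ y × y ≤ n
    covers : ∀ i → 1 ≤ i → i ≤ n → i ∈ readVals z
    mins-increasing : StrictlyIncreasing (blockMins z)
    circled-special : ∀ e → e ∈ reading z → proj₂ e ≡ true → isSpecial z (proj₁ e) ≡ true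
    tail-uncircled1 : ∀ b → b ∈ z → all (not ∘ circled1) (tailL b) ≡ true

isLahStar⇒Valid : ∀ n z → isLahStar n z ≡ true → Valid n z
isLahStar⇒Valid n z h with ∧≡true⁻ {isLahDist n z} h
... | distribution , circles with ∧≡true⁻ {all (not ∘ null) z} distribution | ∧≡true⁻ {all (λ e → not (proj₂ e) ∨ isSpecial z (proj₁ e)) (reading z)} circles
... | nonnull , rest₁ | circles-special , tails-ok with ∧≡true⁻ {length (readVals z) ≡ᵇ n} rest₁
... | size≡n , rest₂ with ∧≡true⁻ {all (λ v → (1 ≤ᵇ v) ∧ (v ≤ᵇ n)) (readVals z)} rest₂
... | ranged , rest₃ with ∧≡true⁻ {all (λ i → elemᵇ i (readVals z)) (range n)} rest₃
... | covered , increasing = record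
  { blocks-nonempty = λ b m → nonnull⇔nonempty b (all≡true⁻ (not ∘ null) z nonnull b m)
  ; size = ≡ᵇ≡true⇒≡ size≡n
  ; in-range = λ y m → let r = ∧≡true⁻ {1 ≤ᵇ y} (all≡true⁻ _ (readVals z) ranged y m) in ≤ᵇ≡true⇒≤ 1 y (proj₁ r) , ≤ᵇ≡true⇒≤ y n (proj₂ r)
  ; covers = λ i h1 h2 → elemᵇ≡true⇒∈ i (readVals z) (all≡true⁻ _ (range n) covered i (∈-range⁺ n i h1 h2))
  ; mins-increasing = strictlyIncr⇒StrictlyIncreasing _ increasing
  ; circled-special = λ e m ce → circled⇒special e (all≡true⁻ _ (reading z) circles-special e m) ce
  ; tail-uncircled1 = λ b m → all≡true⁻ _ z tails-ok b m }
  where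
  nonnull⇔nonempty : ∀ b → not (null b) ≡ true → b ≢ []
  nonnull⇔nonempty (x ∷ b) _ ()
  circled⇒special : ∀ e → (not (proj₂ e) ∨ isSpecial z (proj₁ e)) ≡ true → proj₂ e ≡ true → isSpecial z (proj₁ e) ≡ true
  circled⇒special (y , true) h refl = h

Valid⇒isLahStar : ∀ n z → Valid n z → isLahStar n z ≡ true
Valid⇒isLahStar n z V = ∧≡true⁺ (∧≡true⁺ (all≡true⁺ (not ∘ null) z (λ b m → nonnull⇔nonempty b (blocks-nonempty b m)))
                   (∧≡true⁺ (trans (cong (_≡ᵇ n) size) (≡ᵇ-refl n))
                   (∧≡true⁺ (all≡true⁺ _ (readVals z) (λ y m → ∧≡true⁺ (≤⇒≤ᵇ≡true (proj₁ (in-range y m))) (≤⇒≤ᵇ≡true (proj₂ (in-range y m)))))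
                   (∧≡true⁺ (all≡true⁺ _ (range n) (λ i m → ∈⇒elemᵇ≡true i (readVals z) (covers i (proj₁ (∈-range⁻ n i m)) (proj₂ (∈-range⁻ n i m)))))
                        (StrictlyIncreasing⇒strictlyIncr _ mins-increasing)))))
                 (∧≡true⁺ (all≡true⁺ _ (reading z) (λ e m → circled⇒special e m)) (all≡true⁺ _ z tail-uncircled1))
  where
  open Valid V
  nonnull⇔nonempty : ∀ b → b ≢ [] → not (null b) ≡ true
  nonnull⇔nonempty [] h = ⊥-elim (h refl)
  nonnull⇔nonempty (x ∷ b) h = refl
  circled⇒special : ∀ e → e ∈ reading z → (not (proj₂ e) ∨ isSpecial z (proj₁ e)) ≡ true
  circled⇒special (y , false) m = refl
  circled⇒special (y , true) m = circled-special (y , true) m refl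

reading-delete : ∀ v z → reading (delete v z) ≡ filterᵇ (λ e → not (proj₁ e ≡ᵇ v)) (reading z)
reading-delete v z = trans (concat-filter-nonempty (map (deleteFromBlock v) z)) (concat-map-filterᵇ _ z)

readVals-delete : ∀ v z → readVals (delete v z) ≡ filterᵇ (λ y → not (y ≡ᵇ v)) (readVals z)
readVals-delete v z = trans (cong vals (reading-delete v z)) (map-filterᵇ proj₁ (λ y → not (y ≡ᵇ v)) (reading z))

∈-deleteFromBlock⁻ : ∀ v b y → y ∈ vals (deleteFromBlock v b) → y ∈ vals b × y ≢ v
∈-deleteFromBlock⁻ v b y m with ∈-map⁻ proj₁ m
... | e , em , refl with ∈-filterᵇ⁻ _ b e em
... | m1 , t = ∈-map⁺ proj₁ m1 , isNot⇒≢ t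

∈-deleteFromBlock⁺ : ∀ v b y → y ∈ vals b → y ≢ v → y ∈ vals (deleteFromBlock v b)
∈-deleteFromBlock⁺ v b y m ne with ∈-map⁻ proj₁ m
... | e , em , refl = ∈-map⁺ proj₁ (∈-filterᵇ⁺ _ b e em (≢⇒isNot ne))

deleteFromBlock-⊆ : ∀ v b e → e ∈ deleteFromBlock v b → e ∈ b
deleteFromBlock-⊆ v b e m = proj₁ (∈-filterᵇ⁻ _ b e m)

elemᵇ-deleteFromBlock : ∀ v i b → i ≢ v → elemᵇ i (vals (deleteFromBlock v b)) ≡ elemᵇ i (vals b)
elemᵇ-deleteFromBlock v i b ne with elemᵇ i (vals b) in eq
... | true = ∈⇒elemᵇ≡true i _ (∈-deleteFromBlock⁺ v b i (elemᵇ≡true⇒∈ i _ eq) ne)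
... | false = ∉⇒elemᵇ≡false i _ (λ m → false≢true (trans (sym eq) (∈⇒elemᵇ≡true i _ (proj₁ (∈-deleteFromBlock⁻ v b i m)))))

delete-∷-vanishing : ∀ v b bs → deleteFromBlock v b ≡ [] → delete v (b ∷ bs) ≡ delete v bs
delete-∷-vanishing v b bs eq = filterᵇ-reject (not ∘ null) (deleteFromBlock v b) (map (deleteFromBlock v) bs) (cong (not ∘ null) eq)

delete-∷ : ∀ v b bs c cs → deleteFromBlock v b ≡ c ∷ cs → delete v (b ∷ bs) ≡ (c ∷ cs) ∷ delete v bs
delete-∷ v b bs c cs eq = trans (filterᵇ-accept (not ∘ null) (deleteFromBlock v b) (map (deleteFromBlock v) bs) (cong (not ∘ null) eq)) (cong (_∷ delete v bs) eq)

blockOf-delete : ∀ v i z → i ≢ v → blockOf i (delete v z) ≡ deleteFromBlock v (blockOf i z)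
blockOf-delete v i [] ne = refl
blockOf-delete v i (b ∷ bs) ne with deleteFromBlock v b in eq
... | [] = (trans (blockOf-delete v i bs ne)
             (cong (deleteFromBlock v) (sym (if-false (elemᵇ i (vals b)) b (blockOf i bs) (trans (sym (elemᵇ-deleteFromBlock v i b ne)) (cong (λ l → elemᵇ i (vals l)) eq))))))
... | c ∷ cs = by-membership (elemᵇ i (vals b)) refl
  where
  by-membership : ∀ t → elemᵇ i (vals b) ≡ t → blockOf i ((c ∷ cs) ∷ delete v bs) ≡ deleteFromBlock v (blockOf i (b ∷ bs))
  by-membership true et = trans (if-true (elemᵇ i (vals (c ∷ cs))) (c ∷ cs) _ (trans (cong (λ l → elemᵇ i (vals l)) (sym eq)) (trans (elemᵇ-deleteFromBlock v i b ne) et)))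
                 (trans (sym eq) (cong (deleteFromBlock v) (sym (if-true (elemᵇ i (vals b)) b _ et))))
  by-membership false et = trans (if-false (elemᵇ i (vals (c ∷ cs))) (c ∷ cs) _ (trans (cong (λ l → elemᵇ i (vals l)) (sym eq)) (trans (elemᵇ-deleteFromBlock v i b ne) et)))
                 (trans (blockOf-delete v i bs ne) (cong (deleteFromBlock v) (sym (if-false (elemᵇ i (vals b)) b _ et))))

blockMin-deleteFromBlock : ∀ v B i → (∀ y → y ∈ vals B → y ≤ v) → i ∈ vals B → i ≢ v → blockMin (vals (deleteFromBlock v B)) ≡ blockMin (vals B)
blockMin-deleteFromBlock v B i le im ne = blockMin-≡ (vals (deleteFromBlock v B)) (vals B) (ne1 (∈-deleteFromBlock⁺ v B i im ne)) (ne1 im) f g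
  where
  ne1 : ∀ {L : List ℕ} → i ∈ L → L ≢ []
  ne1 m refl with m
  ... | ()
  f : ∀ a → a ∈ vals (deleteFromBlock v B) → ∃[ b ] (b ∈ vals B × b ≤ a)
  f a m = a , proj₁ (∈-deleteFromBlock⁻ v B a m) , ℕP.≤-refl
  g : ∀ b → b ∈ vals B → ∃[ a ] (a ∈ vals (deleteFromBlock v B) × a ≤ b)
  g b m with b ℕ.≟ v
  ... | yes refl = i , ∈-deleteFromBlock⁺ v B i im ne , le i im
  ... | no nb = b , ∈-deleteFromBlock⁺ v B b m nb , ℕP.≤-refl

elemᵇ-takeWhileᵇ-filterᵇ : ∀ v i j L → i ≢ v → j ≢ v →
  elemᵇ j (takeWhileᵇ (isNot i) (filterᵇ (isNot v) L)) ≡ elemᵇ j (takeWhileᵇ (isNot i) L)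
elemᵇ-takeWhileᵇ-filterᵇ v i j [] ni nj = refl
elemᵇ-takeWhileᵇ-filterᵇ v i j (y ∷ L) ni nj with y ℕ.≟ v
... | yes refl = trans (cong (λ l → elemᵇ j (takeWhileᵇ (isNot i) l)) (filterᵇ-reject (isNot v) y L (cong not (≡ᵇ-refl y))))
                  (trans (elemᵇ-takeWhileᵇ-filterᵇ v i j L ni nj)
                  (sym (trans (cong (elemᵇ j) (takeWhileᵇ-accept (isNot i) y L (≢⇒isNot (λ e → ni (sym e))))) (cong (_∨ elemᵇ j (takeWhileᵇ (isNot i) L)) (≢⇒≡ᵇ≡false nj)))))
... | no ny with y ℕ.≟ i
...   | yes refl = trans (cong (λ l → elemᵇ j (takeWhileᵇ (isNot y) l)) (filterᵇ-accept (isNot v) y L (≢⇒isNot ny)))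
                   (trans (cong (elemᵇ j) (takeWhileᵇ-reject (isNot y) y (filterᵇ (isNot v) L) (cong not (≡ᵇ-refl y))))
                          (sym (cong (elemᵇ j) (takeWhileᵇ-reject (isNot y) y L (cong not (≡ᵇ-refl y))))))
...   | no nyi = trans (cong (λ l → elemᵇ j (takeWhileᵇ (isNot i) l)) (filterᵇ-accept (isNot v) y L (≢⇒isNot ny)))
                 (trans (cong (elemᵇ j) (takeWhileᵇ-accept (isNot i) y (filterᵇ (isNot v) L) (≢⇒isNot nyi)))
                 (trans (cong ((j ≡ᵇ y) ∨_) (elemᵇ-takeWhileᵇ-filterᵇ v i j L ni nj))
                        (sym (cong (elemᵇ j) (takeWhileᵇ-accept (isNot i) y L (≢⇒isNot nyi))))))

isSpecial-delete : ∀ v z i → i < v → (∀ y → y ∈ readVals z → y ≤ v) → isSpecial (delete v z) i ≡ isSpecial z i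
isSpecial-delete v z i i<v le = cong₂ (λ m a → (i ≡ᵇ 1) ∨ ((2 ≤ᵇ i) ∧ not (i ≡ᵇ m) ∧ a)) bmeq alleq
  where
  iv : i ≢ v
  iv eq = ℕP.<-irrefl eq i<v
  bmeq : blockMin (vals (blockOf i (delete v z))) ≡ blockMin (vals (blockOf i z))
  bmeq with blockOf-cases i z
  ... | inj₁ e = trans (cong (blockMin ∘ vals) (trans (blockOf-delete v i z iv) (cong (deleteFromBlock v) e))) (cong (blockMin ∘ vals) (sym e))
  ... | inj₂ (bm , im) = trans (cong (blockMin ∘ vals) (blockOf-delete v i z iv)) (blockMin-deleteFromBlock v (blockOf i z) i (λ y m → le y (∈-block⇒∈-readVals z _ y bm m)) im iv)
  alleq : all (λ j → elemᵇ j (takeWhileᵇ (isNot i) (readVals (delete v z)))) (map suc (upTo (i ℕ.∸ 1)))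
        ≡ all (λ j → elemᵇ j (takeWhileᵇ (isNot i) (readVals z))) (map suc (upTo (i ℕ.∸ 1)))
  alleq = all-cong _ _ _ (λ j m → trans (cong (λ l → elemᵇ j (takeWhileᵇ (isNot i) l)) (readVals-delete v z))
            (elemᵇ-takeWhileᵇ-filterᵇ v i j (readVals z) iv (λ eq → ℕP.<-irrefl eq (ℕP.<-trans (∈-range-pred⁻ i j m) i<v))))

blockMin-deleteFromBlock′ : ∀ v b → (∀ y → y ∈ vals b → y ≤ v) → deleteFromBlock v b ≢ [] → blockMin (vals (deleteFromBlock v b)) ≡ blockMin (vals b)
blockMin-deleteFromBlock′ v b le ne with deleteFromBlock v b in eq
... | [] = ⊥-elim (ne refl)
... | (a , c) ∷ cs with ∈-deleteFromBlock⁻ v b a (subst (λ l → a ∈ vals l) (sym eq) (here refl))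
... | am , av = trans (cong (blockMin ∘ vals) (sym eq)) (blockMin-deleteFromBlock v b a le am av)

blockMins-delete-⊆ : ∀ v z → (∀ y → y ∈ readVals z → y ≤ v) → ∀ m → m ∈ blockMins (delete v z) → m ∈ blockMins z
blockMins-delete-⊆ v [] le m ()
blockMins-delete-⊆ v (b ∷ bs) le m mm with deleteFromBlock v b in eq
... | [] = there (blockMins-delete-⊆ v bs (λ y ym → le y (readVals-tail b bs y ym)) m mm)
... | c ∷ cs with mm
...   | here refl = here (trans (cong (blockMin ∘ vals) (sym eq)) (blockMin-deleteFromBlock′ v b (λ y ym → le y (∈-block⇒∈-readVals (b ∷ bs) b y (here refl) ym)) (λ e → ∷≢[] (trans (sym eq) e))))
...   | there mm' = there (blockMins-delete-⊆ v bs (λ y ym → le y (readVals-tail b bs y ym)) m mm')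

StrictlyIncreasing-delete : ∀ v z → (∀ y → y ∈ readVals z → y ≤ v) → StrictlyIncreasing (blockMins z) → StrictlyIncreasing (blockMins (delete v z))
StrictlyIncreasing-delete v [] le s = tt
StrictlyIncreasing-delete v (b ∷ bs) le (a , s) with deleteFromBlock v b in eq
... | [] = StrictlyIncreasing-delete v bs (λ y ym → le y (readVals-tail b bs y ym)) s
... | c ∷ cs = All.tabulate (λ {m} mm → subst (_< m) (sym bmq) (lookup a (blockMins-delete-⊆ v bs (λ y ym → le y (readVals-tail b bs y ym)) m mm)))
             , StrictlyIncreasing-delete v bs (λ y ym → le y (readVals-tail b bs y ym)) s
  where
  bmq : blockMin (vals (c ∷ cs)) ≡ blockMin (vals b)
  bmq = trans (cong (blockMin ∘ vals) (sym eq)) (blockMin-deleteFromBlock′ v b (λ y ym → le y (readVals-head b bs y ym)) (λ e → ∷≢[] (trans (sym eq) e)))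

tailL-deleteFromBlock-⊆ : ∀ v b e → e ∈ tailL (deleteFromBlock v b) → e ∈ tailL b
tailL-deleteFromBlock-⊆ v [] e ()
tailL-deleteFromBlock-⊆ v ((y , c) ∷ xs) e m with y ℕ.≟ v
... | yes refl = deleteFromBlock-⊆ v xs e (∈-tailL⁻ (deleteFromBlock v xs) e (subst (λ l → e ∈ tailL l) (filterᵇ-reject _ (y , c) xs (cong not (≡ᵇ-refl y))) m))
... | no ne = deleteFromBlock-⊆ v xs e (subst (λ l → e ∈ tailL l) (filterᵇ-accept _ (y , c) xs (≢⇒isNot ne)) m)

Valid⇒Unique-readVals : ∀ n z → Valid n z → Unique (readVals z)
Valid⇒Unique-readVals n z V = ⊆-length≤⇒Unique (range n) (readVals z) (range-unique n) (λ u m → covers u (proj₁ (∈-range⁻ n u m)) (proj₂ (∈-range⁻ n u m)))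
  (ℕP.≤-reflexive (trans size (sym (length-range n))))
  where open Valid V

Valid-delete : ∀ n z → Valid (suc n) z → Valid n (delete (suc n) z)
Valid-delete n z V = record
  { blocks-nonempty = λ b m → nonnull⇒nonempty b (proj₂ (∈-filterᵇ⁻ (not ∘ null) (map (deleteFromBlock v) z) b m))
  ; size = ℕP.suc-injective (trans (cong (suc ∘ length) (readVals-delete v z)) (trans (Unique-length-filter-isNot-∈ v (readVals z) distinct (covers v (s≤s z≤n) ℕP.≤-refl)) size))
  ; in-range = λ y m → let r = ∈-filterᵇ⁻ (isNot v) (readVals z) y (subst (y ∈_) (readVals-delete v z) m) in
                 proj₁ (in-range y (proj₁ r)) , ℕP.≤-pred (ℕP.≤∧≢⇒< (proj₂ (in-range y (proj₁ r))) (isNot⇒≢ (proj₂ r)))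
  ; covers = λ i h1 h2 → subst (i ∈_) (sym (readVals-delete v z)) (∈-filterᵇ⁺ (isNot v) (readVals z) i (covers i h1 (ℕP.m≤n⇒m≤1+n h2)) (≢⇒isNot {i} {v} (λ eq → ℕP.<-irrefl eq (s≤s h2))))
  ; mins-increasing = StrictlyIncreasing-delete v z ≤v mins-increasing
  ; circled-special = λ e m ce → let r = ∈-filterᵇ⁻ (λ e → not (proj₁ e ≡ᵇ v)) (reading z) e (subst (e ∈_) (reading-delete v z) m) in
           trans (isSpecial-delete v z (proj₁ e) (ℕP.≤∧≢⇒< (≤v (proj₁ e) (∈-map⁺ proj₁ (proj₁ r))) (isNot⇒≢ (proj₂ r))) ≤v) (circled-special e (proj₁ r) ce)
  ; tail-uncircled1 = tail-uncircled1′ }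
  where
  open Valid V
  v = suc n
  distinct = Valid⇒Unique-readVals (suc n) z V
  ≤v : ∀ y → y ∈ readVals z → y ≤ v
  ≤v y m = proj₂ (in-range y m)
  nonnull⇒nonempty : ∀ b → not (null b) ≡ true → b ≢ []
  nonnull⇒nonempty (x ∷ b) _ ()
  tail-uncircled1′ : ∀ b → b ∈ delete v z → all (not ∘ circled1) (tailL b) ≡ true
  tail-uncircled1′ b m with ∈-map⁻ (deleteFromBlock v) (proj₁ (∈-filterᵇ⁻ (not ∘ null) (map (deleteFromBlock v) z) b m))
  ... | b0 , b0m , refl = all≡true⁺ _ _ (λ e em → all≡true⁻ _ (tailL b0) (tail-uncircled1 b0 b0m) e (tailL-deleteFromBlock-⊆ v b0 e em))

extensions-∷ : ∀ v b μ w → w ∈ extensions v μ → w ≢ [ [ (v , true) ] ] → b ∷ w ∈ extensions v (b ∷ μ)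
extensions-∷ v b μ w (here refl) ne = here refl
extensions-∷ v b [] w (there (here refl)) ne = ⊥-elim (ne refl)
extensions-∷ v b (m ∷ ms) w (there (here refl)) ne = there (here refl)
extensions-∷ v b μ w (there (there m)) ne = there (there (∈-++⁺ʳ (map (_∷ μ) (blockInsertions (v , false) b)) (∈-map⁺ (b ∷_) m)))

insertions-complete : ∀ (e : Entry) p q → p ++ e ∷ q ∈ insertions e (p ++ q)
insertions-complete e [] [] = here refl
insertions-complete e [] (y ∷ ys) = here refl
insertions-complete e (x ∷ p) q = there (∈-map⁺ (x ∷_) (insertions-complete e p q))

blockInsertions-complete : ∀ (e : Entry) p q → (p ++ q) ≢ [] → (p ≡ [] → ∀ y ys → q ≡ y ∷ ys → proj₂ y ≡ false) → p ++ e ∷ q ∈ blockInsertions e (p ++ q)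
blockInsertions-complete e [] [] ne h = ⊥-elim (ne refl)
blockInsertions-complete e [] ((y₁ , c) ∷ ys) ne h with h refl (y₁ , c) ys refl
... | refl = here refl
blockInsertions-complete e ((x₁ , true) ∷ p) q ne h = ∈-map⁺ ((x₁ , true) ∷_) (insertions-complete e p q)
blockInsertions-complete e ((x₁ , false) ∷ p) q ne h = insertions-complete e ((x₁ , false) ∷ p) q

delete-id : ∀ v z → (∀ b → b ∈ z → b ≢ []) → (∀ y → y ∈ readVals z → y < v) → delete v z ≡ z
delete-id v [] ne lt = refl
delete-id v ([] ∷ bs) ne lt = ⊥-elim (ne [] (here refl) refl)
delete-id v ((x ∷ xs) ∷ bs) ne lt =
  trans (delete-∷ v (x ∷ xs) bs x xs (deleteFromBlock-id v (x ∷ xs) (λ y m → lt y (readVals-head (x ∷ xs) bs y m))))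
        (cong ((x ∷ xs) ∷_) (delete-id v bs (λ b m → ne b (there m)) (λ y m → lt y (readVals-tail (x ∷ xs) bs y m))))

record MaxPlacement (v : ℕ) (z : LahStar) : Set where
  field
    nonempty : ∀ b → b ∈ z → b ≢ []
    ≤max : ∀ y → y ∈ readVals z → y ≤ v
    distinct : Unique (readVals z)
    max∈ : v ∈ readVals z
    singleton-last : ∀ z1 z2 c → z ≡ z1 ++ [ (v , c) ] ∷ z2 → (z2 ≡ []) × (c ≡ true → z1 ≡ [])
    circled-last : ∀ z1 z2 b → z ≡ z1 ++ b ∷ z2 → (v , true) ∈ b → 2 ≤ length b → (z2 ≡ []) × ∃[ b0 ] (b ≡ b0 ++ [ (v , true) ])
    after-head-uncircled : ∀ z1 z2 c y ys → z ≡ z1 ++ ((v , c) ∷ y ∷ ys) ∷ z2 → proj₂ y ≡ false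

MaxPlacement-tail : ∀ v b bs → MaxPlacement v (b ∷ bs) → ¬ (v ∈ vals b) → MaxPlacement v bs
MaxPlacement-tail v b bs H = λ nv → record
  { nonempty = λ b' m → nonempty b' (there m)
  ; ≤max = λ y m → ≤max y (readVals-tail b bs y m)
  ; distinct = Unique-++⁻ʳ (vals b) (readVals bs) (subst Unique (readVals-cons b bs) distinct)
  ; max∈ = max∈-tail nv
  ; singleton-last = λ z1 z2 c eq → proj₁ (singleton-last (b ∷ z1) z2 c (cong (b ∷_) eq)) , λ ct → ⊥-elim (∷≢[] (proj₂ (singleton-last (b ∷ z1) z2 c (cong (b ∷_) eq)) ct))
  ; circled-last = λ z1 z2 b' eq m l → circled-last (b ∷ z1) z2 b' (cong (b ∷_) eq) m l
  ; after-head-uncircled = λ z1 z2 c y ys eq → after-head-uncircled (b ∷ z1) z2 c y ys (cong (b ∷_) eq) }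
  where
  open MaxPlacement H
  max∈-tail : ¬ (v ∈ vals b) → v ∈ readVals bs
  max∈-tail nv with ∈-++⁻ (vals b) (subst (v ∈_) (readVals-cons b bs) max∈)
  ... | inj₁ m = ⊥-elim (nv m)
  ... | inj₂ m = m

∈-vals⇒middle : ∀ v (b : Block) → v ∈ vals b → ∃[ c ] ∃[ p ] ∃[ q ] (b ≡ p ++ (v , c) ∷ q)
∈-vals⇒middle v b m with ∈-map⁻ proj₁ m
... | (v' , c) , em , refl with ∈-∃++ em
... | p , q , eq = c , p , q , eq

delete-∷-id : ∀ v b bs → b ≢ [] → (∀ y → y ∈ vals b → y < v) → delete v (b ∷ bs) ≡ b ∷ delete v bs
delete-∷-id v [] bs nb lt = ⊥-elim (nb refl)
delete-∷-id v (x ∷ xs) bs nb lt = delete-∷ v (x ∷ xs) bs x xs (deleteFromBlock-id v (x ∷ xs) lt)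

module _ (v : ℕ) (bs : LahStar) (c : Bool) (p q : Block) (H : MaxPlacement v ((p ++ (v , c) ∷ q) ∷ bs)) where
  open MaxPlacement H
  private
    b : Block
    b = p ++ (v , c) ∷ q
    distinct-b-bs : Unique (vals b ++ readVals bs)
    distinct-b-bs = subst Unique (readVals-cons b bs) distinct
    v∈b : v ∈ vals b
    v∈b = subst (v ∈_) (sym (vals-middle p q (v , c))) (∈-++⁺ʳ (vals p) (here refl))
    v∉bs : ¬ (v ∈ readVals bs)
    v∉bs m = Unique-++⇒disjoint (vals b) (readVals bs) v distinct-b-bs v∈b m
    bs<v : ∀ y → y ∈ readVals bs → y < v
    bs<v y m = ℕP.≤∧≢⇒< (≤max y (readVals-tail b bs y m)) (λ eq → v∉bs (subst (_∈ readVals bs) eq m))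
    delete-bs : delete v bs ≡ bs
    delete-bs = delete-id v bs (λ b' m → nonempty b' (there m)) bs<v
    distinct-b : Unique (vals p ++ v ∷ vals q)
    distinct-b = subst Unique (vals-middle p q (v , c)) (Unique-++⁻ˡ (vals b) (readVals bs) distinct-b-bs)
    pq<v : ∀ y → y ∈ vals (p ++ q) → y < v
    pq<v y m = ℕP.≤∧≢⇒< (≤max y (readVals-head b bs y (∈-vals-middle⁺ (v , c) p q y m)))
                  (λ eq → proj₂ (Unique-remove-middle (vals p) (vals q) v distinct-b) (subst (_∈ vals p ++ vals q) eq (subst (y ∈_) (vals-++ p q) m)))
    delete-b : deleteFromBlock v b ≡ p ++ q
    delete-b = deleteFromBlock-middle v c p q pq<v

  ∈-extensions-delete-nonsingleton : ∀ x xs → p ++ q ≡ x ∷ xs → b ∷ bs ∈ extensions v (delete v (b ∷ bs))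
  ∈-extensions-delete-nonsingleton x xs pq = subst (λ μ → b ∷ bs ∈ extensions v μ) (sym (trans (delete-∷ v b bs x xs (trans delete-b pq)) (cong ((x ∷ xs) ∷_) delete-bs))) (by-circling c refl)
    where
    2≤b : 2 ≤ length b
    2≤b = subst (2 ≤_) (sym (length-++ p {(v , c) ∷ q}))
             (subst (2 ≤_) (sym (ℕP.+-suc (length p) (length q))) (s≤s (subst (1 ≤_) (length-++ p {q}) (subst (λ l → 1 ≤ length l) (sym pq) (s≤s z≤n)))))
    by-circling : ∀ c' → c ≡ c' → b ∷ bs ∈ extensions v ((x ∷ xs) ∷ bs)
    by-circling true refl with circled-last [] bs b refl (subst ((v , true) ∈_) refl (∈-++⁺ʳ p (here refl))) 2≤b
    ... | refl , b0 , b0eq = subst (λ l → l ∷ [] ∈ extensions v ((x ∷ xs) ∷ [])) (sym (trans b0eq (cong (_++ [ (v , true) ]) b0≡xs))) (there (here refl))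
      where
      distinct-b0 : Unique (vals b0 ++ v ∷ [])
      distinct-b0 = subst Unique (trans (cong vals b0eq) (vals-middle b0 [] (v , true))) (Unique-++⁻ˡ (vals b) (readVals bs) distinct-b-bs)
      b0<v : ∀ y → y ∈ vals (b0 ++ []) → y < v
      b0<v y m = ℕP.≤∧≢⇒< (≤max y (readVals-head b [] y (subst (λ l → y ∈ vals l) (sym b0eq) (∈-vals-++⁺ˡ b0 [ (v , true) ] y (subst (λ l → y ∈ vals l) (++-identityʳ b0) m)))))
                 (λ eq → proj₂ (Unique-remove-middle (vals b0) [] v distinct-b0) (subst (_∈ vals b0 ++ []) eq (subst (y ∈_) (vals-++ b0 []) m)))
      b0≡xs : b0 ≡ x ∷ xs
      b0≡xs = trans (sym (++-identityʳ b0)) (trans (sym (deleteFromBlock-middle v true b0 [] b0<v)) (trans (cong (deleteFromBlock v) (sym b0eq)) (trans delete-b pq)))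
    by-circling false refl = there (there (∈-++⁺ˡ (∈-map⁺ (_∷ bs) (subst (λ l → p ++ (v , false) ∷ q ∈ blockInsertions (v , false) l) pq
        (blockInsertions-complete (v , false) p q (λ e → ∷≢[] (trans (sym pq) e)) follower-uncircled)))))
      where
      follower-uncircled : p ≡ [] → ∀ y ys → q ≡ y ∷ ys → proj₂ y ≡ false
      follower-uncircled refl y ys refl = after-head-uncircled [] bs false y ys refl

∈-extensions-delete-head : ∀ v bs c p q → MaxPlacement v ((p ++ (v , c) ∷ q) ∷ bs) → (p ++ (v , c) ∷ q) ∷ bs ∈ extensions v (delete v ((p ++ (v , c) ∷ q) ∷ bs))
∈-extensions-delete-head v bs c [] [] H with MaxPlacement.singleton-last H [] bs c refl
... | refl , _ = subst (λ μ → [ (v , c) ] ∷ [] ∈ extensions v μ) (sym (delete-∷-vanishing v [ (v , c) ] [] (deleteFromBlock-head v c []))) (singleton-extension c)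
  where singleton-extension : ∀ c → [ (v , c) ] ∷ [] ∈ extensions v []
        singleton-extension false = here refl
        singleton-extension true = there (here refl)
∈-extensions-delete-head v bs c [] (y ∷ ys) H = ∈-extensions-delete-nonsingleton v bs c [] (y ∷ ys) H y ys refl
∈-extensions-delete-head v bs c (x ∷ p) q H = ∈-extensions-delete-nonsingleton v bs c (x ∷ p) q H x (p ++ q) refl

∈-extensions-delete : ∀ v z → MaxPlacement v z → z ∈ extensions v (delete v z)
∈-extensions-delete v [] H with MaxPlacement.max∈ H
... | ()
∈-extensions-delete v (b ∷ bs) H with v ∈? vals b
... | no nv = subst (λ μ → b ∷ bs ∈ extensions v μ) (sym (delete-∷-id v b bs (nonempty b (here refl)) ltb))
        (extensions-∷ v b (delete v bs) bs (∈-extensions-delete v bs (MaxPlacement-tail v b bs H nv)) notcirc)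
  where
  open MaxPlacement H
  ltb : ∀ y → y ∈ vals b → y < v
  ltb y m = ℕP.≤∧≢⇒< (≤max y (readVals-head b bs y m)) (λ eq → nv (subst (_∈ vals b) eq m))
  notcirc : bs ≢ [ [ (v , true) ] ]
  notcirc eq with proj₂ (singleton-last (b ∷ []) [] true (cong (b ∷_) eq)) refl
  ... | ()
... | yes vb with ∈-vals⇒middle v b vb
... | c , p , q , refl = ∈-extensions-delete-head v bs c p q H

∈-range-pred⁺ : ∀ i j → 1 ≤ j → j < i → j ∈ range (i ℕ.∸ 1)
∈-range-pred⁺ (suc i) j 1≤j (s≤s j≤i) = ∈-range⁺ i j 1≤j j≤i

isSpecial⁻ : ∀ z i → isSpecial z i ≡ true →
  i ≡ 1 ⊎ (i ≢ blockMin (vals (blockOf i z)) × (∀ j → 1 ≤ j → j < i → j ∈ takeWhileᵇ (isNot i) (readVals z)))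
isSpecial⁻ z i sp with ∨≡true⁻ {i ≡ᵇ 1} sp
... | inj₁ i≡1 = inj₁ (≡ᵇ≡true⇒≡ i≡1)
... | inj₂ late with ∧≡true⁻ {not (i ≡ᵇ blockMin (vals (blockOf i z)))} (proj₂ (∧≡true⁻ {2 ≤ᵇ i} late))
... | not-min , precede = inj₂ (isNot⇒≢ not-min ,
        λ j 1≤j j<i → elemᵇ≡true⇒∈ j _ (all≡true⁻ _ (range (i ℕ.∸ 1)) precede j (∈-range-pred⁺ i j 1≤j j<i)))

module _ (n : ℕ) (z : LahStar) (V : Valid (suc n) z) where
  open Valid V
  private
    v = suc n
    distinct-readVals = Valid⇒Unique-readVals (suc n) z V
    ≤max : ∀ y → y ∈ readVals z → y ≤ v
    ≤max y m = proj₂ (in-range y m)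

  max-isSpecial : ∀ z1 B z2 → z ≡ z1 ++ B ∷ z2 → (v , true) ∈ B → isSpecial z v ≡ true
  max-isSpecial z1 B z2 eq m = circled-special (v , true) (subst (λ l → (v , true) ∈ reading l) (sym eq) (∈-block⇒∈-reading (z1 ++ B ∷ z2) B (v , true) (∈-++⁺ʳ z1 (here refl)) m)) refl

  ∉-earlier-blocks : ∀ z1 B z2 y → z ≡ z1 ++ B ∷ z2 → y ∈ vals B → ¬ (y ∈ readVals z1)
  ∉-earlier-blocks z1 B z2 y eq yb yz1 = Unique-++⇒disjoint (readVals z1) (vals B ++ readVals z2) y (subst Unique (trans (cong readVals eq) (readVals-mid z1 B z2)) distinct-readVals) yz1 (∈-++⁺ˡ yb)

  singleton-block-last : ∀ z1 z2 c → z ≡ z1 ++ [ (v , c) ] ∷ z2 → (z2 ≡ []) × (c ≡ true → z1 ≡ [])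
  singleton-block-last z1 z2 c eq = later-empty z2 refl , earlier-empty
    where
    larger-mins : All (v <_) (blockMins z2)
    larger-mins = StrictlyIncreasing-middle (blockMins z1) v (blockMins z2)
      (subst StrictlyIncreasing (trans (cong blockMins eq) (blockMins-++ z1 ([ (v , c) ] ∷ z2))) mins-increasing)
    later-empty : ∀ z2' → z2' ≡ z2 → z2' ≡ []
    later-empty [] _ = refl
    later-empty (b ∷ _) refl with larger-mins
    ... | v<min ∷ _ = ⊥-elim (ℕP.<-irrefl refl (ℕP.<-≤-trans v<min (blockMin-≤-bound z b v b∈z (blocks-nonempty b b∈z) ≤max)))
      where b∈z = subst (b ∈_) (sym eq) (∈-++⁺ʳ z1 (there (here refl)))
    earlier-empty : c ≡ true → z1 ≡ []
    earlier-empty refl with isSpecial⁻ z v (max-isSpecial z1 [ (v , true) ] z2 eq (here refl))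
    ... | inj₂ (v≢min , _) = ⊥-elim (v≢min (cong (blockMin ∘ vals) (sym own-block)))
      where
      own-block : blockOf v z ≡ [ (v , true) ]
      own-block = trans (cong (blockOf v) eq) (blockOf-find v z1 [ (v , true) ] z2 (∉-earlier-blocks z1 [ (v , true) ] z2 v eq (here refl)) (here refl))
    ... | inj₁ v≡1 = readVals≡[]⇒≡[] z1 (λ b m → blocks-nonempty b (subst (b ∈_) (sym eq) (∈-++⁺ˡ m)))
                       (length≡0⇒[] (readVals z1) (ℕP.m+n≡0⇒m≡0 (length (readVals z1)) (ℕP.suc-injective size-z)))
      where
      size-z : suc (length (readVals z1) ℕ.+ length (readVals z2)) ≡ 1
      size-z = begin
        suc (length (readVals z1) ℕ.+ length (readVals z2)) ≡⟨ ℕP.+-suc (length (readVals z1)) _ ⟨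
        length (readVals z1) ℕ.+ length (v ∷ readVals z2)   ≡⟨ length-++ (readVals z1) ⟨
        length (readVals z1 ++ v ∷ readVals z2)             ≡⟨ cong length (trans (cong readVals eq) (readVals-mid z1 [ (v , true) ] z2)) ⟨
        length (readVals z)                                 ≡⟨ trans size v≡1 ⟩
        1                                                   ∎
        where open ≡-Reasoning

  -- 1, …, n all precede a special maximum v ≠ 1, and they fill all but one place of the reading.
  special-max-last : v ≢ 1 → isSpecial z v ≡ true → ∀ X Y → readVals z ≡ X ++ v ∷ Y → Y ≡ []
  special-max-last v≢1 sp X Y rz with isSpecial⁻ z v sp
  ... | inj₁ v≡1 = ⊥-elim (v≢1 v≡1)
  ... | inj₂ (_ , precede) = length≡0⇒[] Y (ℕP.n≤0⇒n≡0 (ℕP.+-cancelˡ-≤ (length X) (length Y) 0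
          (subst₂ _≤_ (sym X+Y≡n) (sym (ℕP.+-identityʳ (length X))) n≤X)))
    where
    v∉X : ¬ (v ∈ X)
    v∉X m = Unique-++⇒disjoint X (v ∷ Y) v (subst Unique rz distinct-readVals) m (here refl)
    earlier : ∀ j → j ∈ range n → j ∈ X
    earlier j m = subst (j ∈_) (trans (cong (takeWhileᵇ (isNot v)) rz) (takeWhileᵇ-isNot-prefix v X Y v∉X))
                    (precede j (proj₁ (∈-range⁻ n j m)) (s≤s (proj₂ (∈-range⁻ n j m))))
    n≤X : n ≤ length X
    n≤X = subst (_≤ length X) (length-range n) (Unique-⊆⇒length≤ (range n) X (range-unique n) earlier)
    X+Y≡n : length X ℕ.+ length Y ≡ n
    X+Y≡n = ℕP.suc-injective (trans (sym (ℕP.+-suc (length X) (length Y)))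
                                    (trans (sym (length-++ X {v ∷ Y})) (trans (cong length (sym rz)) size)))

  circled-max-last : ∀ z1 z2 b → z ≡ z1 ++ b ∷ z2 → (v , true) ∈ b → 2 ≤ length b → (z2 ≡ []) × ∃[ b0 ] (b ≡ b0 ++ [ (v , true) ])
  circled-max-last z1 z2 b eq vb 2≤b with ∈-∃++ vb
  ... | b1 , b2 , refl = after-empty b2 refl
    where
    X = readVals z1 ++ vals b1
    Y = vals b2 ++ readVals z2
    rz : readVals z ≡ X ++ v ∷ Y
    rz = trans (cong readVals eq) (trans (readVals-mid z1 (b1 ++ (v , true) ∷ b2) z2)
           (trans (cong (λ l → readVals z1 ++ l ++ readVals z2) (vals-middle b1 b2 (v , true)))
           (trans (cong (readVals z1 ++_) (++-assoc (vals b1) (v ∷ vals b2) (readVals z2))) (sym (++-assoc (readVals z1) (vals b1) (v ∷ Y))))))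
    b≤size : length (b1 ++ (v , true) ∷ b2) ≤ suc n
    b≤size = subst₂ _≤_ (length-map proj₁ (b1 ++ (v , true) ∷ b2))
               (trans (sym (length-++ (readVals z1))) (trans (cong length (sym (trans (cong readVals eq) (readVals-mid z1 _ z2)))) size))
               (ℕP.≤-trans (ℕP.m≤m+n _ (length (readVals z2))) (ℕP.≤-trans (ℕP.≤-reflexive (sym (length-++ (vals (b1 ++ (v , true) ∷ b2))))) (ℕP.m≤n+m _ (length (readVals z1)))))
    v≢1 : v ≢ 1
    v≢1 v≡1 with ℕP.≤-trans 2≤b (subst (length (b1 ++ (v , true) ∷ b2) ≤_) v≡1 b≤size)
    ... | s≤s ()
    Y≡[] : Y ≡ []
    Y≡[] = special-max-last v≢1 (max-isSpecial z1 (b1 ++ (v , true) ∷ b2) z2 eq vb) X Y rz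
    after-empty : ∀ b2' → b2' ≡ b2 → (z2 ≡ []) × ∃[ b0 ] (b1 ++ (v , true) ∷ b2 ≡ b0 ++ [ (v , true) ])
    after-empty [] refl = readVals≡[]⇒≡[] z2 (λ b' m → blocks-nonempty b' (subst (b' ∈_) (sym eq) (∈-++⁺ʳ z1 (there m)))) Y≡[] , b1 , refl
    after-empty (_ ∷ _) refl with Y≡[]
    ... | ()

  -- The minimum of v's block would have to precede a circled follower of v, i.e. lie in an earlier block.
  max-head-followed-by-uncircled : ∀ z1 z2 c y ys → z ≡ z1 ++ ((v , c) ∷ y ∷ ys) ∷ z2 → proj₂ y ≡ false
  max-head-followed-by-uncircled z1 z2 c (y , false) ys eq = refl
  max-head-followed-by-uncircled z1 z2 c (y , true) ys eq =
      ⊥-elim (absurd (isSpecial⁻ z y (circled-special (y , true) (∈-block⇒∈-reading z B (y , true) B∈z (there (here refl))) refl)))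
    where
    B = (v , c) ∷ (y , true) ∷ ys
    B∈z : B ∈ z
    B∈z = subst (B ∈_) (sym eq) (∈-++⁺ʳ z1 (here refl))
    m = blockMin (vals B)
    m∈B : m ∈ vals B
    m∈B = blockMin-∈ v (y ∷ vals ys)
    own-block : blockOf y z ≡ B
    own-block = trans (cong (blockOf y) eq) (blockOf-find y z1 B z2 (∉-earlier-blocks z1 B z2 y eq (there (here refl))) (there (here refl)))
    distinct-B : Unique (vals B)
    distinct-B = Unique-++⁻ˡ (vals B) (readVals z2)
      (Unique-++⁻ʳ (readVals z1) _ (subst Unique (trans (cong readVals eq) (readVals-mid z1 B z2)) distinct-readVals))
    y∉prefix : ¬ (y ∈ readVals z1 ++ [ v ])
    y∉prefix m with ∈-++⁻ (readVals z1) m | distinct-B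
    ... | inj₁ m′ | _ = ∉-earlier-blocks z1 B z2 y eq (there (here refl)) m′
    ... | inj₂ (here y≡v) | (v≢y ∷ _) ∷ _ = v≢y (sym y≡v)
    absurd : y ≡ 1 ⊎ (y ≢ blockMin (vals (blockOf y z)) × (∀ j → 1 ≤ j → j < y → j ∈ takeWhileᵇ (isNot y) (readVals z))) → ⊥
    absurd (inj₁ refl) with tail-uncircled1 B B∈z
    ... | ()
    absurd (inj₂ (y≢min , precede)) = ∉-earlier-blocks z1 B z2 m eq m∈B (min-earlier (∈-++⁻ (readVals z1) min-precedes))
      where
      m<y : m < y
      m<y = ℕP.≤∧≢⇒< (blockMin-≤ (vals B) y (there (here refl))) (λ e → y≢min (trans (sym e) (cong (blockMin ∘ vals) (sym own-block))))
      min-precedes : m ∈ readVals z1 ++ [ v ]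
      min-precedes = subst (m ∈_)
        (trans (cong (takeWhileᵇ (isNot y)) (trans (cong readVals eq) (trans (readVals-mid z1 B z2) (sym (++-assoc (readVals z1) [ v ] _)))))
               (takeWhileᵇ-isNot-prefix y (readVals z1 ++ [ v ]) _ y∉prefix))
        (precede m (proj₁ (in-range m (∈-block⇒∈-readVals z B m B∈z m∈B))) m<y)
      min-earlier : m ∈ readVals z1 ⊎ m ∈ [ v ] → m ∈ readVals z1
      min-earlier (inj₁ m∈z1) = m∈z1
      min-earlier (inj₂ (here m≡v)) = ⊥-elim (ℕP.<-irrefl refl (ℕP.<-≤-trans (subst (_< y) m≡v m<y) (≤max y (∈-block⇒∈-readVals z B y B∈z (there (here refl))))))

  Valid⇒MaxPlacement : MaxPlacement v z
  Valid⇒MaxPlacement = record { nonempty = blocks-nonempty ; ≤max = ≤max ; distinct = distinct-readVals ; max∈ = covers v (s≤s z≤n) ℕP.≤-refl ; singleton-last = singleton-block-last ; circled-last = circled-max-last ; after-head-uncircled = max-head-followed-by-uncircled }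

Valid⇒∈lahStars : ∀ n z → Valid n z → z ∈ lahStars n
Valid⇒∈lahStars zero z V with readVals≡[]⇒≡[] z (Valid.blocks-nonempty V) (length≡0⇒[] (readVals z) (Valid.size V))
... | refl = here refl
Valid⇒∈lahStars (suc n) z V = ∈-concatMap⁺′ (extensions (suc n)) (lahStars n) (delete (suc n) z) z (Valid⇒∈lahStars n (delete (suc n) z) (Valid-delete n z V)) (∈-extensions-delete (suc n) z (Valid⇒MaxPlacement n z V))

extensions-reading : ∀ n μ → WellFormed n μ → ∀ z → z ∈ extensions (suc n) μ → ∃[ c ] ∃[ p ] ∃[ q ] (reading μ ≡ p ++ q × reading z ≡ p ++ (suc n , c) ∷ q × (c ≡ true → z ≡ snocLastBlock (suc n , true) μ))
extensions-reading n μ w z (here refl) = false , reading μ , [] , sym (++-identityʳ _) , sym (concat-++ μ [ [ (suc n , false) ] ]) , (λ ())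
extensions-reading n μ w z (there (here refl)) = true , reading μ , [] , sym (++-identityʳ _) , reading-snocLastBlock (suc n , true) μ , (λ _ → refl)
extensions-reading n μ (iz , _) z (there (there m)) with blocksInsertions-reading (suc n) μ iz z m
... | p , q , e1 , e2 = false , p , q , e1 , e2 , (λ ())


blockMins-snocLastBlock : ∀ v b bs → All (WellFormedBlock v) (b ∷ bs) → blockMins (snocLastBlock (v , true) (b ∷ bs)) ≡ blockMins (b ∷ bs)
blockMins-snocLastBlock v (x ∷ xs) [] ((_ , _ , sm) ∷ []) = cong (_∷ []) (blockMin-snoc v (x ∷ xs) (λ ()) (λ y m → ℕP.<⇒≤ (sm y m)))
blockMins-snocLastBlock v b (b' ∷ bs) (_ ∷ ibs) = cong (blockMin (vals b) ∷_) (blockMins-snocLastBlock v b' bs ibs)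

blockMin-blockInsertions : ∀ v b → WellFormedBlock v b → ∀ b' → b' ∈ blockInsertions (v , false) b → blockMin (vals b') ≡ blockMin (vals b)
blockMin-blockInsertions v b ib b' m with blockInsertions-shape v b ib b' m | ib
... | [] , [] , refl , refl | ()
... | [] , (y ∷ ys) , refl , refl | (_ , _ , sm) = blockMin-cons-larger v (proj₁ y) ys (ℕP.<⇒≤ (sm _ (here refl)))
... | (x ∷ p) , q , refl , refl | (_ , _ , sm) = blockMin-insert (proj₁ x) (v , false) p q (ℕP.<⇒≤ (sm _ (here refl)))

blockMins-blocksInsertions : ∀ v z → All (WellFormedBlock v) z → ∀ z' → z' ∈ blocksInsertions (v , false) z → blockMins z' ≡ blockMins z
blockMins-blocksInsertions v (b ∷ bs) (ib ∷ ibs) z' m with ∈-++⁻ (map (_∷ bs) (blockInsertions (v , false) b)) m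
... | inj₁ m1 with ∈-map⁻ (_∷ bs) m1
... | b' , bm , refl = cong (_∷ blockMins bs) (blockMin-blockInsertions v b ib b' bm)
blockMins-blocksInsertions v (b ∷ bs) (ib ∷ ibs) z' m | inj₂ m2 with ∈-map⁻ (b ∷_) m2
... | z'' , zm , refl = cong (blockMin (vals b) ∷_) (blockMins-blocksInsertions v bs ibs z'' zm)

Valid⇒blockMins< : ∀ n μ → Valid n μ → All (_< suc n) (blockMins μ)
Valid⇒blockMins< n μ Vμ = All.tabulate (λ {m} mm → mlem m mm)
  where
  module Vm = Valid Vμ
  mlem : ∀ m → m ∈ blockMins μ → m < suc n
  mlem m mm with ∈-map⁻ (blockMin ∘ vals) mm
  ... | b , bm , refl = s≤s (blockMin-≤-bound μ b n bm (Vm.blocks-nonempty b bm) (λ y ym → proj₂ (Vm.in-range y ym)))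

extensions-blockMins-increasing : ∀ n μ → Valid n μ → WellFormed n μ → ∀ z → z ∈ extensions (suc n) μ → StrictlyIncreasing (blockMins z)
extensions-blockMins-increasing n μ Vμ wμ z (here refl) = subst StrictlyIncreasing (sym (blockMins-++ μ [ [ (suc n , false) ] ])) (StrictlyIncreasing-snoc (blockMins μ) (suc n) (Valid.mins-increasing Vμ) (Valid⇒blockMins< n μ Vμ))
extensions-blockMins-increasing n [] Vμ wμ z (there (here refl)) = [] , tt
extensions-blockMins-increasing n (b ∷ bs) Vμ wμ z (there (here refl)) = subst StrictlyIncreasing (sym (blockMins-snocLastBlock (suc n) b bs (proj₁ wμ))) (Valid.mins-increasing Vμ)
extensions-blockMins-increasing n μ Vμ wμ z (there (there m)) = subst StrictlyIncreasing (sym (blockMins-blocksInsertions (suc n) μ (proj₁ wμ) z m)) (Valid.mins-increasing Vμ)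

snocLastBlock-max-isSpecial : ∀ n μ → Valid n μ → isSpecial (snocLastBlock (suc n , true) μ) (suc n) ≡ true
snocLastBlock-max-isSpecial n [] Vμ with Valid.size Vμ
... | refl = refl
snocLastBlock-max-isSpecial n (b ∷ bs) Vμ with snocLastBlock-shape (suc n , true) b bs
... | z1 , b' , d1 , d2 = subst (λ Z → isSpecial Z v ≡ true) (sym d2) spec'
      where
      open Valid Vμ renaming (in-range to v3; covers to v4; blocks-nonempty to v1; size to len)
      v = suc n
      vnz1 : ¬ (v ∈ readVals z1)
      vnz1 m = ℕP.<-irrefl refl (s≤s (proj₂ (v3 v (subst (λ l → v ∈ readVals l) (sym d1) (subst (v ∈_) (sym (readVals-++ z1 [ b' ])) (∈-++⁺ˡ m))))))
      b'm : b' ∈ b ∷ bs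
      b'm = subst (b' ∈_) (sym d1) (∈-++⁺ʳ z1 (here refl))
      bo : blockOf v (z1 ++ [ b' ++ [ (v , true) ] ]) ≡ b' ++ [ (v , true) ]
      bo = blockOf-find v z1 (b' ++ [ (v , true) ]) [] vnz1 (subst (v ∈_) (sym (vals-++ b' [ (v , true) ])) (∈-++⁺ʳ (vals b') (here refl)))
      bmq : blockMin (vals (b' ++ [ (v , true) ])) ≡ blockMin (vals b')
      bmq = blockMin-snoc v b' (v1 b' b'm) (λ y m → ℕP.m≤n⇒m≤1+n (proj₂ (v3 y (∈-block⇒∈-readVals (b ∷ bs) b' y b'm m))))
      bmlt : blockMin (vals b') < v
      bmlt = s≤s (blockMin-≤-bound (b ∷ bs) b' n b'm (v1 b' b'm) (λ y m → proj₂ (v3 y m)))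
      n1 : 1 ≤ n
      n1 = subst (1 ≤_) len (readVals-nonempty b bs (v1 b (here refl)))
      rz' : readVals (z1 ++ [ b' ++ [ (v , true) ] ]) ≡ readVals (b ∷ bs) ++ v ∷ []
      rz' = trans (cong readVals (sym d2)) (trans (cong vals (reading-snocLastBlock (v , true) (b ∷ bs))) (map-++ proj₁ (reading (b ∷ bs)) [ (v , true) ]))
      vnμ : ¬ (v ∈ readVals (b ∷ bs))
      vnμ m = ℕP.<-irrefl refl (s≤s (proj₂ (v3 v m)))
      spec' : isSpecial (z1 ++ [ b' ++ [ (v , true) ] ]) v ≡ true
      spec' = trans (cong ((v ≡ᵇ 1) ∨_) (∧≡true⁺ (≤⇒≤ᵇ≡true (s≤s n1)) (∧≡true⁺ (trans (cong (λ B → not (v ≡ᵇ blockMin (vals B))) bo) (trans (cong (λ m → not (v ≡ᵇ m)) bmq) (≢⇒isNot (λ eq → ℕP.<-irrefl (sym eq) bmlt))))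
                 (all≡true⁺ _ (map suc (upTo n)) (λ j jm → ∈⇒elemᵇ≡true j _ (subst (j ∈_) (sym (trans (cong (takeWhileᵇ (isNot v)) rz') (takeWhileᵇ-isNot-prefix v (readVals (b ∷ bs)) [] vnμ)))
                      (v4 j (proj₁ (∈-range⁻ n j jm)) (proj₂ (∈-range⁻ n j jm))))))))) (∨-zeroʳ (v ≡ᵇ 1))

Valid-extensions : ∀ n μ → Valid n μ → WellFormed n μ → ∀ z → z ∈ extensions (suc n) μ → Valid (suc n) z
Valid-extensions n μ Vμ wμ z zm with extensions-reading n μ wμ z zm
... | c , p , q , reading-μ , reading-z , appended = record
    { blocks-nonempty = WellFormedBlock⇒nonempty (suc v) z (proj₁ wz)
    ; size = trans (length-map proj₁ (reading z)) (proj₂ wz)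
    ; in-range = in-range′
    ; covers = covers′
    ; mins-increasing = extensions-blockMins-increasing n μ Vμ wμ z zm
    ; circled-special = circled-special′
    ; tail-uncircled1 = WellFormedBlock⇒tail-uncircled1 (suc v) z (proj₁ wz) }
  where
  module Vμ = Valid Vμ
  v = suc n
  wz = extensions-wellFormed n μ wμ z zm
  deleted : delete v z ≡ μ
  deleted = delete-extensions n μ wμ z zm
  old-values : ∀ y → y ∈ readVals z → y ≢ v → y ∈ readVals μ
  old-values y m ne = subst (λ l → y ∈ readVals l) deleted (subst (y ∈_) (sym (readVals-delete v z)) (∈-filterᵇ⁺ (isNot v) (readVals z) y m (≢⇒isNot ne)))
  kept-values : ∀ y → y ∈ readVals μ → y ∈ readVals z
  kept-values y m = proj₁ (∈-filterᵇ⁻ (isNot v) (readVals z) y (subst (y ∈_) (readVals-delete v z) (subst (λ l → y ∈ readVals l) (sym deleted) m)))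
  in-range′ : ∀ y → y ∈ readVals z → 1 ≤ y × y ≤ v
  in-range′ y m with y ℕ.≟ v
  ... | yes refl = s≤s z≤n , ℕP.≤-refl
  ... | no ne = proj₁ (Vμ.in-range y (old-values y m ne)) , ℕP.m≤n⇒m≤1+n (proj₂ (Vμ.in-range y (old-values y m ne)))
  covers′ : ∀ i → 1 ≤ i → i ≤ v → i ∈ readVals z
  covers′ i 1≤i i≤v with i ℕ.≟ v
  ... | yes refl = subst (v ∈_) (sym (cong vals reading-z)) (∈-map⁺ proj₁ (∈-++⁺ʳ p (here refl)))
  ... | no ne = kept-values i (Vμ.covers i 1≤i (ℕP.≤-pred (ℕP.≤∧≢⇒< i≤v ne)))
  circled-special′ : ∀ e → e ∈ reading z → proj₂ e ≡ true → isSpecial z (proj₁ e) ≡ true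
  circled-special′ e m ce with ∈-middle⁻ p q (v , c) e (subst (e ∈_) reading-z m)
  ... | inj₁ refl = subst (λ Z → isSpecial Z v ≡ true) (sym (appended ce)) (snocLastBlock-max-isSpecial n μ Vμ)
  ... | inj₂ m′ = trans (sym (isSpecial-delete v z (proj₁ e) (s≤s (proj₂ (Vμ.in-range (proj₁ e) (∈-map⁺ proj₁ e∈μ)))) (λ y m → proj₂ (in-range′ y m))))
                    (trans (cong (λ Z → isSpecial Z (proj₁ e)) deleted) (Vμ.circled-special e e∈μ ce))
    where e∈μ : e ∈ reading μ
          e∈μ = subst (e ∈_) (sym reading-μ) m′

∈lahStars⇒Valid : ∀ n z → z ∈ lahStars n → Valid n z
∈lahStars⇒Valid zero z (here refl) = isLahStar⇒Valid 0 [] refl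
∈lahStars⇒Valid (suc n) z m with ∈-concatMap⁻′ (extensions (suc n)) (lahStars n) z m
... | μ , μm , zm = Valid-extensions n μ (∈lahStars⇒Valid n μ μm) (lahStars-wellFormed n μ μm) z zm

Unique-wordsOf : ∀ (A : List Letter) m → Unique A → Unique (wordsOf A m)
Unique-wordsOf A zero uA = [] ∷ []
Unique-wordsOf A (suc m) uA = Unique-concatMap (λ a → map (a ∷_) (wordsOf A m)) A uA
  (λ a _ → UP.map⁺ ∷-injectiveʳ (Unique-wordsOf A m uA))
  (λ a a' z _ _ m1 m2 → just-injective (trans (sym (head-first a z m1)) (head-first a' z m2)))
  where
  head-first : ∀ a z → z ∈ map (a ∷_) (wordsOf A m) → head z ≡ just a
  head-first a z mm with ∈-map⁻ (a ∷_) mm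
  ... | _ , _ , refl = refl

bools : List Bool
bools = true ∷ false ∷ []

Unique-bools : Unique bools
Unique-bools = ((λ ()) ∷ []) ∷ ([] ∷ [])

∈-bools : ∀ b → b ∈ bools
∈-bools true = here refl
∈-bools false = there (here refl)

Unique-alphabet : ∀ n → Unique (alphabet n)
Unique-alphabet n = Unique-concatMap mid (range n) (range-unique n)
  (λ v _ → Unique-concatMap (inner v) bools Unique-bools (λ c _ → UP.map⁺ {f = λ s → v , c , s} (cong (proj₂ ∘ proj₂)) Unique-bools)
     (λ c c' z _ _ m1 m2 → trans (sym (c-of v c z m1)) (c-of v c' z m2)))
  (λ v v' z _ _ m1 m2 → trans (sym (v-of v z m1)) (v-of v' z m2))
  where
  inner : ℕ → Bool → List Letter
  inner v c = map (λ s → v , c , s) bools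
  mid : ℕ → List Letter
  mid v = concatMap (inner v) bools
  c-of : ∀ v c z → z ∈ inner v c → proj₁ (proj₂ z) ≡ c
  c-of v c z m with ∈-map⁻ (λ s → v , c , s) m
  ... | s , _ , refl = refl
  v-of : ∀ v z → z ∈ mid v → proj₁ z ≡ v
  v-of v z m with ∈-concatMap⁻′ (inner v) bools z m
  ... | c , _ , m' with ∈-map⁻ (λ s → v , c , s) m'
  ... | s , _ , refl = refl

∈-alphabet : ∀ n v c s → 1 ≤ v → v ≤ n → (v , c , s) ∈ alphabet n
∈-alphabet n (suc u) c s _ v≤n = ∈-concatMap⁺′ (λ v → concatMap (λ c → map (λ s → v , c , s) bools) bools) (range n) (suc u) _ (∈-map⁺ suc (∈-upTo⁺ v≤n))
  (∈-concatMap⁺′ (λ c → map (λ s → suc u , c , s) bools) bools c _ (∈-bools c) (∈-map⁺ (λ s → suc u , c , s) (∈-bools s)))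

∈-wordsOf : ∀ (A : List Letter) (w : List Letter) → (∀ a → a ∈ w → a ∈ A) → w ∈ wordsOf A (length w)
∈-wordsOf A [] h = here refl
∈-wordsOf A (a ∷ w) h = ∈-concatMap⁺′ (λ a → map (a ∷_) (wordsOf A (length w))) A a (a ∷ w) (h a (here refl))
  (∈-map⁺ (a ∷_) (∈-wordsOf A w (λ b m → h b (there m))))

innerLetter : Entry → Letter
innerLetter (v , c) = v , c , false

encodeBlock : Block → List Letter
encodeBlock [] = []
encodeBlock ((v , c) ∷ rest) = (v , c , true) ∷ map innerLetter rest

encode : LahStar → List Letter
encode [] = []
encode (b ∷ bs) = encodeBlock b ++ encode bs

encodeSplit : List Entry × LahStar → List Letter
encodeSplit (p , bs) = map innerLetter p ++ encode bs

encodeSplit-split : ∀ w → encodeSplit (split w) ≡ w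
encodeSplit-split [] = refl
encodeSplit-split ((v , c , true) ∷ w) = cong ((v , c , true) ∷_) (encodeSplit-split w)
encodeSplit-split ((v , c , false) ∷ w) = cong ((v , c , false) ∷_) (encodeSplit-split w)

split-innerLetters : ∀ p w → split (map innerLetter p ++ w) ≡ (p ++ proj₁ (split w) , proj₂ (split w))
split-innerLetters [] w = refl
split-innerLetters ((v , c) ∷ p) w = cong (λ q → ((v , c) ∷ proj₁ q) , proj₂ q) (split-innerLetters p w)

split-encode : ∀ v z → All (WellFormedBlock v) z → split (encode z) ≡ ([] , z)
split-encode v [] [] = refl
split-encode v (((x , c) ∷ rest) ∷ bs) (_ ∷ ibs) = trans
  (cong (λ q → [] , ((x , c) ∷ proj₁ q) ∷ proj₂ q)
    (trans (split-innerLetters rest (encode bs)) (cong (λ q → rest ++ proj₁ q , proj₂ q) (split-encode v bs ibs))))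
  (cong (λ l → [] , ((x , c) ∷ l) ∷ bs) (++-identityʳ rest))

null⇒[] : {A : Set} (l : List A) → T (null l) → l ≡ []
null⇒[] [] _ = refl

Unique-candidates : ∀ n → Unique (candidates n)
Unique-candidates n = Unique-map-injectiveOn (proj₂ ∘ split) _ (UP.filter⁺ (T? ∘ (null ∘ proj₁ ∘ split)) (Unique-wordsOf (alphabet n) n (Unique-alphabet n))) inj
  where
  inj : ∀ x y → x ∈ filterᵇ (null ∘ proj₁ ∘ split) (wordsOf (alphabet n) n) → y ∈ filterᵇ (null ∘ proj₁ ∘ split) (wordsOf (alphabet n) n) → proj₂ (split x) ≡ proj₂ (split y) → x ≡ y
  inj x y mx my e with ∈-filter⁻ (T? ∘ (null ∘ proj₁ ∘ split)) {xs = wordsOf (alphabet n) n} mx | ∈-filter⁻ (T? ∘ (null ∘ proj₁ ∘ split)) {xs = wordsOf (alphabet n) n} my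
  ... | _ , tx | _ , ty = trans (sym (encodeSplit-split x)) (trans (cong₂ (λ p bs → map innerLetter p ++ encode bs) (trans (null⇒[] _ tx) (sym (null⇒[] _ ty))) e) (encodeSplit-split y))

length-encodeBlock : ∀ b → length (encodeBlock b) ≡ length b
length-encodeBlock [] = refl
length-encodeBlock ((x , c) ∷ rest) = cong suc (length-map innerLetter rest)

length-encode-reading : ∀ z → length (encode z) ≡ length (reading z)
length-encode-reading [] = refl
length-encode-reading (b ∷ bs) = trans (length-++ (encodeBlock b) {encode bs}) (trans (cong₂ ℕ._+_ (length-encodeBlock b) (length-encode-reading bs)) (sym (length-++ b {concat bs})))

length-encode : ∀ z → length (encode z) ≡ length (readVals z)
length-encode z = trans (length-encode-reading z) (sym (length-map proj₁ (reading z)))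

encode-values : ∀ z a → a ∈ encode z → proj₁ a ∈ readVals z
encode-values ([] ∷ bs) a m = encode-values bs a m
encode-values (((x , c) ∷ rest) ∷ bs) a (here refl) = here refl
encode-values (((x , c) ∷ rest) ∷ bs) a (there m) with ∈-++⁻ (map innerLetter rest) m
... | inj₁ m1 with ∈-map⁻ innerLetter m1
... | e , em , refl = there (subst (proj₁ e ∈_) (sym (map-++ proj₁ rest (concat bs))) (∈-++⁺ˡ (∈-map⁺ proj₁ em)))
encode-values (((x , c) ∷ rest) ∷ bs) a (there m) | inj₂ m2 = there (subst (proj₁ a ∈_) (sym (map-++ proj₁ rest (concat bs))) (∈-++⁺ʳ (map proj₁ rest) (encode-values bs a m2)))

∈-candidates : ∀ n v z → All (WellFormedBlock v) z → length (readVals z) ≡ n → (∀ y → y ∈ readVals z → 1 ≤ y × y ≤ n) → z ∈ candidates n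
∈-candidates n v z iz len rng = subst (_∈ candidates n) (cong proj₂ (split-encode v z iz))
  (∈-map⁺ (proj₂ ∘ split) (∈-filter⁺ (T? ∘ (null ∘ proj₁ ∘ split)) wm (subst (T ∘ null ∘ proj₁) (sym (split-encode v z iz)) tt)))
  where
  wm : encode z ∈ wordsOf (alphabet n) n
  wm = subst (λ k → encode z ∈ wordsOf (alphabet n) k) (trans (length-encode z) len)
        (∈-wordsOf (alphabet n) (encode z) (λ a m → let r = rng (proj₁ a) (encode-values z a m) in ∈-alphabet n (proj₁ a) (proj₁ (proj₂ a)) (proj₂ (proj₂ a)) (proj₁ r) (proj₂ r)))

lahStarCandidates : ℕ → List LahStar
lahStarCandidates n = filterᵇ (isLahStar n) (candidates n)

Unique-lahStarCandidates : ∀ n → Unique (lahStarCandidates n)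
Unique-lahStarCandidates n = UP.filter⁺ (T? ∘ isLahStar n) (Unique-candidates n)

lahStars-complete : ∀ n z → z ∈ lahStarCandidates n → z ∈ lahStars n
lahStars-complete n z m = Valid⇒∈lahStars n z (isLahStar⇒Valid n z (proj₂ (∈-filterᵇ⁻ (isLahStar n) (candidates n) z m)))

lahStars-sound : ∀ n z → z ∈ lahStars n → z ∈ lahStarCandidates n
lahStars-sound n z m = ∈-filterᵇ⁺ (isLahStar n) (candidates n) z
    (∈-candidates n (suc n) z (proj₁ (lahStars-wellFormed n z m)) (Valid.size V) (Valid.in-range V))
    (Valid⇒isLahStar n z V)
  where V = ∈lahStars⇒Valid n z m

-- Block statistics and weights under placing the largest element

nrecOf : Bool → List ℕ → ℕ
nrecOf t u = if t then count (not ∘ proj₂) (markRec u) else length u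

isNonMinRecordLow : ℕ → ℕ × Bool → Bool
isNonMinRecordLow m e = proj₂ e ∧ not (proj₁ e ≡ᵇ m)

recStarOf : Bool → List ℕ → ℕ → ℕ
recStarOf t u m = if t then count (isNonMinRecordLow m) (markRec u) else 0

module _ (v x₁ : ℕ) (xs : Block) (nc : any circled1 xs ≡ false) (sm : Below v ((x₁ , false) ∷ xs)) where
  private
    b : Block
    b = (x₁ , false) ∷ xs
    u : List ℕ
    u = uncirc b
    m : ℕ
    m = blockMin (vals b)
    nT : isTrue b ≡ true
    nT = cong not nc
    mr : markRec (v ∷ u) ≡ (v , true) ∷ markRec u
    mr = markRec-cons-larger v u (λ y mm → sm y (uncirc⊆vals b y mm))

  nrecBlock-cons-larger : nrecBlock ((v , false) ∷ b) ≡ nrecBlock b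
  nrecBlock-cons-larger = begin
    nrecOf (isTrue b) (v ∷ u)              ≡⟨ cong (λ t → nrecOf t (v ∷ u)) nT ⟩
    count (not ∘ proj₂) (markRec (v ∷ u))  ≡⟨ cong (count (not ∘ proj₂)) mr ⟩
    count (not ∘ proj₂) (markRec u)        ≡⟨ cong (λ t → nrecOf t u) nT ⟨
    nrecOf (isTrue b) u                    ∎
    where open ≡-Reasoning

  recStarBlock-cons-larger : recStarBlock ((v , false) ∷ b) ≡ suc (recStarBlock b)
  recStarBlock-cons-larger = begin
    recStarOf (isTrue b) (v ∷ u) (blockMin (v ∷ vals b))                  ≡⟨ cong (λ t → recStarOf t (v ∷ u) (blockMin (v ∷ vals b))) nT ⟩
    count (isNonMinRecordLow (blockMin (v ∷ vals b))) (markRec (v ∷ u))  ≡⟨ cong₂ (λ mm L → count (isNonMinRecordLow mm) L) min-unchanged mr ⟩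
    count (isNonMinRecordLow m) ((v , true) ∷ markRec u)                 ≡⟨ count-middle-true (isNonMinRecordLow m) [] (markRec u) (v , true) (cong not v≢min) ⟩
    suc (count (isNonMinRecordLow m) (markRec u))                        ≡⟨ cong (λ t → suc (recStarOf t u m)) nT ⟨
    suc (recStarOf (isTrue b) u m)                                       ∎
    where
    open ≡-Reasoning
    min-unchanged : blockMin (v ∷ vals b) ≡ m
    min-unchanged = blockMin-cons-larger v x₁ xs (ℕP.<⇒≤ (sm x₁ (here refl)))
    v≢min : (v ≡ᵇ m) ≡ false
    v≢min = ≢⇒≡ᵇ≡false (λ eq → ℕP.<-irrefl (sym eq) (sm _ (blockMin-∈ x₁ (vals xs))))

module _ (v x₁ : ℕ) (p q : Block) (nc : any circled1 (p ++ q) ≡ false) (sm : Below v ((x₁ , false) ∷ p ++ q)) where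
  private
    e : Entry
    e = (v , false)
    b1 b2 : Block
    b1 = (x₁ , false) ∷ p ++ q
    b2 = (x₁ , false) ∷ p ++ e ∷ q
    U1 U2 : List ℕ
    U1 = uncirc p
    U2 = uncirc q
    nT1 : isTrue b1 ≡ true
    nT1 = cong not nc
    nT2 : isTrue b2 ≡ true
    nT2 = cong not (trans (any-circled1-insert p q e refl) nc)
    u2 : uncirc b2 ≡ x₁ ∷ (U1 ++ v ∷ U2)
    u2 = cong (x₁ ∷_) (uncirc-++ p (e ∷ q))
    u1 : uncirc b1 ≡ x₁ ∷ (U1 ++ U2)
    u1 = cong (x₁ ∷_) (uncirc-++ p q)
    x<v : x₁ < v
    x<v = sm x₁ (here refl)
    A B : List (ℕ × Bool)
    A = (x₁ , true) ∷ markRecGo [ x₁ ] U1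
    B = markRecGo (x₁ ∷ U1) U2
    -- v is no record low (x₁ precedes it), and being the largest value it changes no other mark
    mr2 : markRec (x₁ ∷ (U1 ++ v ∷ U2)) ≡ A ++ (v , false) ∷ B
    mr2 = cong ((x₁ , true) ∷_) (trans (markRecGo-++ [ x₁ ] U1 (v ∷ U2))
            (cong (markRecGo [ x₁ ] U1 ++_) (cong₂ _∷_ (cong (v ,_) (cong (λ t → not t ∧ isRecordLow U1 v) (<⇒<ᵇ≡true x<v)))
               (markRecGo-cong-prefix v ((x₁ ∷ U1) ++ [ v ]) (x₁ ∷ U1) U2 (λ x x<v' → isRecordLow-snoc-larger v (x₁ ∷ U1) x x<v')
                 (λ y m → sm y (there (∈-vals-++⁺ʳ p q y (uncirc⊆vals q y m))))))))
    mr1 : markRec (x₁ ∷ (U1 ++ U2)) ≡ A ++ B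
    mr1 = cong ((x₁ , true) ∷_) (markRecGo-++ [ x₁ ] U1 U2)

  nrecBlock-insert-true : nrecBlock b2 ≡ suc (nrecBlock b1)
  nrecBlock-insert-true = begin
    nrecOf (isTrue b2) (uncirc b2)                       ≡⟨ cong₂ nrecOf nT2 u2 ⟩
    count (not ∘ proj₂) (markRec (x₁ ∷ (U1 ++ v ∷ U2)))  ≡⟨ cong (count (not ∘ proj₂)) mr2 ⟩
    count (not ∘ proj₂) (A ++ (v , false) ∷ B)           ≡⟨ count-middle-true (not ∘ proj₂) A B (v , false) refl ⟩
    suc (count (not ∘ proj₂) (A ++ B))                   ≡⟨ cong (λ L → suc (count (not ∘ proj₂) L)) mr1 ⟨
    suc (nrecOf true (x₁ ∷ (U1 ++ U2)))                  ≡⟨ cong suc (cong₂ nrecOf nT1 u1) ⟨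
    suc (nrecOf (isTrue b1) (uncirc b1))                 ∎
    where open ≡-Reasoning

  recStarBlock-insert-true : recStarBlock b2 ≡ recStarBlock b1
  recStarBlock-insert-true = begin
    recStarOf (isTrue b2) (uncirc b2) (blockMin (vals b2))                          ≡⟨ cong₂ (λ t L → recStarOf t L (blockMin (vals b2))) nT2 u2 ⟩
    count (isNonMinRecordLow (blockMin (vals b2))) (markRec (x₁ ∷ (U1 ++ v ∷ U2)))  ≡⟨ cong₂ (λ mm L → count (isNonMinRecordLow mm) L) min-unchanged mr2 ⟩
    count (isNonMinRecordLow m) (A ++ (v , false) ∷ B)                              ≡⟨ count-middle-false (isNonMinRecordLow m) A B (v , false) refl ⟩
    count (isNonMinRecordLow m) (A ++ B)                                            ≡⟨ cong (count (isNonMinRecordLow m)) mr1 ⟨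
    recStarOf true (x₁ ∷ (U1 ++ U2)) m                                              ≡⟨ cong₂ (λ t L → recStarOf t L m) nT1 u1 ⟨
    recStarOf (isTrue b1) (uncirc b1) m                                             ∎
    where
    open ≡-Reasoning
    m : ℕ
    m = blockMin (vals b1)
    min-unchanged : blockMin (vals b2) ≡ m
    min-unchanged = blockMin-insert x₁ e p q (ℕP.<⇒≤ x<v)

nrecBlock-insert-circled1 : ∀ v p q → nrecBlock ((1 , true) ∷ p ++ (v , false) ∷ q) ≡ suc (nrecBlock ((1 , true) ∷ p ++ q))
nrecBlock-insert-circled1 v p q = begin
  length (uncirc (p ++ (v , false) ∷ q))     ≡⟨ cong length (uncirc-++ p ((v , false) ∷ q)) ⟩
  length (uncirc p ++ v ∷ uncirc q)          ≡⟨ length-++ (uncirc p) ⟩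
  length (uncirc p) ℕ.+ suc (length (uncirc q)) ≡⟨ ℕP.+-suc (length (uncirc p)) _ ⟩
  suc (length (uncirc p) ℕ.+ length (uncirc q)) ≡⟨ cong suc (length-++ (uncirc p)) ⟨
  suc (length (uncirc p ++ uncirc q))        ≡⟨ cong (suc ∘ length) (uncirc-++ p q) ⟨
  suc (length (uncirc (p ++ q)))             ∎
  where open ≡-Reasoning

module _ (v : ℕ) (x : Entry) (xs : Block) (v≢1 : (v ≡ᵇ 1) ≡ false) where
  private
    b b2 : Block
    b = x ∷ xs
    b2 = b ++ [ (v , true) ]
    same-truth : isTrue b2 ≡ isTrue b
    same-truth = cong not (trans (any-++ circled1 b [ (v , true) ]) (trans (cong (λ t → any circled1 b ∨ (t ∨ false)) v≢1) (∨-identityʳ _)))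
    same-uncircled : uncirc b2 ≡ uncirc b
    same-uncircled = trans (uncirc-++ b [ (v , true) ]) (++-identityʳ _)

  nrecBlock-snoc-circled : nrecBlock b2 ≡ nrecBlock b
  nrecBlock-snoc-circled = cong₂ nrecOf same-truth same-uncircled

  recStarBlock-snoc-circled : Below v b → recStarBlock b2 ≡ recStarBlock b
  recStarBlock-snoc-circled sm = trans (cong₂ (λ t L → recStarOf t L (blockMin (vals b2))) same-truth same-uncircled)
                                      (cong (recStarOf (isTrue b) (uncirc b)) same-min)
    where
    same-min : blockMin (vals b2) ≡ blockMin (vals b)
    same-min = trans (blockMin-insert (proj₁ x) (v , true) xs [] (ℕP.<⇒≤ (sm _ (here refl))))
                     (cong (λ L → blockMin (proj₁ x ∷ vals L)) (++-identityʳ xs))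

module Weights (α β : ℤ) (r : ℕ) where

  blockWeight : Block → ℤ
  blockWeight b = α ^ nrecBlock b * β ^ recStarBlock b * (+ r) ^ count proj₂ b

  weightProduct : LahStar → ℤ
  weightProduct [] = + 1
  weightProduct (b ∷ bs) = blockWeight b * weightProduct bs

  weight≡weightProduct : ∀ z → weight α β r z ≡ weightProduct z
  weight≡weightProduct [] = refl
  weight≡weightProduct (b ∷ bs) rewrite count-++ proj₂ b (concat bs)
    | ℤP.^-distribˡ-+-* α (nrecBlock b) (nrec bs)
    | ℤP.^-distribˡ-+-* β (recStarBlock b) (recStar bs)
    | ℤP.^-distribˡ-+-* (+ r) (count proj₂ b) (circ bs)
    = trans (regroup (α ^ nrecBlock b) (α ^ nrec bs) (β ^ recStarBlock b) (β ^ recStar bs) ((+ r) ^ count proj₂ b) ((+ r) ^ circ bs))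
            (cong (blockWeight b *_) (weight≡weightProduct bs))
    where regroup : (a a' b b' c c' : ℤ) → a * a' * (b * b') * (c * c') ≡ a * b * c * (a' * b' * c')
          regroup = solve-∀

  weightProduct-++ : ∀ xs ys → weightProduct (xs ++ ys) ≡ weightProduct xs * weightProduct ys
  weightProduct-++ [] ys = sym (ℤP.*-identityˡ _)
  weightProduct-++ (b ∷ xs) ys = trans (cong (blockWeight b *_) (weightProduct-++ xs ys)) (sym (ℤP.*-assoc (blockWeight b) _ _))

  monomial : ℕ → ℕ → ℕ → ℤ
  monomial a b c = α ^ a * β ^ b * (+ r) ^ c

  monomial-cong : ∀ {a1 a2 b1 b2 c1 c2 : ℕ} → a1 ≡ a2 → b1 ≡ b2 → c1 ≡ c2 → monomial a1 b1 c1 ≡ monomial a2 b2 c2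
  monomial-cong refl refl refl = refl

  blockWeight-β : ∀ b2 b1 → nrecBlock b2 ≡ nrecBlock b1 → recStarBlock b2 ≡ suc (recStarBlock b1) → count proj₂ b2 ≡ count proj₂ b1 → blockWeight b2 ≡ β * blockWeight b1
  blockWeight-β b2 b1 e1 e2 e3 = trans (monomial-cong e1 e2 e3) (identity β (α ^ nrecBlock b1) (β ^ recStarBlock b1) ((+ r) ^ count proj₂ b1))
    where identity : (bb a b c : ℤ) → a * (bb * b) * c ≡ bb * (a * b * c)
          identity = solve-∀

  blockWeight-α : ∀ b2 b1 → nrecBlock b2 ≡ suc (nrecBlock b1) → recStarBlock b2 ≡ recStarBlock b1 → count proj₂ b2 ≡ count proj₂ b1 → blockWeight b2 ≡ α * blockWeight b1
  blockWeight-α b2 b1 e1 e2 e3 = trans (monomial-cong e1 e2 e3) (identity α (α ^ nrecBlock b1) (β ^ recStarBlock b1) ((+ r) ^ count proj₂ b1))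
    where identity : (aa a b c : ℤ) → aa * a * b * c ≡ aa * (a * b * c)
          identity = solve-∀

  blockWeight-r : ∀ b2 b1 → nrecBlock b2 ≡ nrecBlock b1 → recStarBlock b2 ≡ recStarBlock b1 → count proj₂ b2 ≡ suc (count proj₂ b1) → blockWeight b2 ≡ + r * blockWeight b1
  blockWeight-r b2 b1 e1 e2 e3 = trans (monomial-cong e1 e2 e3) (identity (+ r) (α ^ nrecBlock b1) (β ^ recStarBlock b1) ((+ r) ^ count proj₂ b1))
    where identity : (rr a b c : ℤ) → a * b * (rr * c) ≡ rr * (a * b * c)
          identity = solve-∀

  blockWeight-cons-larger : ∀ v x₁ xs → any circled1 xs ≡ false → Below v ((x₁ , false) ∷ xs) →
    blockWeight ((v , false) ∷ (x₁ , false) ∷ xs) ≡ β * blockWeight ((x₁ , false) ∷ xs)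
  blockWeight-cons-larger v x₁ xs nc sm = blockWeight-β ((v , false) ∷ (x₁ , false) ∷ xs) ((x₁ , false) ∷ xs) (nrecBlock-cons-larger v x₁ xs nc sm) (recStarBlock-cons-larger v x₁ xs nc sm) refl

  blockWeight-insert-true : ∀ v x₁ p q → any circled1 (p ++ q) ≡ false → Below v ((x₁ , false) ∷ p ++ q) →
    blockWeight ((x₁ , false) ∷ p ++ (v , false) ∷ q) ≡ α * blockWeight ((x₁ , false) ∷ p ++ q)
  blockWeight-insert-true v x₁ p q nc sm = blockWeight-α ((x₁ , false) ∷ p ++ (v , false) ∷ q) ((x₁ , false) ∷ p ++ q) (nrecBlock-insert-true v x₁ p q nc sm) (recStarBlock-insert-true v x₁ p q nc sm)
    (count-circled-insert p q (v , false) refl)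

  blockWeight-insert-circled1 : ∀ v p q → blockWeight ((1 , true) ∷ p ++ (v , false) ∷ q) ≡ α * blockWeight ((1 , true) ∷ p ++ q)
  blockWeight-insert-circled1 v p q = blockWeight-α ((1 , true) ∷ p ++ (v , false) ∷ q) ((1 , true) ∷ p ++ q) (nrecBlock-insert-circled1 v p q) refl (cong suc (count-circled-insert p q (v , false) refl))

  blockWeight-snoc-circled : ∀ v x xs → (v ≡ᵇ 1) ≡ false → Below v (x ∷ xs) → blockWeight ((x ∷ xs) ++ [ (v , true) ]) ≡ + r * blockWeight (x ∷ xs)
  blockWeight-snoc-circled v x xs v≢1 sm = blockWeight-r ((x ∷ xs) ++ [ (v , true) ]) (x ∷ xs) (nrecBlock-snoc-circled v x xs v≢1) (recStarBlock-snoc-circled v x xs v≢1 sm)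
    (trans (count-++ proj₂ (x ∷ xs) [ (v , true) ]) (ℕP.+-comm _ 1))

  insertionFactor : Block → ℤ
  insertionFactor b = (if isTrue b then β else + 0) + + length b * α

  sum-blockInsertions : ∀ v b → WellFormedBlock v b → sumMap blockWeight (blockInsertions (v , false) b) ≡ insertionFactor b * blockWeight b
  sum-blockInsertions v ((x₁ , false) ∷ xs) (h , t , sm) =
    begin
      blockWeight (e ∷ b) + sumMap blockWeight (map ((x₁ , false) ∷_) (insertions e xs))
    ≡⟨ cong₂ _+_ (blockWeight-cons-larger v x₁ xs nc sm) (trans (sumMap-map blockWeight ((x₁ , false) ∷_) (insertions e xs))
          (sumMap-const _ (α * blockWeight b) (insertions e xs) later-insertion)) ⟩
      β * blockWeight b + + length (insertions e xs) * (α * blockWeight b)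
    ≡⟨ cong (λ L → β * blockWeight b + + L * (α * blockWeight b)) (length-insertions e xs) ⟩
      β * blockWeight b + + suc (length xs) * (α * blockWeight b)
    ≡⟨ identity β α (+ suc (length xs)) (blockWeight b) ⟩
      (β + + suc (length xs) * α) * blockWeight b
    ≡⟨ cong (λ t → ((if not t then β else + 0) + + suc (length xs) * α) * blockWeight b) (sym nc) ⟩
      insertionFactor b * blockWeight b ∎
    where
    open ≡-Reasoning
    e = (v , false)
    b = (x₁ , false) ∷ xs
    nc = all-not⇒any≡false xs t
    identity : (bb aa l w : ℤ) → bb * w + l * (aa * w) ≡ (bb + l * aa) * w
    identity = solve-∀
    later-insertion : ∀ b' → b' ∈ insertions e xs → blockWeight ((x₁ , false) ∷ b') ≡ α * blockWeight b
    later-insertion b' m with insertions-shape e xs b' m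
    ... | p , q , refl , refl = blockWeight-insert-true v x₁ p q nc sm
  sum-blockInsertions v ((x₁ , true) ∷ xs) (h , t , sm) with h refl
  ... | refl =
    begin
      sumMap blockWeight (map ((1 , true) ∷_) (insertions e xs))
    ≡⟨ trans (sumMap-map blockWeight ((1 , true) ∷_) (insertions e xs)) (sumMap-const _ (α * blockWeight b) (insertions e xs) later-insertion) ⟩
      + length (insertions e xs) * (α * blockWeight b)
    ≡⟨ cong (λ L → + L * (α * blockWeight b)) (length-insertions e xs) ⟩
      + suc (length xs) * (α * blockWeight b)
    ≡⟨ identity α (+ suc (length xs)) (blockWeight b) ⟩
      insertionFactor b * blockWeight b ∎
    where
    open ≡-Reasoning
    e = (v , false)
    b = (1 , true) ∷ xs
    identity : (aa l w : ℤ) → l * (aa * w) ≡ (+ 0 + l * aa) * w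
    identity = solve-∀
    later-insertion : ∀ b' → b' ∈ insertions e xs → blockWeight ((1 , true) ∷ b') ≡ α * blockWeight b
    later-insertion b' m with insertions-shape e xs b' m
    ... | p , q , refl , refl = blockWeight-insert-circled1 v p q

  sum-blocksInsertions : ∀ v z → All (WellFormedBlock v) z → sumMap weightProduct (blocksInsertions (v , false) z) ≡ (+ numTrue z * β + + length (reading z) * α) * weightProduct z
  sum-blocksInsertions v [] [] = refl
  sum-blocksInsertions v (b ∷ bs) (ib ∷ ibs) =
    begin
      sumMap weightProduct (map (_∷ bs) (blockInsertions e b) ++ map (b ∷_) (blocksInsertions e bs))
    ≡⟨ sumMap-++ weightProduct (map (_∷ bs) (blockInsertions e b)) (map (b ∷_) (blocksInsertions e bs)) ⟩
      sumMap weightProduct (map (_∷ bs) (blockInsertions e b)) + sumMap weightProduct (map (b ∷_) (blocksInsertions e bs))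
    ≡⟨ cong₂ _+_ (trans (sumMap-map weightProduct (_∷ bs) (blockInsertions e b)) (sumMap-*ʳ blockWeight (weightProduct bs) (blockInsertions e b)))
                 (trans (sumMap-map weightProduct (b ∷_) (blocksInsertions e bs)) (sumMap-*ˡ (blockWeight b) weightProduct (blocksInsertions e bs))) ⟩
      sumMap blockWeight (blockInsertions e b) * weightProduct bs + blockWeight b * sumMap weightProduct (blocksInsertions e bs)
    ≡⟨ cong₂ (λ s t → s * weightProduct bs + blockWeight b * t) (sum-blockInsertions v b ib) (sum-blocksInsertions v bs ibs) ⟩
      insertionFactor b * blockWeight b * weightProduct bs + blockWeight b * ((+ numTrue bs * β + + length (reading bs) * α) * weightProduct bs)
    ≡⟨ regroup ⟩
      (+ numTrue (b ∷ bs) * β + + length (reading (b ∷ bs)) * α) * (blockWeight b * weightProduct bs) ∎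
    where
    open ≡-Reasoning
    e = (v , false)
    regroup : insertionFactor b * blockWeight b * weightProduct bs + blockWeight b * ((+ numTrue bs * β + + length (reading bs) * α) * weightProduct bs)
        ≡ (+ numTrue (b ∷ bs) * β + + length (reading (b ∷ bs)) * α) * (blockWeight b * weightProduct bs)
    regroup = begin
        insertionFactor b * blockWeight b * weightProduct bs + blockWeight b * ((+ numTrue bs * β + + length (reading bs) * α) * weightProduct bs)
      ≡⟨ cong (λ F → (F + + length b * α) * blockWeight b * weightProduct bs + blockWeight b * ((+ numTrue bs * β + + length (reading bs) * α) * weightProduct bs)) (if-β (isTrue b)) ⟩
        (+ boolToℕ (isTrue b) * β + + length b * α) * blockWeight b * weightProduct bs + blockWeight b * ((+ numTrue bs * β + + length (reading bs) * α) * weightProduct bs)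
      ≡⟨ identity β α (+ boolToℕ (isTrue b)) (+ numTrue bs) (+ length b) (+ length (concat bs)) (blockWeight b) (weightProduct bs) ⟩
        ((+ boolToℕ (isTrue b) + + numTrue bs) * β + (+ length b + + length (concat bs)) * α) * (blockWeight b * weightProduct bs)
      ≡⟨ cong₂ (λ N L → (N * β + L * α) * (blockWeight b * weightProduct bs))
           (trans (sym (ℤP.pos-+ (boolToℕ (isTrue b)) (numTrue bs))) (cong +_ (sym (numTrue-∷ b bs))))
           (trans (sym (ℤP.pos-+ (length b) (length (concat bs)))) (cong +_ (sym (length-++ b {concat bs})))) ⟩
        (+ numTrue (b ∷ bs) * β + + length (reading (b ∷ bs)) * α) * (blockWeight b * weightProduct bs) ∎
      where
      if-β : ∀ t → (if t then β else + 0) ≡ + boolToℕ t * β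
      if-β true = sym (ℤP.*-identityˡ β)
      if-β false = sym (ℤP.*-zeroˡ β)
      identity : (bb aa t n lb l w p : ℤ) → (t * bb + lb * aa) * w * p + w * ((n * bb + l * aa) * p) ≡ ((t + n) * bb + (lb + l) * aa) * (w * p)
      identity = solve-∀

  weightIfTrue : ℕ → LahStar → ℤ
  weightIfTrue k z = if numTrue z ≡ᵇ k then weightProduct z else + 0

  coeff : ℕ → ℕ → ℤ
  coeff n k = + k * β + + n * α + + r

  blockWeight-singleton : ∀ v → blockWeight [ (v , false) ] ≡ + 1
  blockWeight-singleton v = cong (λ t → α ^ 0 * β ^ t * (+ r) ^ 0) (count-middle-false (isNonMinRecordLow v) [] [] (v , true) (cong not (≡ᵇ-refl v)))

  weightProduct-snocLastBlock-∷ : ∀ v b bs → (v ≡ᵇ 1) ≡ false → All (WellFormedBlock v) (b ∷ bs) →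
             (weightProduct (snocLastBlock (v , true) (b ∷ bs)) ≡ + r * weightProduct (b ∷ bs)) × (numTrue (snocLastBlock (v , true) (b ∷ bs)) ≡ numTrue (b ∷ bs))
  weightProduct-snocLastBlock-∷ v (x ∷ xs) [] v1 ((h , t , sm) ∷ []) =
    trans (cong (_* + 1) (blockWeight-snoc-circled v x xs v1 sm)) (ℤP.*-assoc (+ r) _ _) ,
    trans (numTrue-∷ ((x ∷ xs) ++ [ (v , true) ]) []) (trans (cong (λ t → boolToℕ t ℕ.+ 0) (isTrue-snoc-circled (x ∷ xs) v v1)) (sym (numTrue-∷ (x ∷ xs) [])))
  weightProduct-snocLastBlock-∷ v b (b' ∷ bs) v1 (ib ∷ ibs) with weightProduct-snocLastBlock-∷ v b' bs v1 ibs
  ... | p1 , p2 = trans (cong (blockWeight b *_) p1) (identity (blockWeight b) (+ r) (weightProduct (b' ∷ bs))) ,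
                  trans (numTrue-∷ b (snocLastBlock (v , true) (b' ∷ bs))) (trans (cong (boolToℕ (isTrue b) ℕ.+_) p2) (sym (numTrue-∷ b (b' ∷ bs))))
    where identity : (a rr p : ℤ) → a * (rr * p) ≡ rr * (a * p)
          identity = solve-∀

  combine-appended-inserted : ∀ (t : Bool) (X P A : ℤ) (C : ℤ) → (t ≡ true → A + + r ≡ C) →
         X + ((if t then + r * P else + 0) + ((if t then A * P else + 0) + + 0)) ≡ X + (if t then C * P else + 0)
  combine-appended-inserted true X P A C h = cong (λ w → X + w) (trans (identity (+ r) P A) (cong (_* P) (h refl)))
    where identity : (rr p a : ℤ) → rr * p + (a * p + + 0) ≡ (a + rr) * p
          identity = solve-∀
  combine-appended-inserted false X P A C h = refl

  weightProduct-snocLastBlock : ∀ n z → WellFormed n z → (weightProduct (snocLastBlock (suc n , true) z) ≡ + r * weightProduct z) × (numTrue (snocLastBlock (suc n , true) z) ≡ numTrue z)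
  weightProduct-snocLastBlock n [] ([] , refl) = identity (+ r) , refl
      where identity : (rr : ℤ) → (+ 1 * + 1 * (rr * + 1)) * + 1 ≡ rr * + 1
            identity = solve-∀
  weightProduct-snocLastBlock n (b ∷ bs) (wf , size) = weightProduct-snocLastBlock-∷ (suc n) b bs (≢⇒≡ᵇ≡false (λ eq → wellFormed-size≢0 (suc n) b bs wf (trans size (ℕP.suc-injective eq)))) wf

  sum-extensions : ∀ n z k → WellFormed n z → sumMap (weightIfTrue k) (extensions (suc n) z) ≡ (if suc (numTrue z) ≡ᵇ k then weightProduct z else + 0) + (if numTrue z ≡ᵇ k then coeff n k * weightProduct z else + 0)
  sum-extensions n z k (wf , size) =
    begin
      weightIfTrue k newBlock + (weightIfTrue k appended + sumMap (weightIfTrue k) (blocksInsertions e z))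
    ≡⟨ cong₂ (λ a b → a + (b + sumMap (weightIfTrue k) (blocksInsertions e z))) newBlock-term appended-term ⟩
      X + ((if t then + r * P else + 0) + sumMap (weightIfTrue k) (blocksInsertions e z))
    ≡⟨ cong (λ w → X + ((if t then + r * P else + 0) + w)) inserted-term ⟩
      X + ((if t then + r * P else + 0) + ((if t then (+ numTrue z * β + + n * α) * P else + 0) + + 0))
    ≡⟨ combine-appended-inserted t X P (+ numTrue z * β + + n * α) (coeff n k) (λ eq → cong (λ q → + q * β + + n * α + + r) (≡ᵇ≡true⇒≡ {numTrue z} {k} eq)) ⟩
      X + (if t then coeff n k * P else + 0) ∎
    where
    open ≡-Reasoning
    v = suc n
    e = (v , false)
    newBlock = z ++ [ [ e ] ]
    appended = snocLastBlock (v , true) z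
    P = weightProduct z
    t = numTrue z ≡ᵇ k
    X = if suc (numTrue z) ≡ᵇ k then P else + 0
    newBlock-term : weightIfTrue k newBlock ≡ X
    newBlock-term = cong₂ (λ q w → if q ≡ᵇ k then w else + 0)
            (trans (count-++ isTrue z [ [ e ] ]) (ℕP.+-comm _ 1))
            (trans (weightProduct-++ z [ [ e ] ]) (trans (cong (λ w → P * (w * + 1)) (blockWeight-singleton v)) (ℤP.*-identityʳ P)))
    appended-weight = weightProduct-snocLastBlock n z (wf , size)
    appended-term : weightIfTrue k appended ≡ (if t then + r * P else + 0)
    appended-term = cong₂ (λ q w → if q ≡ᵇ k then w else + 0) (proj₂ appended-weight) (proj₁ appended-weight)
    inserted-term : sumMap (weightIfTrue k) (blocksInsertions e z) ≡ ((if t then (+ numTrue z * β + + n * α) * P else + 0) + + 0)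
    inserted-term = trans (sumMap-cong (weightIfTrue k) (λ z' → if t then weightProduct z' else + 0) (blocksInsertions e z)
                    (λ z' m → cong (λ q → if q ≡ᵇ k then weightProduct z' else + 0) (blocksInsertions-numTrue v z wf z' m)))
          (trans (sumMap-if t weightProduct (blocksInsertions e z))
          (trans (cong (λ w → if t then w else + 0) (trans (sum-blocksInsertions v z wf) (cong (λ L → (+ numTrue z * β + + L * α) * P) size)))
          (sym (ℤP.+-identityʳ _))))

  lahStarsSum : ℕ → ℕ → ℤ
  lahStarsSum n k = sumMap (weightIfTrue k) (lahStars n)

  lahStarsSum-0-0 : lahStarsSum 0 0 ≡ + 1
  lahStarsSum-0-0 = refl

  lahStarsSum-above-diagonal : ∀ n k → n < k → lahStarsSum n k ≡ + 0
  lahStarsSum-above-diagonal n k n<k = trans (sumMap-cong (weightIfTrue k) (λ _ → + 0) (lahStars n) f) (sumMap-zero (lahStars n))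
    where f : ∀ z → z ∈ lahStars n → weightIfTrue k z ≡ + 0
          f z m with lahStars-wellFormed n z m
          ... | wf , size = cong (λ t → if t then weightProduct z else + 0)
                 (≢⇒≡ᵇ≡false {numTrue z} {k} (λ eq → ℕP.<-irrefl eq (ℕP.≤-<-trans (subst (numTrue z ≤_) size (numTrue≤size (suc n) z wf)) n<k)))

  lahStarsSum-suc : ∀ n k → lahStarsSum (suc n) k ≡ sumMap (λ z → (if suc (numTrue z) ≡ᵇ k then weightProduct z else + 0) + (if numTrue z ≡ᵇ k then coeff n k * weightProduct z else + 0)) (lahStars n)
  lahStarsSum-suc n k = trans (sumMap-concatMap (weightIfTrue k) (extensions (suc n)) (lahStars n)) (sumMap-cong _ _ (lahStars n) (λ z m → sum-extensions n z k (lahStars-wellFormed n z m)))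

  if-*ʳ-zero : ∀ (t : Bool) (c p : ℤ) → (if t then c * p else + 0) ≡ c * (if t then p else + 0)
  if-*ʳ-zero true c p = refl
  if-*ʳ-zero false c p = sym (ℤP.*-zeroʳ c)

  lahStarsSum-suc-0 : ∀ n → lahStarsSum (suc n) 0 ≡ (+ 0 * β + + n * α + + r) * lahStarsSum n 0
  lahStarsSum-suc-0 n = trans (lahStarsSum-suc n 0) (trans (sumMap-cong _ _ (lahStars n) (λ z _ → trans (ℤP.+-identityˡ _) (if-*ʳ-zero (numTrue z ≡ᵇ 0) (coeff n 0) (weightProduct z))))
                (sumMap-*ˡ (coeff n 0) (weightIfTrue 0) (lahStars n)))

  lahStarsSum-suc-suc : ∀ n k → lahStarsSum (suc n) (suc k) ≡ lahStarsSum n k + (+ suc k * β + + n * α + + r) * lahStarsSum n (suc k)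
  lahStarsSum-suc-suc n k = trans (lahStarsSum-suc n (suc k)) (trans (sumMap-cong _ _ (lahStars n) (λ z _ → cong (λ w → weightIfTrue k z + w) (if-*ʳ-zero (numTrue z ≡ᵇ suc k) (coeff n (suc k)) (weightProduct z))))
                 (trans (sumMap-+ (weightIfTrue k) (λ z → coeff n (suc k) * weightIfTrue (suc k) z) (lahStars n)) (cong (λ w → lahStarsSum n k + w) (sumMap-*ˡ (coeff n (suc k)) (weightIfTrue (suc k)) (lahStars n)))))

  lahStarSum≡lahStarsSum : ∀ n k → lahStarSum α β r n k ≡ lahStarsSum n k
  lahStarSum≡lahStarsSum n k = begin
      sumMap (weight α β r) (filterᵇ (λ z → isLahStar n z ∧ (numTrue z ≡ᵇ k)) (candidates n))
    ≡⟨ sumMap-filterᵇ (weight α β r) _ (candidates n) ⟩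
      sumMap (λ z → if isLahStar n z ∧ (numTrue z ≡ᵇ k) then weight α β r z else + 0) (candidates n)
    ≡⟨ sumMap-cong _ _ (candidates n) (λ z _ → trans (if-∧ (isLahStar n z)) (cong (λ w → if isLahStar n z then (if numTrue z ≡ᵇ k then w else + 0) else + 0) (weight≡weightProduct z))) ⟩
      sumMap (λ z → if isLahStar n z then weightIfTrue k z else + 0) (candidates n)
    ≡⟨ sumMap-filterᵇ (weightIfTrue k) (isLahStar n) (candidates n) ⟨
      sumMap (weightIfTrue k) (filterᵇ (isLahStar n) (candidates n))
    ≡⟨ sumMap-sameElements (weightIfTrue k) _ (lahStars n) (Unique-lahStarCandidates n) (Unique-lahStars n) (lahStars-complete n) (lahStars-sound n) ⟩
      sumMap (weightIfTrue k) (lahStars n) ∎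
    where open ≡-Reasoning

expansion-cong : ∀ {α β r} {S S′ : ℕ → ℕ → ℤ} → (∀ n k → S n k ≡ S′ n k) → HsuShiueExpansion α β r S′ → HsuShiueExpansion α β r S
expansion-cong {β = β} {r} {S} {S′} S≡S′ expand n x = trans (expand n x) (cong (foldr _+_ (+ 0)) (map-cong (λ k → cong (_* fall (x - + r) β k) (sym (S≡S′ n k))) (upTo (suc n))))

lemma3p7 : (α β : ℤ) (r : ℕ) → HsuShiueExpansion α β r (lahStarSum α β r)
lemma3p7 α β r = expansion-cong lahStarSum≡lahStarsSum
  (HsuShiueRecurrence.expansion α β r lahStarsSum lahStarsSum-0-0 lahStarsSum-above-diagonal lahStarsSum-suc-0 lahStarsSum-suc-suc)
  where open Weights α β r
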